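{- Let $\alpha_1,\dots,\alpha_n\in\mathbb{Q}^d$ be linearly independent, $A=(\alpha_1,\dots,\alpha_n)$, $K=\mathscr{C}(A)$. Let $1\le r\le n$, $k\in\{0,\dots,r\}$, and $\gamma=p_1\alpha_1+\cdots+p_k\alpha_k-p_{k+1}\alpha_{k+1}-\cdots-p_r\alpha_r$ with all $p_i\in\mathbb{Q}_{>0}$. For $1\le i\le k$ let $$K_i=\Big\{t_i\gamma+\sum_{l\ne i}t_l\alpha_l : t_l>0 \text{ for } 1\le l\le i-1,\ t_l\ge 0 \text{ otherwise (including } t_i\ge0)\Big\},$$ and for $k+1\le j\le r$ let $$K_j=\Big\{t_j(-\gamma)+\sum_{l\ne j}t_l\alpha_l : t_l>0 \text{ for } k+1\le l\le j-1,\ t_l\ge 0 \text{ otherwise (including } t_j\ge0)\Big\}.$$ Then $$\sigma(K)=\sum_{i=1}^{k}\sigma(K_i)+\sum_{j=k+1}^{r}\sigma(K_j).$$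
   Context: For $S\subset\mathbb{R}^d$, $\sigma(S;\mathbf{y})=\sum_{\mathbf{m}\in S\cap\mathbb{Z}^d}\mathbf{y}^{\mathbf{m}}$; for rational polyhedra (including half-open ones such as the sets above) this is identified with the rational function it represents (a valuation, additive on disjoint unions, with $\sigma(P)=0$ when the rational polyhedron $P$ contains a line); equalities are equalities of rational functions. $\mathscr{C}(A)=\{\sum_i k_i\alpha_i: k_i\ge0\}$. (In the paper's notation, $K_i=\mathscr{C}^{[i-1]}(A[(i\to\gamma)])$ and $K_j=\mathscr{C}^{\{k+1,\dots,j-1\}}(A[(j\to-\gamma)])$, where $A[(i\to\gamma)]$ replaces the $i$-th column by $\gamma$ and $\mathscr{C}^{\theta}$ makes the coefficients indexed by $\theta$ strictly positive.) -}

module Defs where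

open import Data.Nat as ℕ using (ℕ; zero; suc)
open import Data.Nat.Properties using (_<?_; _≤?_)
open import Data.Integer as ℤ using (ℤ; +_)
open import Data.Rational as ℚ using (ℚ; 0ℚ; _/_)
open import Data.Fin using (Fin; toℕ) renaming (zero to fz; suc to fs)
open import Data.Vec as Vec using (Vec; []; _∷_; zipWith; replicate)
open import Data.Vec.Properties using (≡-dec)
open import Data.List as List using (List; []; _∷_; concatMap)
open import Data.Product using (Σ; ∃; _×_; _,_)
open import Data.Bool using (Bool; true; false; if_then_else_; _∧_)
open import Relation.Nullary using (¬_; yes; no)
open import Relation.Nullary.Decidable using (⌊_⌋)
open import Relation.Binary.PropositionalEquality using (_≡_)
open import Function using (_∘_)

_+v_ : ∀ {d} → Vec ℚ d → Vec ℚ d → Vec ℚ d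
_+v_ = zipWith ℚ._+_

_·v_ : ∀ {d} → ℚ → Vec ℚ d → Vec ℚ d
c ·v v = Vec.map (c ℚ.*_) v

-v_ : ∀ {d} → Vec ℚ d → Vec ℚ d
-v v = Vec.map ℚ.-_ v

lincomb : ∀ {n d} → (Fin n → ℚ) → (Fin n → Vec ℚ d) → Vec ℚ d
lincomb {zero}  {d} t w = replicate d 0ℚ
lincomb {suc n} {d} t w = (t fz ·v w fz) +v lincomb (t ∘ fs) (w ∘ fs)

LinIndep : ∀ {n d} → (Fin n → Vec ℚ d) → Set
LinIndep {n} {d} α = (c : Fin n → ℚ) → lincomb c α ≡ replicate d 0ℚ → ∀ l → c l ≡ 0ℚ

HCone : ∀ {n d} → (Fin n → Vec ℚ d) → (Fin n → Bool) → Vec ℚ d → Set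
HCone w strict x =
  Σ _ λ (t : _ ) → (∀ l → 0ℚ ℚ.≤ t l) × (∀ l → strict l ≡ true → 0ℚ ℚ.< t l)
                    × (x ≡ lincomb t w)

toℚv : ∀ {d} → Vec ℤ d → Vec ℚ d
toℚv = Vec.map (λ z → z / 1)

LatticePts : ∀ {d} → (Vec ℚ d → Set) → Vec ℤ d → Set
LatticePts S m = S (toℚv m)

-- Laurent polynomials in y_1,…,y_d over ℤ, as finite lists of
-- (coefficient , exponent vector) terms; series as coefficient functions.

Exp : ℕ → Set
Exp d = Vec ℤ d

LPoly : ℕ → Set
LPoly d = List (ℤ × Exp d)

_≟e_ : ∀ {d} (u v : Exp d) → _
_≟e_ = ≡-dec ℤ._≟_

coeff : ∀ {d} → LPoly d → Exp d → ℤ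
coeff [] e = + 0
coeff ((c , u) ∷ P) e = (if ⌊ u ≟e e ⌋ then c else + 0) ℤ.+ coeff P e

_*P_ : ∀ {d} → LPoly d → LPoly d → LPoly d
P *P Q = concatMap (λ { (c , u) → List.map (λ { (c' , u') → (c ℤ.* c' , zipWith ℤ._+_ u u') }) Q }) P

_+P_ : ∀ {d} → LPoly d → LPoly d → LPoly d
_+P_ = List._++_

oneP : ∀ {d} → LPoly d
oneP {d} = (+ 1 , replicate d (+ 0)) ∷ []

_≈P_ : ∀ {d} → LPoly d → LPoly d → Set
P ≈P Q = ∀ e → coeff P e ≡ coeff Q e

NonZeroP : ∀ {d} → LPoly d → Set
NonZeroP P = ∃ λ e → ¬ (coeff P e ≡ + 0)

mulSeries : ∀ {d} → LPoly d → (Exp d → ℤ) → Exp d → ℤ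
mulSeries [] s e = + 0
mulSeries ((c , u) ∷ Q) s e = c ℤ.* s (zipWith ℤ._-_ e u) ℤ.+ mulSeries Q s e

RatFun : ℕ → Set
RatFun d = LPoly d × LPoly d

_+R_ : ∀ {d} → RatFun d → RatFun d → RatFun d
(P , Q) +R (P' , Q') = ((P *P Q') +P (P' *P Q)) , (Q *P Q')

zeroR : ∀ {d} → RatFun d
zeroR = [] , oneP

_≈R_ : ∀ {d} → RatFun d → RatFun d → Set
(P , Q) ≈R (P' , Q') = (P *P Q') ≈P (P' *P Q)

sumR : ∀ {n d} → (Fin n → Bool) → (Fin n → RatFun d) → RatFun d
sumR {zero}  sel F = zeroR
sumR {suc n} sel F =
  (if sel fz then F fz else zeroR) +R sumR (sel ∘ fs) (F ∘ fs)

-- "σ(S) = P/Q": Q ≠ 0 and Q · σ(S) = P, where σ(S) = Σ_{m ∈ S ∩ ℤ^d} y^m is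
-- the formal series whose coefficient is 1 on S ∩ ℤ^d and 0 elsewhere.
IsGF : ∀ {d} → (Exp d → Set) → RatFun d → Set
IsGF {d} S (P , Q) =
  NonZeroP Q ×
  Σ (Exp d → ℤ) λ s →
      (∀ m → (S m → s m ≡ + 1) × (¬ S m → s m ≡ + 0))
    × (∀ e → mulSeries Q s e ≡ coeff P e)

-- The data of Proposition 3.4 (indices 0-based: l : Fin n is α_{l+1})

gammaCoeff : ∀ {n} → ℕ → ℕ → (Fin n → ℚ) → Fin n → ℚ
gammaCoeff k r p l =
  if ⌊ toℕ l <? k ⌋ then p l
  else if ⌊ toℕ l <? r ⌋ then ℚ.- p l
  else 0ℚ

gamma : ∀ {n d} → (Fin n → Vec ℚ d) → ℕ → ℕ → (Fin n → ℚ) → Vec ℚ d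
gamma α k r p = lincomb (gammaCoeff k r p) α

replaceCol : ∀ {n d} → (Fin n → Vec ℚ d) → Fin n → Vec ℚ d → Fin n → Vec ℚ d
replaceCol α i v l = if ⌊ toℕ l ℕ.≟ toℕ i ⌋ then v else α l

Kcone : ∀ {n d} → (Fin n → Vec ℚ d) → ℕ → ℕ → (Fin n → ℚ) → Fin n → Vec ℚ d → Set
Kcone α k r p i =
  if ⌊ toℕ i <? k ⌋
  then HCone (replaceCol α i (gamma α k r p))
             (λ l → ⌊ toℕ l <? toℕ i ⌋)
  else HCone (replaceCol α i (-v gamma α k r p))
             (λ l → ⌊ k ≤? toℕ l ⌋ ∧ ⌊ toℕ l <? toℕ i ⌋)

Kmain : ∀ {n d} → (Fin n → Vec ℚ d) → Vec ℚ d → Set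
Kmain α = HCone α (λ _ → false)

{-# OPTIONS --safe #-}
module Submission where

-- Write a point x of span(α) in α-coordinates t and put a_l = t_l / p_l for l < r. Then x ∈ K iff t ≥ 0, and
-- x ∈ K_i (i < k) iff i is the first index below k at which a is minimal, a_i ≥ 0, a_j ≥ −a_i for k ≤ j < r and
-- t_l ≥ 0 for l ≥ r; symmetrically for k ≤ i < r. Summing, [K] − Σ_l [K_l] depends on the two minima
-- min_{l<k} a_l and min_{k≤l<r} a_l only through their sum. Translating x by γ raises the first and lowers the
-- second by 1, so the difference of indicators is invariant under x ↦ x + γ, and its generating function is killed
-- by 1 − y^u for an integer multiple u of γ: σ(K) and Σ_l σ(K_l) agree as rational functions.
--
-- Each σ(C) comes from integer generators v_l of C: multiplying the indicator of C by Π_l (1 − y^{v_l}) leaves the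
-- lattice points of the half-open fundamental parallelepiped, a Laurent polynomial. The denominators are nonzero
-- because, graded by a linear form positive on every v_l (and on u), their lowest term is 1.

open import Defs
open import Algebra.Bundles using (CommutativeRing)
import Algebra.Properties.Semiring.Sum as SemiringSum
open import Data.Bool as Bool using (Bool; true; false; if_then_else_; _∧_)
import Data.Bool.Properties as Bool
open import Data.Empty using (⊥-elim)
open import Data.Fin as Fin using (Fin; zero; suc; toℕ)
import Data.Fin.Properties as Fin
open import Data.Integer as ℤ using (ℤ; 0ℤ; 1ℤ; -[1+_])
import Data.Integer.Properties as ℤ
open import Data.Integer.Tactic.RingSolver using (solve-∀)
open import Data.List as List using (List; []; _∷_; _++_; concatMap)
import Data.List.Properties as List
open import Data.Maybe as Maybe using (Maybe; just; nothing)
open import Data.Nat as ℕ using (ℕ; zero; suc; _≤_; _<_)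
import Data.Nat.Coprimality as ℕ
import Data.Nat.Properties as ℕ
open import Data.Nat.Properties using (_<?_)
open import Data.Product using (Σ; ∃; _×_; _,_; proj₁; proj₂)
open import Data.Rational as ℚ using (ℚ; mkℚ; 0ℚ; 1ℚ; _+_; _*_; -_; _-_; ∣_∣; 1/_)
import Data.Rational.Properties as ℚ
open import Data.Rational.Solver using (module +-*-Solver)
import Data.Rational.Unnormalised as ℚᵘ
open import Data.Sum using (_⊎_; inj₁; inj₂)
open import Data.Vec as Vec using (Vec; []; _∷_; lookup; zipWith; replicate)
import Data.Vec.Properties as Vec
open import Function using (_∘_; id)
open import Function.Bundles using (_⇔_; mk⇔; Equivalence)
open import Relation.Binary.PropositionalEquality
open import Relation.Nullary using (¬_; Dec; yes; no; does; _×-dec_)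
open import Relation.Nullary.Decidable using (⌊_⌋; dec-true; dec-false; isYes≗does; does-⇔)

open +-*-Solver
open SemiringSum (CommutativeRing.semiring ℚ.+-*-commutativeRing)
  using (sum; sum-cong-≗; sum-replicate-zero; ∑-distrib-+; *-distribˡ-sum)
module ℕΣ = SemiringSum ℕ.+-*-semiring
module ℤΣ = SemiringSum ℤ.+-*-semiring

⌊⌋-⇔ : ∀ {a b} {A : Set a} {B : Set b} → (A → B) → (B → A) → (a? : Dec A) (b? : Dec B) → ⌊ a? ⌋ ≡ ⌊ b? ⌋
⌊⌋-⇔ f g a? b? = trans (isYes≗does a?) (trans (does-⇔ (mk⇔ f g) a? b?) (sym (isYes≗does b?)))

⌊⌋-true : ∀ {a} {A : Set a} (a? : Dec A) → A → ⌊ a? ⌋ ≡ true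
⌊⌋-true a? a = trans (isYes≗does a?) (dec-true a? a)

⌊⌋-false : ∀ {a} {A : Set a} (a? : Dec A) → ¬ A → ⌊ a? ⌋ ≡ false
⌊⌋-false a? ¬a = trans (isYes≗does a?) (dec-false a? ¬a)

does-true⇒ : ∀ {ℓ} {A : Set ℓ} (a? : Dec A) → does a? ≡ true → A
does-true⇒ (yes a) _ = a

if-true : ∀ {A : Set} {b} {x y : A} → b ≡ true → (if b then x else y) ≡ x
if-true refl = refl

if-false : ∀ {A : Set} {b} {x y : A} → b ≡ false → (if b then x else y) ≡ y
if-false refl = refl

∧-interchange : ∀ a b c d → (a ∧ b) ∧ (c ∧ d) ≡ (a ∧ c) ∧ (b ∧ d)
∧-interchange true  true  c d = refl
∧-interchange true  false c d = sym (Bool.∧-zeroʳ c)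
∧-interchange false b     c d = refl

all : ∀ {n} → (Fin n → Bool) → Bool
all {zero}  b = true
all {suc n} b = b zero ∧ all (b ∘ suc)

all-cong : ∀ {n} {b c : Fin n → Bool} → (∀ l → b l ≡ c l) → all b ≡ all c
all-cong {zero}  _   = refl
all-cong {suc n} b≗c = cong₂ _∧_ (b≗c zero) (all-cong (b≗c ∘ suc))

all-∧ : ∀ {n} (b c : Fin n → Bool) → all (λ l → b l ∧ c l) ≡ all b ∧ all c
all-∧ {zero}  b c = refl
all-∧ {suc n} b c = trans (cong ((b zero ∧ c zero) ∧_) (all-∧ (b ∘ suc) (c ∘ suc)))
                          (∧-interchange (b zero) (c zero) (all (b ∘ suc)) (all (c ∘ suc)))

all-true : ∀ {n} (b : Fin n → Bool) → (∀ l → b l ≡ true) → all b ≡ true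
all-true {zero}  b _     = refl
all-true {suc n} b b≡true = trans (cong (_∧ all (b ∘ suc)) (b≡true zero)) (all-true (b ∘ suc) (b≡true ∘ suc))

all-elim : ∀ {n} (b : Fin n → Bool) → all b ≡ true → ∀ l → b l ≡ true
all-elim b all≡true zero    with b zero | all≡true
... | true | _ = refl
all-elim b all≡true (suc l) with b zero | all≡true
... | true | rest = all-elim (b ∘ suc) rest l

all-single : ∀ {n} (b : Fin n → Bool) (i : Fin n) → (∀ l → l ≢ i → b l ≡ true) → all b ≡ b i
all-single b zero    others = trans (cong (b zero ∧_) (all-true (b ∘ suc) (λ l → others (suc l) λ ())))
                                    (Bool.∧-identityʳ (b zero))
all-single b (suc i) others = trans (cong (_∧ all (b ∘ suc)) (others zero λ ()))
                                    (all-single (b ∘ suc) i (λ l l≢i → others (suc l) (l≢i ∘ Fin.suc-injective)))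

indicator : Bool → ℤ
indicator true  = 1ℤ
indicator false = 0ℤ

indicator-∧ : ∀ a b → indicator (a ∧ b) ≡ indicator a ℤ.* indicator b
indicator-∧ true  b = sym (ℤ.*-identityˡ (indicator b))
indicator-∧ false b = refl

-- 1/q, with the junk value 0 at 0
recip : ℚ → ℚ
recip q with q ℚ.≟ 0ℚ
... | yes _   = 0ℚ
... | no q≢0 = 1/_ q {{ℚ.≢-nonZero q≢0}}

recip-inverseˡ : ∀ {q} → q ≢ 0ℚ → recip q * q ≡ 1ℚ
recip-inverseˡ {q} q≢0 with q ℚ.≟ 0ℚ
... | yes q≡0 = ⊥-elim (q≢0 q≡0)
... | no q≢0′ = ℚ.*-inverseˡ q {{ℚ.≢-nonZero q≢0′}}

recip-inverseʳ : ∀ {q} → q ≢ 0ℚ → q * recip q ≡ 1ℚ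
recip-inverseʳ {q} q≢0 = trans (ℚ.*-comm q (recip q)) (recip-inverseˡ q≢0)

recip-pos : ∀ {q} → 0ℚ ℚ.< q → 0ℚ ℚ.< recip q
recip-pos {q} q>0 with q ℚ.≟ 0ℚ
... | yes q≡0 = ⊥-elim (ℚ.<-irrefl (sym q≡0) q>0)
... | no q≢0 = ℚ.positive⁻¹ (1/_ q {{ℚ.≢-nonZero q≢0}}) {{ℚ.1/pos⇒pos q {{ℚ.positive q>0}}}}

p-q<p : ∀ p {q} → 0ℚ ℚ.< q → p - q ℚ.< p
p-q<p p {q} q>0 = subst (p - q ℚ.<_) (ℚ.+-identityʳ p) (ℚ.+-monoʳ-< p (ℚ.neg-antimono-< q>0))

0≤* : ∀ {p q} → 0ℚ ℚ.≤ p → 0ℚ ℚ.≤ q → 0ℚ ℚ.≤ p * q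
0≤* {p} {q} p≥0 q≥0 = ℚ.nonNegative⁻¹ (p * q) {{ℚ.nonNeg*nonNeg⇒nonNeg p {{ℚ.nonNegative p≥0}} q {{ℚ.nonNegative q≥0}}}}

0<* : ∀ {p q} → 0ℚ ℚ.< p → 0ℚ ℚ.< q → 0ℚ ℚ.< p * q
0<* {p} {q} p>0 q>0 = ℚ.positive⁻¹ (p * q) {{ℚ.pos*pos⇒pos p {{ℚ.positive p>0}} q {{ℚ.positive q>0}}}}

0≤*-cancel : ∀ {p} z → 0ℚ ℚ.< p → 0ℚ ℚ.≤ p * z → 0ℚ ℚ.≤ z
0≤*-cancel {p} z p>0 h = ℚ.*-cancelˡ-≤-pos p {{ℚ.positive p>0}} (subst (ℚ._≤ p * z) (sym (ℚ.*-zeroʳ p)) h)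

0<*-cancel : ∀ {p} z → 0ℚ ℚ.< p → 0ℚ ℚ.< p * z → 0ℚ ℚ.< z
0<*-cancel {p} z p>0 h = ℚ.*-cancelˡ-<-nonNeg p {{ℚ.nonNegative (ℚ.<⇒≤ p>0)}} (subst (ℚ._< p * z) (sym (ℚ.*-zeroʳ p)) h)

0≤y-x⇔x≤y : ∀ {x y} → 0ℚ ℚ.≤ y - x ⇔ x ℚ.≤ y
0≤y-x⇔x≤y {x} {y} = mk⇔ (λ h → subst₂ ℚ._≤_ (ℚ.+-identityˡ x) (solve 2 (λ x y → y :- x :+ x := y) refl x y) (ℚ.+-monoˡ-≤ x h))
                       (λ h → subst (ℚ._≤ y - x) (ℚ.+-inverseʳ x) (ℚ.+-monoˡ-≤ (- x) h))

0<y-x⇔x<y : ∀ {x y} → 0ℚ ℚ.< y - x ⇔ x ℚ.< y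
0<y-x⇔x<y {x} {y} = mk⇔ (λ h → subst₂ ℚ._<_ (ℚ.+-identityˡ x) (solve 2 (λ x y → y :- x :+ x := y) refl x y) (ℚ.+-monoˡ-< x h))
                       (λ h → subst (ℚ._< y - x) (ℚ.+-inverseʳ x) (ℚ.+-monoˡ-< (- x) h))

scaled-≤ : ∀ {p} z → 0ℚ ℚ.< p → does (0ℚ ℚ.≤? p * z) ≡ does (0ℚ ℚ.≤? z)
scaled-≤ {p} z p>0 = does-⇔ (mk⇔ (0≤*-cancel z p>0) (0≤* (ℚ.<⇒≤ p>0))) (0ℚ ℚ.≤? p * z) (0ℚ ℚ.≤? z)

scaled-difference-≤ : ∀ {p} x y → 0ℚ ℚ.< p → does (0ℚ ℚ.≤? p * (y - x)) ≡ does (x ℚ.≤? y)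
scaled-difference-≤ {p} x y p>0 = trans (scaled-≤ (y - x) p>0)
  (does-⇔ 0≤y-x⇔x≤y (0ℚ ℚ.≤? y - x) (x ℚ.≤? y))

scaled-difference-< : ∀ {p} x y → 0ℚ ℚ.< p → does (0ℚ ℚ.<? p * (y - x)) ≡ does (x ℚ.<? y)
scaled-difference-< {p} x y p>0 = does-⇔ (mk⇔ (Equivalence.to 0<y-x⇔x<y ∘ 0<*-cancel (y - x) p>0) (0<* p>0 ∘ Equivalence.from 0<y-x⇔x<y))
  (0ℚ ℚ.<? p * (y - x)) (x ℚ.<? y)

-- Linear algebra over ℚ

δ : ∀ {n} → Fin n → Fin n → ℚ
δ l m = if does (l Fin.≟ m) then 1ℚ else 0ℚ

δ-refl : ∀ {n} (l : Fin n) → δ l l ≡ 1ℚ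
δ-refl l = cong (λ b → if b then 1ℚ else 0ℚ) (dec-true (l Fin.≟ l) refl)

δ-≢ : ∀ {n} {l m : Fin n} → l ≢ m → δ l m ≡ 0ℚ
δ-≢ {l = l} {m} l≢m = cong (λ b → if b then 1ℚ else 0ℚ) (dec-false (l Fin.≟ m) l≢m)

δ-sym : ∀ {n} (l m : Fin n) → δ l m ≡ δ m l
δ-sym l m with l Fin.≟ m
... | yes refl = sym (δ-refl l)
... | no l≢m = sym (δ-≢ (l≢m ∘ sym))

sum-δ : ∀ {n} (f : Fin n → ℚ) (m : Fin n) → sum (λ l → f l * δ l m) ≡ f m
sum-δ {suc n} f zero = begin
  f zero * 1ℚ + sum (λ l → f (suc l) * 0ℚ) ≡⟨ cong₂ _+_ (ℚ.*-identityʳ (f zero)) (sum-cong-≗ (λ l → ℚ.*-zeroʳ (f (suc l)))) ⟩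
  f zero + sum {n} (λ _ → 0ℚ)             ≡⟨ cong (f zero +_) (sum-replicate-zero n) ⟩
  f zero + 0ℚ                             ≡⟨ ℚ.+-identityʳ (f zero) ⟩
  f zero                                  ∎
  where open ≡-Reasoning
sum-δ f (suc m) = begin
  f zero * 0ℚ + sum (λ l → f (suc l) * δ l m) ≡⟨ cong₂ _+_ (ℚ.*-zeroʳ (f zero)) (sum-δ (f ∘ suc) m) ⟩
  0ℚ + f (suc m)                              ≡⟨ ℚ.+-identityˡ (f (suc m)) ⟩
  f (suc m)                                   ∎
  where open ≡-Reasoning

lookup-ext : ∀ {A : Set} {d} {x y : Vec A d} → (∀ j → lookup x j ≡ lookup y j) → x ≡ y
lookup-ext {x = x} {y} eq = begin
  x                      ≡⟨ Vec.tabulate∘lookup x ⟨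
  Vec.tabulate (lookup x) ≡⟨ Vec.tabulate-cong eq ⟩
  Vec.tabulate (lookup y) ≡⟨ Vec.tabulate∘lookup y ⟩
  y                      ∎
  where open ≡-Reasoning

lookup-+v : ∀ {d} (x y : Vec ℚ d) j → lookup (x +v y) j ≡ lookup x j + lookup y j
lookup-+v x y j = Vec.lookup-zipWith _+_ j x y

lookup-·v : ∀ {d} c (x : Vec ℚ d) j → lookup (c ·v x) j ≡ c * lookup x j
lookup-·v c x j = Vec.lookup-map j (c *_) x

lookup-lincomb : ∀ {n d} (t : Fin n → ℚ) (w : Fin n → Vec ℚ d) j →
                 lookup (lincomb t w) j ≡ sum (λ l → t l * lookup (w l) j)
lookup-lincomb {zero}  t w j = Vec.lookup-replicate j 0ℚ
lookup-lincomb {suc n} t w j = begin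
  lookup ((t zero ·v w zero) +v lincomb (t ∘ suc) (w ∘ suc)) j
    ≡⟨ lookup-+v (t zero ·v w zero) _ j ⟩
  lookup (t zero ·v w zero) j + lookup (lincomb (t ∘ suc) (w ∘ suc)) j
    ≡⟨ cong₂ _+_ (lookup-·v (t zero) (w zero) j) (lookup-lincomb (t ∘ suc) (w ∘ suc) j) ⟩
  t zero * lookup (w zero) j + sum (λ l → t (suc l) * lookup (w (suc l)) j) ∎
  where open ≡-Reasoning

lincomb-cong : ∀ {n d} {s t : Fin n → ℚ} {v w : Fin n → Vec ℚ d} →
               (∀ l → s l ≡ t l) → (∀ l → v l ≡ w l) → lincomb s v ≡ lincomb t w
lincomb-cong {zero}  _   _   = refl
lincomb-cong {suc n} s≗t v≗w =
  cong₂ _+v_ (cong₂ _·v_ (s≗t zero) (v≗w zero)) (lincomb-cong (s≗t ∘ suc) (v≗w ∘ suc))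

lincomb-+ : ∀ {n d} (s t : Fin n → ℚ) (w : Fin n → Vec ℚ d) →
            lincomb (λ l → s l + t l) w ≡ lincomb s w +v lincomb t w
lincomb-+ s t w = lookup-ext λ j → begin
  lookup (lincomb (λ l → s l + t l) w) j                          ≡⟨ lookup-lincomb _ w j ⟩
  sum (λ l → (s l + t l) * lookup (w l) j)                        ≡⟨ sum-cong-≗ (λ l → ℚ.*-distribʳ-+ (lookup (w l) j) (s l) (t l)) ⟩
  sum (λ l → s l * lookup (w l) j + t l * lookup (w l) j)         ≡⟨ ∑-distrib-+ (λ l → s l * lookup (w l) j) _ ⟩
  sum (λ l → s l * lookup (w l) j) + sum (λ l → t l * lookup (w l) j) ≡⟨ cong₂ _+_ (lookup-lincomb s w j) (lookup-lincomb t w j) ⟨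
  lookup (lincomb s w) j + lookup (lincomb t w) j                 ≡⟨ lookup-+v (lincomb s w) (lincomb t w) j ⟨
  lookup (lincomb s w +v lincomb t w) j                           ∎
  where open ≡-Reasoning

lincomb-· : ∀ {n d} (c : ℚ) (s : Fin n → ℚ) (w : Fin n → Vec ℚ d) →
            lincomb (λ l → c * s l) w ≡ c ·v lincomb s w
lincomb-· c s w = lookup-ext λ j → begin
  lookup (lincomb (λ l → c * s l) w) j      ≡⟨ lookup-lincomb _ w j ⟩
  sum (λ l → c * s l * lookup (w l) j)      ≡⟨ sum-cong-≗ (λ l → ℚ.*-assoc c (s l) (lookup (w l) j)) ⟩
  sum (λ l → c * (s l * lookup (w l) j))    ≡⟨ *-distribˡ-sum c (λ l → s l * lookup (w l) j) ⟨
  c * sum (λ l → s l * lookup (w l) j)      ≡⟨ cong (c *_) (lookup-lincomb s w j) ⟨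
  c * lookup (lincomb s w) j                ≡⟨ lookup-·v c (lincomb s w) j ⟨
  lookup (c ·v lincomb s w) j               ∎
  where open ≡-Reasoning

lincomb-δ : ∀ {n d} (w : Fin n → Vec ℚ d) (m : Fin n) → lincomb (λ l → δ l m) w ≡ w m
lincomb-δ w m = lookup-ext λ j → begin
  lookup (lincomb (λ l → δ l m) w) j  ≡⟨ lookup-lincomb _ w j ⟩
  sum (λ l → δ l m * lookup (w l) j)  ≡⟨ sum-cong-≗ (λ l → ℚ.*-comm (δ l m) (lookup (w l) j)) ⟩
  sum (λ l → lookup (w l) j * δ l m)  ≡⟨ sum-δ (λ l → lookup (w l) j) m ⟩
  lookup (w m) j                      ∎
  where open ≡-Reasoning

lincomb-zero : ∀ {n d} (w : Fin n → Vec ℚ d) → lincomb (λ _ → 0ℚ) w ≡ replicate d 0ℚ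
lincomb-zero {n} {d} w = lookup-ext λ j → begin
  lookup (lincomb (λ _ → 0ℚ) w) j   ≡⟨ lookup-lincomb _ w j ⟩
  sum (λ l → 0ℚ * lookup (w l) j)   ≡⟨ sum-cong-≗ (λ l → ℚ.*-zeroˡ (lookup (w l) j)) ⟩
  sum {n} (λ _ → 0ℚ)                ≡⟨ sum-replicate-zero n ⟩
  0ℚ                                ≡⟨ Vec.lookup-replicate j 0ℚ ⟨
  lookup (replicate d 0ℚ) j         ∎
  where open ≡-Reasoning

lincomb-rescale : ∀ {n d} (s κ : Fin n → ℚ) (w : Fin n → Vec ℚ d) →
                  lincomb s (λ l → κ l ·v w l) ≡ lincomb (λ l → s l * κ l) w
lincomb-rescale s κ w = lookup-ext λ j → begin
  lookup (lincomb s (λ l → κ l ·v w l)) j         ≡⟨ lookup-lincomb s _ j ⟩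
  sum (λ l → s l * lookup (κ l ·v w l) j)         ≡⟨ sum-cong-≗ (λ l → cong (s l *_) (lookup-·v (κ l) (w l) j)) ⟩
  sum (λ l → s l * (κ l * lookup (w l) j))        ≡⟨ sum-cong-≗ (λ l → ℚ.*-assoc (s l) (κ l) (lookup (w l) j)) ⟨
  sum (λ l → s l * κ l * lookup (w l) j)          ≡⟨ lookup-lincomb _ w j ⟨
  lookup (lincomb (λ l → s l * κ l) w) j          ∎
  where open ≡-Reasoning

-v≡-1·v : ∀ {d} (x : Vec ℚ d) → -v x ≡ (- 1ℚ) ·v x
-v≡-1·v x = lookup-ext λ j → begin
  lookup (-v x) j          ≡⟨ Vec.lookup-map j -_ x ⟩
  - lookup x j             ≡⟨ solve 1 (λ a → :- a := (:- con 1ℚ) :* a) refl (lookup x j) ⟩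
  (- 1ℚ) * lookup x j      ≡⟨ lookup-·v (- 1ℚ) x j ⟨
  lookup ((- 1ℚ) ·v x) j   ∎
  where open ≡-Reasoning

+v-cancelʳ : ∀ {d} (x y z : Vec ℚ d) → x +v z ≡ y +v z → x ≡ y
+v-cancelʳ x y z eq = lookup-ext λ j → begin
  lookup x j                              ≡⟨ solve 2 (λ a c → a := (a :+ c) :- c) refl (lookup x j) (lookup z j) ⟩
  (lookup x j + lookup z j) - lookup z j  ≡⟨ cong (_- lookup z j) (trans (sym (lookup-+v x z j)) (cong (λ v → lookup v j) eq)) ⟩
  lookup (y +v z) j - lookup z j          ≡⟨ cong (_- lookup z j) (lookup-+v y z j) ⟩
  (lookup y j + lookup z j) - lookup z j  ≡⟨ solve 2 (λ a c → (a :+ c) :- c := a) refl (lookup y j) (lookup z j) ⟩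
  lookup y j                              ∎
  where open ≡-Reasoning

record LinearForm (d : ℕ) : Set where
  field
    eval   : Vec ℚ d → ℚ
    eval-+ : ∀ x y → eval (x +v y) ≡ eval x + eval y
    eval-· : ∀ c x → eval (c ·v x) ≡ c * eval x

open LinearForm public

eval-0 : ∀ {d} (φ : LinearForm d) → eval φ (replicate d 0ℚ) ≡ 0ℚ
eval-0 {d} φ = begin
  eval φ (replicate d 0ℚ)          ≡⟨ cong (eval φ) 0·v0 ⟨
  eval φ (0ℚ ·v replicate d 0ℚ)    ≡⟨ eval-· φ 0ℚ _ ⟩
  0ℚ * eval φ (replicate d 0ℚ)     ≡⟨ ℚ.*-zeroˡ (eval φ (replicate d 0ℚ)) ⟩
  0ℚ                               ∎
  where
  open ≡-Reasoning
  0·v0 : 0ℚ ·v replicate d 0ℚ ≡ replicate d 0ℚ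
  0·v0 = lookup-ext λ j → trans (lookup-·v 0ℚ (replicate d 0ℚ) j) (trans (ℚ.*-zeroˡ (lookup (replicate d 0ℚ) j)) (sym (Vec.lookup-replicate j 0ℚ)))

eval-lincomb : ∀ {n d} (φ : LinearForm d) (t : Fin n → ℚ) (w : Fin n → Vec ℚ d) →
               eval φ (lincomb t w) ≡ sum (λ l → t l * eval φ (w l))
eval-lincomb {zero}  φ t w = eval-0 φ
eval-lincomb {suc n} φ t w = begin
  eval φ ((t zero ·v w zero) +v lincomb (t ∘ suc) (w ∘ suc))
    ≡⟨ eval-+ φ _ _ ⟩
  eval φ (t zero ·v w zero) + eval φ (lincomb (t ∘ suc) (w ∘ suc))
    ≡⟨ cong₂ _+_ (eval-· φ (t zero) (w zero)) (eval-lincomb φ (t ∘ suc) (w ∘ suc)) ⟩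
  t zero * eval φ (w zero) + sum (λ l → t (suc l) * eval φ (w (suc l))) ∎
  where open ≡-Reasoning

eval-sub : ∀ {d} (φ : LinearForm d) (x y : Vec ℚ d) → eval φ (x +v (-v y)) ≡ eval φ x - eval φ y
eval-sub φ x y = begin
  eval φ (x +v (-v y))               ≡⟨ cong (λ v → eval φ (x +v v)) (-v≡-1·v y) ⟩
  eval φ (x +v ((- 1ℚ) ·v y))        ≡⟨ eval-+ φ x _ ⟩
  eval φ x + eval φ ((- 1ℚ) ·v y)    ≡⟨ cong (eval φ x +_) (eval-· φ (- 1ℚ) y) ⟩
  eval φ x + (- 1ℚ) * eval φ y       ≡⟨ solve 2 (λ a b → a :+ (:- con 1ℚ) :* b := a :- b) refl (eval φ x) (eval φ y) ⟩
  eval φ x - eval φ y                ∎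
  where open ≡-Reasoning

coordinateForm : ∀ {d} → Fin d → LinearForm d
coordinateForm j = record
  { eval   = λ x → lookup x j
  ; eval-+ = λ x y → lookup-+v x y j
  ; eval-· = λ c x → lookup-·v c x j
  }

scaleForm : ∀ {d} → ℚ → LinearForm d → LinearForm d
scaleForm c φ = record
  { eval   = λ x → c * eval φ x
  ; eval-+ = λ x y → trans (cong (c *_) (eval-+ φ x y)) (ℚ.*-distribˡ-+ c (eval φ x) (eval φ y))
  ; eval-· = λ a x → trans (cong (c *_) (eval-· φ a x)) (solve 3 (λ c a b → c :* (a :* b) := a :* (c :* b)) refl c a (eval φ x))
  }

addForm : ∀ {d} → LinearForm d → LinearForm d → LinearForm d
addForm φ ψ = record
  { eval   = λ x → eval φ x + eval ψ x
  ; eval-+ = λ x y → trans (cong₂ _+_ (eval-+ φ x y) (eval-+ ψ x y))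
                       (solve 4 (λ a b c e → (a :+ b) :+ (c :+ e) := (a :+ c) :+ (b :+ e)) refl (eval φ x) (eval φ y) (eval ψ x) (eval ψ y))
  ; eval-· = λ a x → trans (cong₂ _+_ (eval-· φ a x) (eval-· ψ a x)) (sym (ℚ.*-distribˡ-+ a (eval φ x) (eval ψ x)))
  }

combineForms : ∀ {k d} → (Fin k → ℚ) → (Fin k → LinearForm d) → LinearForm d
combineForms {zero}  c φ = record { eval = λ _ → 0ℚ ; eval-+ = λ _ _ → refl ; eval-· = λ a _ → sym (ℚ.*-zeroʳ a) }
combineForms {suc k} c φ = addForm (scaleForm (c zero) (φ zero)) (combineForms (c ∘ suc) (φ ∘ suc))

eval-combineForms : ∀ {k d} (c : Fin k → ℚ) (φ : Fin k → LinearForm d) x →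
                    eval (combineForms c φ) x ≡ sum (λ m → c m * eval (φ m) x)
eval-combineForms {zero}  c φ x = refl
eval-combineForms {suc k} c φ x = cong (c zero * eval (φ zero) x +_) (eval-combineForms (c ∘ suc) (φ ∘ suc) x)

record Biorthogonal {n d} (w : Fin n → Vec ℚ d) (φ : Fin n → LinearForm d) : Set where
  constructor biorthogonal
  field eval-δ : ∀ l m → eval (φ l) (w m) ≡ δ l m

open Biorthogonal public

eval-lincomb-biorthogonal : ∀ {n d} {w : Fin n → Vec ℚ d} {φ : Fin n → LinearForm d} →
                            Biorthogonal w φ → ∀ s l → eval (φ l) (lincomb s w) ≡ s l
eval-lincomb-biorthogonal {w = w} {φ} bi s l = begin
  eval (φ l) (lincomb s w)          ≡⟨ eval-lincomb (φ l) s w ⟩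
  sum (λ m → s m * eval (φ l) (w m)) ≡⟨ sum-cong-≗ (λ m → cong (s m *_) (trans (eval-δ bi l m) (δ-sym l m))) ⟩
  sum (λ m → s m * δ m l)           ≡⟨ sum-δ s l ⟩
  s l                               ∎
  where open ≡-Reasoning

zero⊎nonzeroEntry : ∀ {d} (x : Vec ℚ d) → x ≡ replicate d 0ℚ ⊎ ∃ λ j → lookup x j ≢ 0ℚ
zero⊎nonzeroEntry [] = inj₁ refl
zero⊎nonzeroEntry (a ∷ x) with a ℚ.≟ 0ℚ | zero⊎nonzeroEntry x
... | no a≢0   | _              = inj₂ (zero , a≢0)
... | yes _    | inj₂ (j , x≢0) = inj₂ (suc j , x≢0)
... | yes refl | inj₁ refl      = inj₁ refl

LinIndep-tail : ∀ {n d} {α : Fin (suc n) → Vec ℚ d} → LinIndep α → LinIndep (α ∘ suc)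
LinIndep-tail {α = α} indep c c·α≡0 l = indep c′ c′·α≡0 (suc l)
  where
  c′ : Fin _ → ℚ
  c′ zero    = 0ℚ
  c′ (suc l) = c l
  c′·α≡0 : lincomb c′ α ≡ replicate _ 0ℚ
  c′·α≡0 = trans (lookup-ext λ j → begin
      lookup ((0ℚ ·v α zero) +v lincomb c (α ∘ suc)) j            ≡⟨ lookup-+v (0ℚ ·v α zero) (lincomb c (α ∘ suc)) j ⟩
      lookup (0ℚ ·v α zero) j + lookup (lincomb c (α ∘ suc)) j    ≡⟨ cong (_+ lookup (lincomb c (α ∘ suc)) j) (trans (lookup-·v 0ℚ (α zero) j) (ℚ.*-zeroˡ (lookup (α zero) j))) ⟩
      0ℚ + lookup (lincomb c (α ∘ suc)) j                         ≡⟨ ℚ.+-identityˡ _ ⟩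
      lookup (lincomb c (α ∘ suc)) j                              ∎)
    c·α≡0
    where open ≡-Reasoning

formVanishingOn : ∀ {n d} (w : Fin n → Vec ℚ d) (φ : Fin n → LinearForm d) → Biorthogonal w φ →
                  ∀ r j → lookup r j ≢ 0ℚ → (∀ m → eval (φ m) r ≡ 0ℚ) →
                  Σ (LinearForm d) λ g → eval g r ≡ 1ℚ × ∀ m → eval g (w m) ≡ 0ℚ
formVanishingOn {n} {d} w φ bi r j rⱼ≢0 φr≡0 = g , gr≡1 , gw≡0
  where
  g₀ : LinearForm d
  g₀ = scaleForm (recip (lookup r j)) (coordinateForm j)
  c : Fin n → ℚ
  c m = - eval g₀ (w m)
  g : LinearForm d
  g = addForm g₀ (combineForms c φ)
  gw≡0 : ∀ m → eval g (w m) ≡ 0ℚ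
  gw≡0 m = begin
    eval g₀ (w m) + eval (combineForms c φ) (w m)       ≡⟨ cong (eval g₀ (w m) +_) (eval-combineForms c φ (w m)) ⟩
    eval g₀ (w m) + sum (λ l → c l * eval (φ l) (w m))  ≡⟨ cong (eval g₀ (w m) +_) (trans (sum-cong-≗ (λ l → cong (c l *_) (eval-δ bi l m))) (sum-δ c m)) ⟩
    eval g₀ (w m) - eval g₀ (w m)                       ≡⟨ ℚ.+-inverseʳ (eval g₀ (w m)) ⟩
    0ℚ                                                  ∎
    where open ≡-Reasoning
  gr≡1 : eval g r ≡ 1ℚ
  gr≡1 = begin
    eval g₀ r + eval (combineForms c φ) r               ≡⟨ cong (eval g₀ r +_) (eval-combineForms c φ r) ⟩
    eval g₀ r + sum (λ l → c l * eval (φ l) r)          ≡⟨ cong (eval g₀ r +_) (trans (sum-cong-≗ (λ l → trans (cong (c l *_) (φr≡0 l)) (ℚ.*-zeroʳ (c l)))) (sum-replicate-zero n)) ⟩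
    eval g₀ r + 0ℚ                                      ≡⟨ ℚ.+-identityʳ (eval g₀ r) ⟩
    recip (lookup r j) * lookup r j                     ≡⟨ recip-inverseˡ rⱼ≢0 ⟩
    1ℚ                                                  ∎
    where open ≡-Reasoning

residual : ∀ {n d} (α : Fin (suc n) → Vec ℚ d) → (Fin n → LinearForm d) → Vec ℚ d
residual α φ = α zero +v lincomb (λ m → - eval (φ m) (α zero)) (α ∘ suc)

residual-killed : ∀ {n d} (α : Fin (suc n) → Vec ℚ d) (φ : Fin n → LinearForm d) → Biorthogonal (α ∘ suc) φ →
                  ∀ m → eval (φ m) (residual α φ) ≡ 0ℚ
residual-killed α φ bi m = begin
  eval (φ m) (residual α φ)                                               ≡⟨ eval-+ (φ m) _ _ ⟩
  eval (φ m) (α zero) + eval (φ m) (lincomb (λ l → - eval (φ l) (α zero)) (α ∘ suc))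
    ≡⟨ cong (eval (φ m) (α zero) +_) (eval-lincomb-biorthogonal bi (λ l → - eval (φ l) (α zero)) m) ⟩
  eval (φ m) (α zero) - eval (φ m) (α zero)                               ≡⟨ ℚ.+-inverseʳ (eval (φ m) (α zero)) ⟩
  0ℚ                                                                      ∎
  where open ≡-Reasoning

residual≢0 : ∀ {n d} (α : Fin (suc n) → Vec ℚ d) (φ : Fin n → LinearForm d) → LinIndep α → residual α φ ≢ replicate d 0ℚ
residual≢0 {n} {d} α φ indep r≡0 = ℚ.1≢0 (indep c c·α≡0 zero)
  where
  c : Fin (suc n) → ℚ
  c zero    = 1ℚ
  c (suc m) = - eval (φ m) (α zero)
  c·α≡0 : lincomb c α ≡ replicate d 0ℚ
  c·α≡0 = trans (cong (_+v lincomb (c ∘ suc) (α ∘ suc)) (lookup-ext λ j → trans (lookup-·v 1ℚ (α zero) j) (ℚ.*-identityˡ _))) r≡0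

separatingForm : ∀ {n d} (α : Fin (suc n) → Vec ℚ d) → LinIndep α →
                 (φ : Fin n → LinearForm d) → Biorthogonal (α ∘ suc) φ →
                 Σ (LinearForm d) λ g → eval g (α zero) ≡ 1ℚ × ∀ m → eval g (α (suc m)) ≡ 0ℚ
separatingForm {n} {d} α indep φ bi with zero⊎nonzeroEntry (residual α φ)
... | inj₁ r≡0         = ⊥-elim (residual≢0 α φ indep r≡0)
... | inj₂ (j , rⱼ≢0) = g , gα₀≡1 , gα≡0
  where
  vanishing : Σ (LinearForm d) λ g → eval g (residual α φ) ≡ 1ℚ × ∀ m → eval g (α (suc m)) ≡ 0ℚ
  vanishing = formVanishingOn (α ∘ suc) φ bi (residual α φ) j rⱼ≢0 (residual-killed α φ bi)
  g : LinearForm d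
  g = proj₁ vanishing
  gα≡0 : ∀ m → eval g (α (suc m)) ≡ 0ℚ
  gα≡0 = proj₂ (proj₂ vanishing)
  a : Fin n → ℚ
  a m = - eval (φ m) (α zero)
  g·tail≡0 : eval g (lincomb a (α ∘ suc)) ≡ 0ℚ
  g·tail≡0 = trans (eval-lincomb g a (α ∘ suc))
    (trans (sum-cong-≗ (λ m → trans (cong (a m *_) (gα≡0 m)) (ℚ.*-zeroʳ (a m)))) (sum-replicate-zero n))
  gα₀≡1 : eval g (α zero) ≡ 1ℚ
  gα₀≡1 = begin
    eval g (α zero)                                    ≡⟨ ℚ.+-identityʳ (eval g (α zero)) ⟨
    eval g (α zero) + 0ℚ                               ≡⟨ cong (eval g (α zero) +_) g·tail≡0 ⟨
    eval g (α zero) + eval g (lincomb a (α ∘ suc))     ≡⟨ eval-+ g _ _ ⟨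
    eval g (residual α φ)                              ≡⟨ proj₁ (proj₂ vanishing) ⟩
    1ℚ                                                 ∎
    where open ≡-Reasoning

biorthogonal-exists : ∀ {n d} (α : Fin n → Vec ℚ d) → LinIndep α → Σ (Fin n → LinearForm d) (Biorthogonal α)
biorthogonal-exists {zero}  α indep = (λ ()) , biorthogonal (λ ())
biorthogonal-exists {suc n} {d} α indep = φ , bi
  where
  IH : Σ (Fin n → LinearForm d) (Biorthogonal (α ∘ suc))
  IH = biorthogonal-exists (α ∘ suc) (LinIndep-tail {α = α} indep)
  φ′ : Fin n → LinearForm d
  φ′ = proj₁ IH
  sep : Σ (LinearForm d) λ g → eval g (α zero) ≡ 1ℚ × ∀ m → eval g (α (suc m)) ≡ 0ℚ
  sep = separatingForm α indep φ′ (proj₂ IH)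
  g : LinearForm d
  g = proj₁ sep
  φ : Fin (suc n) → LinearForm d
  φ zero    = g
  φ (suc m) = addForm (φ′ m) (scaleForm (- eval (φ′ m) (α zero)) g)
  bi : Biorthogonal α φ
  bi = biorthogonal φα≡δ
    where
    φα≡δ : ∀ l m → eval (φ l) (α m) ≡ δ l m
    φα≡δ zero    zero     = proj₁ (proj₂ sep)
    φα≡δ zero    (suc m)  = proj₂ (proj₂ sep) m
    φα≡δ (suc l) zero     = trans (cong (λ z → eval (φ′ l) (α zero) + - eval (φ′ l) (α zero) * z) (proj₁ (proj₂ sep)))
                          (solve 1 (λ x → x :+ (:- x) :* con 1ℚ := con 0ℚ) refl (eval (φ′ l) (α zero)))
    φα≡δ (suc l) (suc m)  = trans (cong₂ (λ u z → u + - eval (φ′ l) (α zero) * z) (eval-δ (proj₂ IH) l m) (proj₂ (proj₂ sep) m))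
                          (solve 2 (λ x y → x :+ y :* con 0ℚ := x) refl (δ l m) (- eval (φ′ l) (α zero)))

positiveForm : ∀ {n d} (α : Fin (suc n) → Vec ℚ d) (B : Fin (suc n) → LinearForm d) → Biorthogonal α B →
               (h : Fin (suc n) → ℚ) → 0ℚ ℚ.< h zero →
               Σ (LinearForm d) λ ψ → (∀ l → 0ℚ ℚ.< eval ψ (α l)) × 0ℚ ℚ.< eval ψ (lincomb h α)
positiveForm {d = d} α B bi h h₀>0 = ψ , ψα>0 , ψγ>0
  where
  ψ₁ : LinearForm d
  ψ₁ = combineForms (λ _ → 1ℚ) B
  S : ℚ
  S = eval ψ₁ (lincomb h α)
  c : ℚ
  c = recip (h zero) * (0ℚ ℚ.⊔ (1ℚ - S))
  ψ : LinearForm d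
  ψ = addForm ψ₁ (scaleForm c (B zero))
  0<1+ : ∀ {x} → 0ℚ ℚ.≤ x → 0ℚ ℚ.< 1ℚ + x
  0<1+ {x} x≥0 = ℚ.<-≤-trans (ℚ.positive⁻¹ 1ℚ) (subst (ℚ._≤ 1ℚ + x) (ℚ.+-identityʳ 1ℚ) (ℚ.+-monoʳ-≤ 1ℚ x≥0))
  ψα>0 : ∀ l → 0ℚ ℚ.< eval ψ (α l)
  ψα>0 l = subst (0ℚ ℚ.<_) (cong₂ (λ a b → a + c * b) (sym ψ₁α≡1) (sym (eval-δ bi zero l)))
    (0<1+ (0≤* (0≤* (ℚ.<⇒≤ (recip-pos h₀>0)) (ℚ.p≤p⊔q 0ℚ (1ℚ - S))) (δ≥0 zero l)))
    where
    ψ₁α≡1 : eval ψ₁ (α l) ≡ 1ℚ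
    ψ₁α≡1 = trans (eval-combineForms (λ _ → 1ℚ) B (α l)) (trans (sum-cong-≗ λ m → cong (1ℚ *_) (eval-δ bi m l)) (sum-δ (λ _ → 1ℚ) l))
    δ≥0 : ∀ m l → 0ℚ ℚ.≤ δ m l
    δ≥0 m l with does (m Fin.≟ l)
    ... | true  = ℚ.<⇒≤ (ℚ.positive⁻¹ 1ℚ)
    ... | false = ℚ.≤-refl
  ψγ>0 : 0ℚ ℚ.< eval ψ (lincomb h α)
  ψγ>0 = begin-strict
    0ℚ                                          <⟨ ℚ.positive⁻¹ 1ℚ ⟩
    1ℚ                                          ≡⟨ solve 1 (λ s → con 1ℚ := s :+ (con 1ℚ :- s)) refl S ⟩
    S + (1ℚ - S)                                ≤⟨ ℚ.+-monoʳ-≤ S (ℚ.p≤q⊔p 0ℚ (1ℚ - S)) ⟩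
    S + (0ℚ ℚ.⊔ (1ℚ - S))                        ≡⟨ cong (S +_) (ℚ.*-identityˡ (0ℚ ℚ.⊔ (1ℚ - S))) ⟨
    S + 1ℚ * (0ℚ ℚ.⊔ (1ℚ - S))                   ≡⟨ cong (λ z → S + z * (0ℚ ℚ.⊔ (1ℚ - S))) (recip-inverseˡ (λ h₀≡0 → ℚ.<-irrefl (sym h₀≡0) h₀>0)) ⟨
    S + recip (h zero) * h zero * (0ℚ ℚ.⊔ (1ℚ - S)) ≡⟨ cong (S +_) (solve 3 (λ a b m → a :* b :* m := a :* m :* b) refl (recip (h zero)) (h zero) (0ℚ ℚ.⊔ (1ℚ - S))) ⟩
    S + c * h zero                              ≡⟨ cong (λ z → S + c * z) (eval-lincomb-biorthogonal bi h zero) ⟨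
    eval ψ (lincomb h α)                        ∎
    where open ℚ.≤-Reasoning

admissible : Bool → ℚ → Bool
admissible true  q = does (0ℚ ℚ.<? q)
admissible false q = does (0ℚ ℚ.≤? q)

admissible-sound : ∀ strict q → admissible strict q ≡ true → 0ℚ ℚ.≤ q × (strict ≡ true → 0ℚ ℚ.< q)
admissible-sound true  q ok = ℚ.<⇒≤ q>0 , λ _ → q>0
  where
  q>0 : 0ℚ ℚ.< q
  q>0 = does-true⇒ (0ℚ ℚ.<? q) ok
admissible-sound false q ok = does-true⇒ (0ℚ ℚ.≤? q) ok , λ ()

admissible-complete : ∀ strict q → 0ℚ ℚ.≤ q → (strict ≡ true → 0ℚ ℚ.< q) → admissible strict q ≡ true
admissible-complete true  q _   q>0 = dec-true (0ℚ ℚ.<? q) (q>0 refl)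
admissible-complete false q q≥0 _   = dec-true (0ℚ ℚ.≤? q) q≥0

module Span {n d} (w : Fin n → Vec ℚ d) (φ : Fin n → LinearForm d) (bi : Biorthogonal w φ) where

  coord : Vec ℚ d → Fin n → ℚ
  coord x l = eval (φ l) x

  proj : Vec ℚ d → Vec ℚ d
  proj x = lincomb (coord x) w

  InSpan : Vec ℚ d → Set
  InSpan x = proj x ≡ x

  inSpan? : ∀ x → Dec (InSpan x)
  inSpan? x = Vec.≡-dec ℚ._≟_ (proj x) x

  coord-lincomb : ∀ s l → coord (lincomb s w) l ≡ s l
  coord-lincomb = eval-lincomb-biorthogonal bi

  inSpan-lincomb : ∀ s → InSpan (lincomb s w)
  inSpan-lincomb s = lincomb-cong (coord-lincomb s) (λ _ → refl)

  proj-+ : ∀ x y → proj (x +v y) ≡ proj x +v proj y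
  proj-+ x y = trans (lincomb-cong (λ l → eval-+ (φ l) x y) (λ _ → refl)) (lincomb-+ (coord x) (coord y) w)

  proj-· : ∀ a x → proj (a ·v x) ≡ a ·v proj x
  proj-· a x = trans (lincomb-cong (λ l → eval-· (φ l) a x) (λ _ → refl)) (lincomb-· a (coord x) w)

  inSpan-+ : ∀ {x y} → InSpan x → InSpan y → InSpan (x +v y)
  inSpan-+ {x} {y} x∈ y∈ = trans (proj-+ x y) (cong₂ _+v_ x∈ y∈)

  inSpan-· : ∀ a {x} → InSpan x → InSpan (a ·v x)
  inSpan-· a {x} x∈ = trans (proj-· a x) (cong (a ·v_) x∈)

  inSpan-shift : ∀ {x u} a → InSpan u → InSpan (x +v (a ·v u)) → InSpan x
  inSpan-shift {x} {u} a u∈ x+au∈ = +v-cancelʳ (proj x) x (a ·v u) (begin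
    proj x +v (a ·v u)          ≡⟨ cong (proj x +v_) (inSpan-· a u∈) ⟨
    proj x +v proj (a ·v u)     ≡⟨ proj-+ x (a ·v u) ⟨
    proj (x +v (a ·v u))        ≡⟨ x+au∈ ⟩
    x +v (a ·v u)               ∎)
    where open ≡-Reasoning

  proj-0 : proj (replicate d 0ℚ) ≡ replicate d 0ℚ
  proj-0 = trans (lincomb-cong (λ l → eval-0 (φ l)) (λ _ → refl)) (lincomb-zero w)

  inSpan-lincombOf : ∀ {k} (s : Fin k → ℚ) (u : Fin k → Vec ℚ d) → (∀ m → InSpan (u m)) → InSpan (lincomb s u)
  inSpan-lincombOf {zero}  s u u∈ = proj-0
  inSpan-lincombOf {suc k} s u u∈ = inSpan-+ (inSpan-· (s zero) (u∈ zero)) (inSpan-lincombOf (s ∘ suc) (u ∘ suc) (u∈ ∘ suc))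

  coords-zero⇒zero : ∀ x → InSpan x → (∀ l → coord x l ≡ 0ℚ) → x ≡ replicate d 0ℚ
  coords-zero⇒zero x x∈ coord≡0 = trans (sym x∈) (trans (lincomb-cong coord≡0 (λ _ → refl)) (lincomb-zero w))

  InCone : (Fin n → Bool) → Vec ℚ d → Set
  InCone strict x = InSpan x × (∀ l → 0ℚ ℚ.≤ coord x l) × (∀ l → strict l ≡ true → 0ℚ ℚ.< coord x l)

  HCone⇒InCone : ∀ strict x → HCone w strict x → InCone strict x
  HCone⇒InCone strict x (t , t≥0 , t>0 , x≡) = x∈ , (λ l → subst (0ℚ ℚ.≤_) (sym (coord≡t l)) (t≥0 l))
                                                   , (λ l s → subst (0ℚ ℚ.<_) (sym (coord≡t l)) (t>0 l s))
    where
    coord≡t : ∀ l → coord x l ≡ t l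
    coord≡t l = trans (cong (eval (φ l)) x≡) (coord-lincomb t l)
    x∈ : InSpan x
    x∈ = trans (lincomb-cong coord≡t (λ _ → refl)) (sym x≡)

  InCone⇒HCone : ∀ strict x → InCone strict x → HCone w strict x
  InCone⇒HCone strict x (x∈ , c≥0 , c>0) = coord x , c≥0 , c>0 , sym x∈

  inCone? : (Fin n → Bool) → Vec ℚ d → Bool
  inCone? strict x = ⌊ inSpan? x ⌋ ∧ all (λ l → admissible (strict l) (coord x l))

  inCone?-sound : ∀ strict x → inCone? strict x ≡ true → HCone w strict x
  inCone?-sound strict x ok with inSpan? x | ok
  ... | yes x∈ | coords-ok = InCone⇒HCone strict x
    (x∈ , (λ l → proj₁ (admissible-sound (strict l) (coord x l) (all-elim _ coords-ok l)))
        , (λ l → proj₂ (admissible-sound (strict l) (coord x l) (all-elim _ coords-ok l))))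

  inCone?-complete : ∀ strict x → HCone w strict x → inCone? strict x ≡ true
  inCone?-complete strict x hc with HCone⇒InCone strict x hc
  ... | x∈ , c≥0 , c>0 = cong₂ _∧_ (⌊⌋-true (inSpan? x) x∈)
                                   (all-true _ (λ l → admissible-complete (strict l) (coord x l) (c≥0 l) (c>0 l)))

toℚ : ℤ → ℚ
toℚ z = z ℚ./ 1

toℚ-mkℚ : ∀ z → toℚ z ≡ mkℚ z 0 (ℕ.sym (ℕ.1-coprimeTo ℤ.∣ z ∣))
toℚ-mkℚ z = ℚ.↥p/↧p≡p (mkℚ z 0 (ℕ.sym (ℕ.1-coprimeTo ℤ.∣ z ∣)))

toℚ-+ : ∀ a b → toℚ (a ℤ.+ b) ≡ toℚ a + toℚ b
toℚ-+ a b rewrite toℚ-mkℚ a | toℚ-mkℚ b =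
  cong toℚ (cong₂ ℤ._+_ (sym (ℤ.*-identityʳ a)) (sym (ℤ.*-identityʳ b)))

toℚ-* : ∀ a b → toℚ (a ℤ.* b) ≡ toℚ a * toℚ b
toℚ-* a b rewrite toℚ-mkℚ a | toℚ-mkℚ b = refl

toℚ-neg : ∀ a → toℚ (ℤ.- a) ≡ - toℚ a
toℚ-neg a rewrite toℚ-mkℚ a | toℚ-mkℚ (ℤ.- a) with a
... | ℤ.+ zero  = refl
... | ℤ.+ suc n = refl
... | -[1+ n ]  = refl

toℚ-- : ∀ a b → toℚ (a ℤ.- b) ≡ toℚ a - toℚ b
toℚ-- a b = trans (toℚ-+ a (ℤ.- b)) (cong (toℚ a +_) (toℚ-neg b))

toℚ-mono-≤ : ∀ {a b} → a ℤ.≤ b → toℚ a ℚ.≤ toℚ b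
toℚ-mono-≤ {a} {b} a≤b rewrite toℚ-mkℚ a | toℚ-mkℚ b =
  ℚ.*≤* (subst₂ ℤ._≤_ (sym (ℤ.*-identityʳ a)) (sym (ℤ.*-identityʳ b)) a≤b)

toℚ-cancel-≤ : ∀ {a b} → toℚ a ℚ.≤ toℚ b → a ℤ.≤ b
toℚ-cancel-≤ {a} {b} a≤b rewrite toℚ-mkℚ a | toℚ-mkℚ b with a≤b
... | ℚ.*≤* a≤b′ = subst₂ ℤ._≤_ (ℤ.*-identityʳ a) (ℤ.*-identityʳ b) a≤b′

toℚ-∣∣ : ∀ z → ∣ toℚ z ∣ ≡ toℚ (ℤ.+ ℤ.∣ z ∣)
toℚ-∣∣ z rewrite toℚ-mkℚ z | toℚ-mkℚ (ℤ.+ ℤ.∣ z ∣) = refl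

toℚ-suc-pos : ∀ k → 0ℚ ℚ.< toℚ (ℤ.+ suc k)
toℚ-suc-pos k rewrite toℚ-mkℚ (ℤ.+ suc k) = ℚ.positive⁻¹ _

lookup-toℚv : ∀ {d} (e : Vec ℤ d) j → lookup (toℚv e) j ≡ toℚ (lookup e j)
lookup-toℚv e j = Vec.lookup-map j toℚ e

_⊖_ : ∀ {d} → Vec ℤ d → Vec ℤ d → Vec ℤ d
_⊖_ = zipWith ℤ._-_

toℚv-⊖ : ∀ {d} (e u : Vec ℤ d) → toℚv (e ⊖ u) ≡ toℚv e +v (-v toℚv u)
toℚv-⊖ e u = lookup-ext λ j → begin
  lookup (toℚv (e ⊖ u)) j                        ≡⟨ lookup-toℚv (e ⊖ u) j ⟩
  toℚ (lookup (e ⊖ u) j)                         ≡⟨ cong toℚ (Vec.lookup-zipWith ℤ._-_ j e u) ⟩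
  toℚ (lookup e j ℤ.- lookup u j)                ≡⟨ toℚ-- (lookup e j) (lookup u j) ⟩
  toℚ (lookup e j) - toℚ (lookup u j)            ≡⟨ cong₂ _-_ (lookup-toℚv e j) (lookup-toℚv u j) ⟨
  lookup (toℚv e) j + - lookup (toℚv u) j        ≡⟨ cong (lookup (toℚv e) j +_) (Vec.lookup-map j -_ (toℚv u)) ⟨
  lookup (toℚv e) j + lookup (-v toℚv u) j       ≡⟨ lookup-+v (toℚv e) (-v toℚv u) j ⟨
  lookup (toℚv e +v (-v toℚv u)) j               ∎
  where open ≡-Reasoning

toℚv-0 : ∀ d → toℚv (replicate d 0ℤ) ≡ replicate d 0ℚ
toℚv-0 zero    = refl
toℚv-0 (suc d) = cong (0ℚ ∷_) (toℚv-0 d)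

eval-toℚv-⊖ : ∀ {d} (φ : LinearForm d) (e u : Vec ℤ d) → eval φ (toℚv (e ⊖ u)) ≡ eval φ (toℚv e) - eval φ (toℚv u)
eval-toℚv-⊖ φ e u = trans (cong (eval φ) (toℚv-⊖ e u)) (eval-sub φ (toℚv e) (toℚv u))

denominator-clears : ∀ q → toℚ (ℤ.+ ℚ.ℚ.denominatorℕ q) * q ≡ toℚ (ℚ.ℚ.numerator q)
denominator-clears (mkℚ n k _) rewrite toℚ-mkℚ (ℤ.+ suc k) =
  ℚ.fromℚᵘ-cong {ℚᵘ.mkℚᵘ (ℤ.+ suc k ℤ.* n) (k ℕ.+ 0)} {ℚᵘ.mkℚᵘ n 0}
    (ℚᵘ.*≡* (trans (ℤ-lemma (ℤ.+ suc k) n) (cong (λ m → n ℤ.* ℤ.+ suc m) (sym (ℕ.+-identityʳ k)))))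
  where
  ℤ-lemma : ∀ (a b : ℤ) → a ℤ.* b ℤ.* 1ℤ ≡ b ℤ.* a
  ℤ-lemma = solve-∀

clearDenominators : ∀ {d} (u : Vec ℚ d) → Σ ℕ λ K → Σ (Vec ℤ d) λ z → toℚv z ≡ toℚ (ℤ.+ suc K) ·v u
clearDenominators [] = 0 , [] , refl
clearDenominators (q ∷ u) with clearDenominators u | ℚ.ℚ.denominatorℕ q in den≡
... | K , z , z≡Ku | suc k = k ℕ.+ K ℕ.* suc k , (ℤ.+ suc K ℤ.* ℚ.ℚ.numerator q) ∷ Vec.map (ℤ.+ suc k ℤ.*_) z
                           , cong₂ _∷_ head≡ (lookup-ext tail≡)
  where
  κ : ℚ
  κ = toℚ (ℤ.+ suc K)
  δq : ℚ
  δq = toℚ (ℤ.+ suc k)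
  toℚ-K*k : toℚ (ℤ.+ (suc K ℕ.* suc k)) ≡ κ * δq
  toℚ-K*k = trans (cong toℚ (ℤ.pos-* (suc K) (suc k))) (toℚ-* (ℤ.+ suc K) (ℤ.+ suc k))
  head≡ : toℚ (ℤ.+ suc K ℤ.* ℚ.ℚ.numerator q) ≡ toℚ (ℤ.+ (suc K ℕ.* suc k)) * q
  head≡ = begin
    toℚ (ℤ.+ suc K ℤ.* ℚ.ℚ.numerator q)   ≡⟨ toℚ-* (ℤ.+ suc K) (ℚ.ℚ.numerator q) ⟩
    κ * toℚ (ℚ.ℚ.numerator q)             ≡⟨ cong (κ *_) (denominator-clears q) ⟨
    κ * (toℚ (ℤ.+ ℚ.ℚ.denominatorℕ q) * q) ≡⟨ cong (λ m → κ * (toℚ (ℤ.+ m) * q)) den≡ ⟩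
    κ * (δq * q)                          ≡⟨ ℚ.*-assoc κ δq q ⟨
    κ * δq * q                            ≡⟨ cong (_* q) toℚ-K*k ⟨
    toℚ (ℤ.+ (suc K ℕ.* suc k)) * q       ∎
    where open ≡-Reasoning
  tail≡ : ∀ j → lookup (toℚv (Vec.map (ℤ.+ suc k ℤ.*_) z)) j ≡ lookup (toℚ (ℤ.+ (suc K ℕ.* suc k)) ·v u) j
  tail≡ j = begin
    lookup (toℚv (Vec.map (ℤ.+ suc k ℤ.*_) z)) j      ≡⟨ lookup-toℚv (Vec.map (ℤ.+ suc k ℤ.*_) z) j ⟩
    toℚ (lookup (Vec.map (ℤ.+ suc k ℤ.*_) z) j)       ≡⟨ cong toℚ (Vec.lookup-map j (ℤ.+ suc k ℤ.*_) z) ⟩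
    toℚ (ℤ.+ suc k ℤ.* lookup z j)                    ≡⟨ toℚ-* (ℤ.+ suc k) (lookup z j) ⟩
    δq * toℚ (lookup z j)                             ≡⟨ cong (δq *_) (trans (sym (lookup-toℚv z j)) (trans (cong (λ v → lookup v j) z≡Ku) (lookup-·v κ u j))) ⟩
    δq * (κ * lookup u j)                             ≡⟨ solve 3 (λ a b c → a :* (b :* c) := (b :* a) :* c) refl δq κ (lookup u j) ⟩
    κ * δq * lookup u j                               ≡⟨ cong (_* lookup u j) toℚ-K*k ⟨
    toℚ (ℤ.+ (suc K ℕ.* suc k)) * lookup u j          ≡⟨ lookup-·v (toℚ (ℤ.+ (suc K ℕ.* suc k))) u j ⟨
    lookup (toℚ (ℤ.+ (suc K ℕ.* suc k)) ·v u) j       ∎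
    where open ≡-Reasoning

-- Formal series and Laurent polynomials

Series : ℕ → Set
Series d = Exp d → ℤ

⊖-comm : ∀ {d} (e u v : Exp d) → (e ⊖ u) ⊖ v ≡ (e ⊖ v) ⊖ u
⊖-comm []      []      []      = refl
⊖-comm (a ∷ e) (b ∷ u) (c ∷ v) = cong₂ _∷_ (ℤ-lemma a b c) (⊖-comm e u v)
  where
  ℤ-lemma : ∀ (a b c : ℤ) → (a ℤ.- b) ℤ.- c ≡ (a ℤ.- c) ℤ.- b
  ℤ-lemma = solve-∀

⊖-+ : ∀ {d} (e u v : Exp d) → e ⊖ zipWith ℤ._+_ u v ≡ (e ⊖ u) ⊖ v
⊖-+ []      []      []      = refl
⊖-+ (a ∷ e) (b ∷ u) (c ∷ v) = cong₂ _∷_ (ℤ-lemma a b c) (⊖-+ e u v)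
  where
  ℤ-lemma : ∀ (a b c : ℤ) → a ℤ.- (b ℤ.+ c) ≡ (a ℤ.- b) ℤ.- c
  ℤ-lemma = solve-∀

⊖-identityʳ : ∀ {d} (e : Exp d) → e ⊖ replicate d 0ℤ ≡ e
⊖-identityʳ []      = refl
⊖-identityʳ (a ∷ e) = cong₂ _∷_ (ℤ.+-identityʳ a) (⊖-identityʳ e)

⊖-self : ∀ {d} (e : Exp d) → e ⊖ e ≡ replicate d 0ℤ
⊖-self []      = refl
⊖-self (a ∷ e) = cong₂ _∷_ (ℤ.+-inverseʳ a) (⊖-self e)

⊖≡0⇒≡ : ∀ {d} (e u : Exp d) → e ⊖ u ≡ replicate d 0ℤ → u ≡ e
⊖≡0⇒≡ []      []      _  = refl
⊖≡0⇒≡ (a ∷ e) (b ∷ u) eq = cong₂ _∷_ (sym (ℤ.i-j≡0⇒i≡j a b (cong Vec.head eq))) (⊖≡0⇒≡ e u (cong Vec.tail eq))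

mulSeries-cong : ∀ {d} (Q : LPoly d) {s s′ : Series d} → (∀ e → s e ≡ s′ e) → ∀ e → mulSeries Q s e ≡ mulSeries Q s′ e
mulSeries-cong []            s≗s′ e = refl
mulSeries-cong ((c , u) ∷ Q) s≗s′ e = cong₂ ℤ._+_ (cong (c ℤ.*_) (s≗s′ (e ⊖ u))) (mulSeries-cong Q s≗s′ e)

mulSeries-zero : ∀ {d} (Q : LPoly d) e → mulSeries Q (λ _ → 0ℤ) e ≡ 0ℤ
mulSeries-zero []            e = refl
mulSeries-zero ((c , u) ∷ Q) e = cong₂ ℤ._+_ (ℤ.*-zeroʳ c) (mulSeries-zero Q e)

mulSeries-+ : ∀ {d} (Q : LPoly d) (s s′ : Series d) e →
              mulSeries Q (λ x → s x ℤ.+ s′ x) e ≡ mulSeries Q s e ℤ.+ mulSeries Q s′ e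
mulSeries-+ []            s s′ e = refl
mulSeries-+ ((c , u) ∷ Q) s s′ e =
  trans (cong (λ z → c ℤ.* (s (e ⊖ u) ℤ.+ s′ (e ⊖ u)) ℤ.+ z) (mulSeries-+ Q s s′ e))
        (ℤ-lemma c (s (e ⊖ u)) (s′ (e ⊖ u)) (mulSeries Q s e) (mulSeries Q s′ e))
  where
  ℤ-lemma : ∀ (c a b x y : ℤ) → c ℤ.* (a ℤ.+ b) ℤ.+ (x ℤ.+ y) ≡ (c ℤ.* a ℤ.+ x) ℤ.+ (c ℤ.* b ℤ.+ y)
  ℤ-lemma = solve-∀

mulSeries-scale : ∀ {d} (Q : LPoly d) (k : ℤ) (s : Series d) e →
                  mulSeries Q (λ x → k ℤ.* s x) e ≡ k ℤ.* mulSeries Q s e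
mulSeries-scale []            k s e = sym (ℤ.*-zeroʳ k)
mulSeries-scale ((c , u) ∷ Q) k s e =
  trans (cong (λ z → c ℤ.* (k ℤ.* s (e ⊖ u)) ℤ.+ z) (mulSeries-scale Q k s e))
        (ℤ-lemma c k (s (e ⊖ u)) (mulSeries Q s e))
  where
  ℤ-lemma : ∀ (c k a x : ℤ) → c ℤ.* (k ℤ.* a) ℤ.+ k ℤ.* x ≡ k ℤ.* (c ℤ.* a ℤ.+ x)
  ℤ-lemma = solve-∀

mulSeries-- : ∀ {d} (Q : LPoly d) (s s′ : Series d) e →
              mulSeries Q (λ x → s x ℤ.- s′ x) e ≡ mulSeries Q s e ℤ.- mulSeries Q s′ e
mulSeries-- Q s s′ e = begin
  mulSeries Q (λ x → s x ℤ.- s′ x) e                         ≡⟨ mulSeries-cong Q (λ x → cong (λ z → s x ℤ.+ z) (ℤ.-1*i≡-i (s′ x))) e ⟨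
  mulSeries Q (λ x → s x ℤ.+ ℤ.-1ℤ ℤ.* s′ x) e               ≡⟨ mulSeries-+ Q s _ e ⟩
  mulSeries Q s e ℤ.+ mulSeries Q (λ x → ℤ.-1ℤ ℤ.* s′ x) e   ≡⟨ cong (λ z → mulSeries Q s e ℤ.+ z) (mulSeries-scale Q ℤ.-1ℤ s′ e) ⟩
  mulSeries Q s e ℤ.+ ℤ.-1ℤ ℤ.* mulSeries Q s′ e             ≡⟨ cong (λ z → mulSeries Q s e ℤ.+ z) (ℤ.-1*i≡-i (mulSeries Q s′ e)) ⟩
  mulSeries Q s e ℤ.- mulSeries Q s′ e                       ∎
  where open ≡-Reasoning

mulSeries-++ : ∀ {d} (A B : LPoly d) (s : Series d) e →
               mulSeries (A ++ B) s e ≡ mulSeries A s e ℤ.+ mulSeries B s e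
mulSeries-++ []            B s e = sym (ℤ.+-identityˡ _)
mulSeries-++ ((c , u) ∷ A) B s e =
  trans (cong (λ z → c ℤ.* s (e ⊖ u) ℤ.+ z) (mulSeries-++ A B s e)) (sym (ℤ.+-assoc (c ℤ.* s (e ⊖ u)) _ _))

mulSeries-shift : ∀ {d} (B : LPoly d) (s : Series d) (u : Exp d) e →
                  mulSeries B (λ x → s (x ⊖ u)) e ≡ mulSeries B s (e ⊖ u)
mulSeries-shift []            s u e = refl
mulSeries-shift ((c , v) ∷ B) s u e = cong₂ ℤ._+_ (cong (λ z → c ℤ.* s z) (⊖-comm e v u)) (mulSeries-shift B s u e)

mulSeries-comm : ∀ {d} (A B : LPoly d) (s : Series d) e →
                 mulSeries A (mulSeries B s) e ≡ mulSeries B (mulSeries A s) e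
mulSeries-comm []            B s e = sym (mulSeries-zero B e)
mulSeries-comm ((c , u) ∷ A) B s e = sym (begin
  mulSeries B (λ x → c ℤ.* s (x ⊖ u) ℤ.+ mulSeries A s x) e
    ≡⟨ mulSeries-+ B (λ x → c ℤ.* s (x ⊖ u)) (mulSeries A s) e ⟩
  mulSeries B (λ x → c ℤ.* s (x ⊖ u)) e ℤ.+ mulSeries B (mulSeries A s) e
    ≡⟨ cong₂ ℤ._+_ (mulSeries-scale B c (λ x → s (x ⊖ u)) e) (sym (mulSeries-comm A B s e)) ⟩
  c ℤ.* mulSeries B (λ x → s (x ⊖ u)) e ℤ.+ mulSeries A (mulSeries B s) e
    ≡⟨ cong (λ z → c ℤ.* z ℤ.+ mulSeries A (mulSeries B s) e) (mulSeries-shift B s u e) ⟩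
  c ℤ.* mulSeries B s (e ⊖ u) ℤ.+ mulSeries A (mulSeries B s) e ∎)
  where open ≡-Reasoning

mulSeries-*P : ∀ {d} (A B : LPoly d) (s : Series d) e → mulSeries (A *P B) s e ≡ mulSeries A (mulSeries B s) e
mulSeries-*P []            B s e = refl
mulSeries-*P ((c , u) ∷ A) B s e =
  trans (mulSeries-++ (shifted B) (A *P B) s e) (cong₂ ℤ._+_ (mulSeries-shifted B e) (mulSeries-*P A B s e))
  where
  shifted : LPoly _ → LPoly _
  shifted = List.map λ { (c′ , u′) → (c ℤ.* c′ , zipWith ℤ._+_ u u′) }
  mulSeries-shifted : ∀ B e → mulSeries (shifted B) s e ≡ c ℤ.* mulSeries B s (e ⊖ u)
  mulSeries-shifted []              e = sym (ℤ.*-zeroʳ c)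
  mulSeries-shifted ((c′ , u′) ∷ B) e =
    trans (cong₂ ℤ._+_ (cong (λ z → c ℤ.* c′ ℤ.* s z) (⊖-+ e u u′)) (mulSeries-shifted B e))
          (ℤ-lemma c c′ (s ((e ⊖ u) ⊖ u′)) (mulSeries B s (e ⊖ u)))
    where
    ℤ-lemma : ∀ (c c′ a x : ℤ) → c ℤ.* c′ ℤ.* a ℤ.+ c ℤ.* x ≡ c ℤ.* (c′ ℤ.* a ℤ.+ x)
    ℤ-lemma = solve-∀

coeff-++ : ∀ {d} (A B : LPoly d) e → coeff (A ++ B) e ≡ coeff A e ℤ.+ coeff B e
coeff-++ []            B e = sym (ℤ.+-identityˡ _)
coeff-++ ((c , u) ∷ A) B e =
  trans (cong (λ z → (if ⌊ u ≟e e ⌋ then c else 0ℤ) ℤ.+ z) (coeff-++ A B e))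
        (sym (ℤ.+-assoc (if ⌊ u ≟e e ⌋ then c else 0ℤ) (coeff A e) (coeff B e)))

unitSeries : ∀ {d} → Series d
unitSeries {d} e = if ⌊ replicate d 0ℤ ≟e e ⌋ then 1ℤ else 0ℤ

coeff≡mulSeries-unit : ∀ {d} (B : LPoly d) e → coeff B e ≡ mulSeries B unitSeries e
coeff≡mulSeries-unit []                e = refl
coeff≡mulSeries-unit {d} ((c , u) ∷ B) e = cong₂ ℤ._+_ term (coeff≡mulSeries-unit B e)
  where
  term : (if ⌊ u ≟e e ⌋ then c else 0ℤ) ≡ c ℤ.* unitSeries (e ⊖ u)
  term with u ≟e e | replicate d 0ℤ ≟e (e ⊖ u)
  ... | yes refl | yes _   = sym (ℤ.*-identityʳ c)
  ... | yes refl | no e≢u  = ⊥-elim (e≢u (sym (⊖-self u)))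
  ... | no u≢e   | yes 0≡  = ⊥-elim (u≢e (⊖≡0⇒≡ e u (sym 0≡)))
  ... | no _     | no _    = sym (ℤ.*-zeroʳ c)

coeff-*P : ∀ {d} (A B : LPoly d) e → coeff (A *P B) e ≡ mulSeries A (coeff B) e
coeff-*P A B e = begin
  coeff (A *P B) e                          ≡⟨ coeff≡mulSeries-unit (A *P B) e ⟩
  mulSeries (A *P B) unitSeries e           ≡⟨ mulSeries-*P A B unitSeries e ⟩
  mulSeries A (mulSeries B unitSeries) e    ≡⟨ mulSeries-cong A (λ x → sym (coeff≡mulSeries-unit B x)) e ⟩
  mulSeries A (coeff B) e                   ∎
  where open ≡-Reasoning

mulSeries-coeff-comm : ∀ {d} (A B : LPoly d) e → mulSeries A (coeff B) e ≡ mulSeries B (coeff A) e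
mulSeries-coeff-comm A B e = begin
  mulSeries A (coeff B) e                   ≡⟨ mulSeries-cong A (coeff≡mulSeries-unit B) e ⟩
  mulSeries A (mulSeries B unitSeries) e    ≡⟨ mulSeries-comm A B unitSeries e ⟩
  mulSeries B (mulSeries A unitSeries) e    ≡⟨ mulSeries-cong B (λ x → sym (coeff≡mulSeries-unit A x)) e ⟩
  mulSeries B (coeff A) e                   ∎
  where open ≡-Reasoning

mulSeries-oneP : ∀ {d} (s : Series d) e → mulSeries (oneP {d}) s e ≡ s e
mulSeries-oneP s e = trans (ℤ.+-identityʳ _) (trans (ℤ.*-identityˡ _) (cong s (⊖-identityʳ e)))

Represents : ∀ {d} → RatFun d → Series d → Set
Represents (P , Q) s = ∀ e → mulSeries Q s e ≡ coeff P e

represents-zeroR : ∀ {d} → Represents (zeroR {d}) (λ _ → 0ℤ)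
represents-zeroR e = mulSeries-oneP (λ _ → 0ℤ) e

represents-+R : ∀ {d} {F G : RatFun d} {s s′ : Series d} → Represents F s → Represents G s′ →
                Represents (F +R G) (λ x → s x ℤ.+ s′ x)
represents-+R {F = P , Q} {P′ , Q′} {s} {s′} F≈s G≈s′ e = begin
  mulSeries (Q *P Q′) (λ x → s x ℤ.+ s′ x) e
    ≡⟨ mulSeries-*P Q Q′ _ e ⟩
  mulSeries Q (mulSeries Q′ (λ x → s x ℤ.+ s′ x)) e
    ≡⟨ mulSeries-cong Q (mulSeries-+ Q′ s s′) e ⟩
  mulSeries Q (λ x → mulSeries Q′ s x ℤ.+ mulSeries Q′ s′ x) e
    ≡⟨ mulSeries-+ Q (mulSeries Q′ s) (mulSeries Q′ s′) e ⟩
  mulSeries Q (mulSeries Q′ s) e ℤ.+ mulSeries Q (mulSeries Q′ s′) e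
    ≡⟨ cong₂ ℤ._+_ (mulSeries-comm Q Q′ s e) (mulSeries-cong Q G≈s′ e) ⟩
  mulSeries Q′ (mulSeries Q s) e ℤ.+ mulSeries Q (coeff P′) e
    ≡⟨ cong₂ ℤ._+_ (mulSeries-cong Q′ F≈s e) (mulSeries-coeff-comm Q P′ e) ⟩
  mulSeries Q′ (coeff P) e ℤ.+ mulSeries P′ (coeff Q) e
    ≡⟨ cong₂ ℤ._+_ (mulSeries-coeff-comm Q′ P e) (sym (coeff-*P P′ Q e)) ⟩
  mulSeries P (coeff Q′) e ℤ.+ coeff (P′ *P Q) e
    ≡⟨ cong (λ z → z ℤ.+ coeff (P′ *P Q) e) (sym (coeff-*P P Q′ e)) ⟩
  coeff (P *P Q′) e ℤ.+ coeff (P′ *P Q) e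
    ≡⟨ sym (coeff-++ (P *P Q′) (P′ *P Q) e) ⟩
  coeff ((P *P Q′) ++ (P′ *P Q)) e ∎
  where open ≡-Reasoning

represents-≈R : ∀ {d} {F G : RatFun d} {s s′ : Series d} → Represents F s → Represents G s′ →
                (∀ e → mulSeries (proj₂ F) (mulSeries (proj₂ G) (λ x → s x ℤ.- s′ x)) e ≡ 0ℤ) → F ≈R G
represents-≈R {F = P , Q} {P′ , Q′} {s} {s′} F≈s G≈s′ annihilates e = begin
  coeff (P *P Q′) e                   ≡⟨ coeff-*P P Q′ e ⟩
  mulSeries P (coeff Q′) e            ≡⟨ mulSeries-coeff-comm Q′ P e ⟨
  mulSeries Q′ (coeff P) e            ≡⟨ mulSeries-cong Q′ F≈s e ⟨
  mulSeries Q′ (mulSeries Q s) e      ≡⟨ mulSeries-comm Q Q′ s e ⟨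
  mulSeries Q (mulSeries Q′ s) e      ≡⟨ ℤ.i-j≡0⇒i≡j _ _ difference≡0 ⟩
  mulSeries Q (mulSeries Q′ s′) e     ≡⟨ mulSeries-cong Q G≈s′ e ⟩
  mulSeries Q (coeff P′) e            ≡⟨ mulSeries-coeff-comm Q P′ e ⟩
  mulSeries P′ (coeff Q) e            ≡⟨ coeff-*P P′ Q e ⟨
  coeff (P′ *P Q) e                   ∎
  where
  open ≡-Reasoning
  difference≡0 : mulSeries Q (mulSeries Q′ s) e ℤ.- mulSeries Q (mulSeries Q′ s′) e ≡ 0ℤ
  difference≡0 = begin
    mulSeries Q (mulSeries Q′ s) e ℤ.- mulSeries Q (mulSeries Q′ s′) e  ≡⟨ mulSeries-- Q (mulSeries Q′ s) (mulSeries Q′ s′) e ⟨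
    mulSeries Q (λ x → mulSeries Q′ s x ℤ.- mulSeries Q′ s′ x) e        ≡⟨ mulSeries-cong Q (mulSeries-- Q′ s s′) e ⟨
    mulSeries Q (mulSeries Q′ (λ x → s x ℤ.- s′ x)) e                   ≡⟨ annihilates e ⟩
    0ℤ                                                                  ∎

binomial : ∀ {d} → Exp d → LPoly d
binomial {d} u = (1ℤ , replicate d 0ℤ) ∷ (ℤ.- 1ℤ , u) ∷ []

mulSeries-binomial : ∀ {d} (u : Exp d) (s : Series d) e → mulSeries (binomial u) s e ≡ s e ℤ.- s (e ⊖ u)
mulSeries-binomial u s e = trans (cong (λ x → 1ℤ ℤ.* s x ℤ.+ (ℤ.- 1ℤ ℤ.* s (e ⊖ u) ℤ.+ 0ℤ)) (⊖-identityʳ e))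
                                 (ℤ-lemma (s e) (s (e ⊖ u)))
  where
  ℤ-lemma : ∀ (a b : ℤ) → 1ℤ ℤ.* a ℤ.+ (ℤ.- 1ℤ ℤ.* b ℤ.+ 0ℤ) ≡ a ℤ.- b
  ℤ-lemma = solve-∀

Periodic : ∀ {d} → Exp d → Series d → Set
Periodic u s = ∀ e → s (e ⊖ u) ≡ s e

mulSeries-periodic : ∀ {d} (A : LPoly d) {u : Exp d} {s : Series d} → Periodic u s → Periodic u (mulSeries A s)
mulSeries-periodic A {u} {s} per e = trans (sym (mulSeries-shift A s u e)) (mulSeries-cong A per e)

binomial-annihilates : ∀ {d} {u : Exp d} {s : Series d} → Periodic u s → ∀ e → mulSeries (binomial u) s e ≡ 0ℤ
binomial-annihilates {u = u} {s} per e = trans (mulSeries-binomial u s e)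
  (trans (cong (λ z → s e ℤ.- z) (per e)) (ℤ.+-inverseʳ (s e)))

indicatorSeries : ∀ {d} {S : Exp d → Set} {s : Series d} → (∀ m → (S m → s m ≡ 1ℤ) × (¬ S m → s m ≡ 0ℤ)) →
                  ∀ e (b : Bool) → (b ≡ true → S e) → (S e → b ≡ true) → s e ≡ indicator b
indicatorSeries s-indicator e true  sound _        = proj₁ (s-indicator e) (sound refl)
indicatorSeries s-indicator e false _     complete = proj₂ (s-indicator e) (λ e∈S → Bool.not-¬ refl (complete e∈S))

represents-sumR : ∀ {n d} (sel : Fin n → Bool) (G : Fin n → RatFun d) (s : Fin n → Series d) →
                  (∀ l → sel l ≡ true → Represents (G l) (s l)) →
                  Represents (sumR sel G) (λ e → ℤΣ.sum (λ l → if sel l then s l e else 0ℤ))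
represents-sumR {zero}  sel G s G≈s = represents-zeroR
represents-sumR {suc n} sel G s G≈s =
  represents-+R {F = if sel zero then G zero else zeroR} {G = sumR (sel ∘ suc) (G ∘ suc)}
    (head (sel zero) refl) (represents-sumR (sel ∘ suc) (G ∘ suc) (s ∘ suc) (G≈s ∘ suc))
  where
  head : ∀ b → sel zero ≡ b → Represents (if sel zero then G zero else zeroR) (λ e → if sel zero then s zero e else 0ℤ)
  head true  sel₀ rewrite sel₀ = G≈s zero sel₀
  head false sel₀ rewrite sel₀ = represents-zeroR

-- the integers z with ∣ z ∣ ≤ M, each once
interval : ℕ → List ℤ
interval M = List.map -[1+_] (List.downFrom M) ++ List.map ℤ.+_ (List.downFrom (suc M))

box : (d : ℕ) → ℕ → List (Exp d)
box zero    M = [] ∷ []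
box (suc d) M = concatMap (λ z → List.map (z ∷_) (box d M)) (interval M)

inBox : ∀ {d} → ℕ → Exp d → Bool
inBox M []      = true
inBox M (z ∷ e) = ⌊ ℤ.∣ z ∣ ℕ.≤? M ⌋ ∧ inBox M e

inBox-true : ∀ {d} M (e : Exp d) → (∀ j → ℤ.∣ lookup e j ∣ ℕ.≤ M) → inBox M e ≡ true
inBox-true M []      _       = refl
inBox-true M (z ∷ e) bounded =
  cong₂ _∧_ (⌊⌋-true (ℤ.∣ z ∣ ℕ.≤? M) (bounded zero)) (inBox-true M e (bounded ∘ suc))

listing : ∀ {d} → Series d → List (Exp d) → LPoly d
listing g = List.map λ e → (g e , e)

coeff-listing-++ : ∀ {d} (g : Series d) (A B : List (Exp d)) e →
                   coeff (listing g (A ++ B)) e ≡ coeff (listing g A) e ℤ.+ coeff (listing g B) e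
coeff-listing-++ g A B e = trans (cong (λ L → coeff L e) (List.map-++ _ A B)) (coeff-++ (listing g A) (listing g B) e)

pick : List ℤ → (ℤ → ℤ) → ℤ → ℤ
pick []      G h = 0ℤ
pick (z ∷ R) G h = (if ⌊ z ℤ.≟ h ⌋ then G z else 0ℤ) ℤ.+ pick R G h

pick-++ : ∀ A B G h → pick (A ++ B) G h ≡ pick A G h ℤ.+ pick B G h
pick-++ []      B G h = sym (ℤ.+-identityˡ _)
pick-++ (z ∷ A) B G h = trans (cong (λ x → (if ⌊ z ℤ.≟ h ⌋ then G z else 0ℤ) ℤ.+ x) (pick-++ A B G h))
                              (sym (ℤ.+-assoc (if ⌊ z ℤ.≟ h ⌋ then G z else 0ℤ) (pick A G h) (pick B G h)))

pick-cong : ∀ R {G G′ : ℤ → ℤ} h → (∀ z → G z ≡ G′ z) → pick R G h ≡ pick R G′ h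
pick-cong []      h G≗G′ = refl
pick-cong (z ∷ R) h G≗G′ = cong₂ ℤ._+_ (cong (λ x → if ⌊ z ℤ.≟ h ⌋ then x else 0ℤ) (G≗G′ z)) (pick-cong R h G≗G′)

≟e-∷ : ∀ {d} (z h : ℤ) (a t : Exp d) → ⌊ (z ∷ a) ≟e (h ∷ t) ⌋ ≡ ⌊ z ℤ.≟ h ⌋ ∧ ⌊ a ≟e t ⌋
≟e-∷ z h a t = trans (isYes≗does ((z ∷ a) ≟e (h ∷ t))) (sym (cong₂ _∧_ (isYes≗does (z ℤ.≟ h)) (isYes≗does (a ≟e t))))

coeff-listing-map-∷ : ∀ {d} (z h : ℤ) (B : List (Exp d)) (g : Series (suc d)) t →
  coeff (listing g (List.map (z ∷_) B)) (h ∷ t) ≡ (if ⌊ z ℤ.≟ h ⌋ then coeff (listing (g ∘ (z ∷_)) B) t else 0ℤ)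
coeff-listing-map-∷ z h []      g t with ⌊ z ℤ.≟ h ⌋
... | true  = refl
... | false = refl
coeff-listing-map-∷ z h (b ∷ B) g t rewrite ≟e-∷ z h b t | coeff-listing-map-∷ z h B g t with ⌊ z ℤ.≟ h ⌋
... | true  = refl
... | false = refl

coeff-listing-concatMap : ∀ {d} (R : List ℤ) (B : List (Exp d)) (g : Series (suc d)) h t →
  coeff (listing g (concatMap (λ z → List.map (z ∷_) B) R)) (h ∷ t) ≡ pick R (λ z → coeff (listing (g ∘ (z ∷_)) B) t) h
coeff-listing-concatMap []      B g h t = refl
coeff-listing-concatMap (z ∷ R) B g h t =
  trans (coeff-listing-++ g (List.map (z ∷_) B) (concatMap (λ z → List.map (z ∷_) B) R) (h ∷ t))
        (cong₂ ℤ._+_ (coeff-listing-map-∷ z h B g t) (coeff-listing-concatMap R B g h t))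

pick-downFrom : (ι : ℕ → ℤ) → (∀ {i k} → ι i ≡ ι k → i ≡ k) → ∀ K G k →
                pick (List.map ι (List.downFrom K)) G (ι k) ≡ (if ⌊ k ℕ.<? K ⌋ then G (ι k) else 0ℤ)
pick-downFrom ι inj zero G k = refl
pick-downFrom ι inj (suc K) G k with ι K ℤ.≟ ι k
... | yes ιK≡ιk rewrite pick-downFrom ι inj K G k | inj ιK≡ιk with k ℕ.<? suc k | k ℕ.<? k
...   | yes _     | yes k<k  = ⊥-elim (ℕ.<-irrefl refl k<k)
...   | yes _     | no _     = ℤ.+-identityʳ _
...   | no k≮1+k  | _        = ⊥-elim (k≮1+k (ℕ.n<1+n k))
pick-downFrom ι inj (suc K) G k | no ιK≢ιk rewrite pick-downFrom ι inj K G k with k ℕ.<? suc K | k ℕ.<? K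
...   | yes _     | yes _    = ℤ.+-identityˡ _
...   | no _      | no _     = refl
...   | yes k<1+K | no k≮K   = ⊥-elim (k≮K (ℕ.≤∧≢⇒< (ℕ.≤-pred k<1+K) (λ k≡K → ιK≢ιk (cong ι (sym k≡K)))))
...   | no k≮1+K  | yes k<K  = ⊥-elim (k≮1+K (ℕ.m<n⇒m<1+n k<K))

pick-downFrom-miss : (ι ι′ : ℕ → ℤ) → (∀ {i k} → ι i ≢ ι′ k) → ∀ K G k → pick (List.map ι (List.downFrom K)) G (ι′ k) ≡ 0ℤ
pick-downFrom-miss ι ι′ disjoint zero    G k = refl
pick-downFrom-miss ι ι′ disjoint (suc K) G k with ι K ℤ.≟ ι′ k
... | yes ιK≡ι′k = ⊥-elim (disjoint ιK≡ι′k)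
... | no _       = trans (ℤ.+-identityˡ _) (pick-downFrom-miss ι ι′ disjoint K G k)

pick-interval : ∀ M G h → pick (interval M) G h ≡ (if ⌊ ℤ.∣ h ∣ ℕ.≤? M ⌋ then G h else 0ℤ)
pick-interval M G (ℤ.+ k) = begin
  pick (interval M) G (ℤ.+ k)
    ≡⟨ pick-++ (List.map -[1+_] (List.downFrom M)) _ G (ℤ.+ k) ⟩
  pick (List.map -[1+_] (List.downFrom M)) G (ℤ.+ k) ℤ.+ pick (List.map ℤ.+_ (List.downFrom (suc M))) G (ℤ.+ k)
    ≡⟨ cong₂ ℤ._+_ (pick-downFrom-miss -[1+_] ℤ.+_ (λ ()) M G k) (pick-downFrom ℤ.+_ ℤ.+-injective (suc M) G k) ⟩
  0ℤ ℤ.+ (if ⌊ k ℕ.<? suc M ⌋ then G (ℤ.+ k) else 0ℤ)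
    ≡⟨ ℤ.+-identityˡ _ ⟩
  (if ⌊ k ℕ.<? suc M ⌋ then G (ℤ.+ k) else 0ℤ)
    ≡⟨ cong (λ b → if b then G (ℤ.+ k) else 0ℤ) (⌊⌋-⇔ ℕ.≤-pred ℕ.s≤s (k ℕ.<? suc M) (k ℕ.≤? M)) ⟩
  (if ⌊ k ℕ.≤? M ⌋ then G (ℤ.+ k) else 0ℤ) ∎
  where open ≡-Reasoning
pick-interval M G -[1+ k ] = begin
  pick (interval M) G -[1+ k ]
    ≡⟨ pick-++ (List.map -[1+_] (List.downFrom M)) _ G -[1+ k ] ⟩
  pick (List.map -[1+_] (List.downFrom M)) G -[1+ k ] ℤ.+ pick (List.map ℤ.+_ (List.downFrom (suc M))) G -[1+ k ]
    ≡⟨ cong₂ ℤ._+_ (pick-downFrom -[1+_] ℤ.-[1+-injective M G k) (pick-downFrom-miss ℤ.+_ -[1+_] (λ ()) (suc M) G k) ⟩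
  (if ⌊ k ℕ.<? M ⌋ then G -[1+ k ] else 0ℤ) ℤ.+ 0ℤ
    ≡⟨ ℤ.+-identityʳ _ ⟩
  (if ⌊ k ℕ.<? M ⌋ then G -[1+ k ] else 0ℤ) ∎
  where open ≡-Reasoning

coeff-listing-box : ∀ d M (g : Series d) e → coeff (listing g (box d M)) e ≡ (if inBox M e then g e else 0ℤ)
coeff-listing-box zero    M g [] = ℤ.+-identityʳ (g [])
coeff-listing-box (suc d) M g (h ∷ t) = begin
  coeff (listing g (box (suc d) M)) (h ∷ t)
    ≡⟨ coeff-listing-concatMap (interval M) (box d M) g h t ⟩
  pick (interval M) (λ z → coeff (listing (g ∘ (z ∷_)) (box d M)) t) h
    ≡⟨ pick-cong (interval M) h (λ z → coeff-listing-box d M (g ∘ (z ∷_)) t) ⟩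
  pick (interval M) (λ z → if inBox M t then g (z ∷ t) else 0ℤ) h
    ≡⟨ pick-interval M _ h ⟩
  (if ⌊ ℤ.∣ h ∣ ℕ.≤? M ⌋ then (if inBox M t then g (h ∷ t) else 0ℤ) else 0ℤ)
    ≡⟨ if-∧ ⌊ ℤ.∣ h ∣ ℕ.≤? M ⌋ ⟩
  (if inBox M (h ∷ t) then g (h ∷ t) else 0ℤ) ∎
  where
  open ≡-Reasoning
  if-∧ : ∀ a → (if a then (if inBox M t then g (h ∷ t) else 0ℤ) else 0ℤ) ≡ (if a ∧ inBox M t then g (h ∷ t) else 0ℤ)
  if-∧ true  = refl
  if-∧ false = refl

module Monic {d} (ψ : LinearForm d) where

  0ₑ : Exp d
  0ₑ = replicate d 0ℤ

  ψ0ₑ≡0 : eval ψ (toℚv 0ₑ) ≡ 0ℚ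
  ψ0ₑ≡0 = trans (cong (eval ψ) (toℚv-0 d)) (eval-0 ψ)

  SupportedIn≥0 : Series d → Set
  SupportedIn≥0 s = ∀ e → eval ψ (toℚv e) ℚ.< 0ℚ → s e ≡ 0ℤ

  -- B = 1 + (terms of positive ψ-degree), expressed through its action on series
  IsMonic : LPoly d → Set
  IsMonic B = ∀ s → SupportedIn≥0 s → SupportedIn≥0 (mulSeries B s) × mulSeries B s 0ₑ ≡ s 0ₑ

  binomial-monic : ∀ u → 0ℚ ℚ.< eval ψ (toℚv u) → IsMonic (binomial u)
  binomial-monic u ψu>0 s supp = supp′ , at0
    where
    ψ-descends : ∀ e → eval ψ (toℚv (e ⊖ u)) ℚ.< eval ψ (toℚv e)
    ψ-descends e = subst (ℚ._< eval ψ (toℚv e)) (sym (eval-toℚv-⊖ ψ e u)) (p-q<p (eval ψ (toℚv e)) ψu>0)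
    supp′ : SupportedIn≥0 (mulSeries (binomial u) s)
    supp′ e ψe<0 = trans (mulSeries-binomial u s e)
      (cong₂ ℤ._-_ (supp e ψe<0) (supp (e ⊖ u) (ℚ.<-trans (ψ-descends e) ψe<0)))
    at0 : mulSeries (binomial u) s 0ₑ ≡ s 0ₑ
    at0 = trans (mulSeries-binomial u s 0ₑ)
      (trans (cong (λ z → s 0ₑ ℤ.- z) (supp (0ₑ ⊖ u) (subst (eval ψ (toℚv (0ₑ ⊖ u)) ℚ.<_) ψ0ₑ≡0 (ψ-descends 0ₑ))))
             (ℤ.+-identityʳ (s 0ₑ)))

  *P-monic : ∀ A B → IsMonic A → IsMonic B → IsMonic (A *P B)
  *P-monic A B A-monic B-monic s supp =
      (λ e ψe<0 → trans (mulSeries-*P A B s e) (proj₁ (A-monic _ (proj₁ (B-monic s supp))) e ψe<0))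
    , trans (mulSeries-*P A B s 0ₑ) (trans (proj₂ (A-monic _ (proj₁ (B-monic s supp)))) (proj₂ (B-monic s supp)))

  oneP-monic : IsMonic oneP
  oneP-monic s supp = (λ e ψe<0 → trans (mulSeries-oneP s e) (supp e ψe<0)) , mulSeries-oneP s 0ₑ

  monic⇒nonZero : ∀ B → IsMonic B → NonZeroP B
  monic⇒nonZero B B-monic = 0ₑ , λ B₀≡0 → 1≢0 (begin
    1ℤ                                ≡⟨ unit-at-0 ⟨
    unitSeries 0ₑ                     ≡⟨ proj₂ (B-monic unitSeries unit-supported) ⟨
    mulSeries B unitSeries 0ₑ         ≡⟨ coeff≡mulSeries-unit B 0ₑ ⟨
    coeff B 0ₑ                        ≡⟨ B₀≡0 ⟩
    0ℤ                                ∎)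
    where
    open ≡-Reasoning
    1≢0 : 1ℤ ≢ 0ℤ
    1≢0 ()
    unit-at-0 : unitSeries 0ₑ ≡ 1ℤ
    unit-at-0 = cong (λ b → if b then 1ℤ else 0ℤ) (⌊⌋-true (0ₑ ≟e 0ₑ) refl)
    unit-supported : SupportedIn≥0 unitSeries
    unit-supported e ψe<0 with 0ₑ ≟e e
    ... | yes refl = ⊥-elim (ℚ.<-irrefl ψ0ₑ≡0 ψe<0)
    ... | no _     = refl

-- Generating functions of half-open simplicial cones

∏ : ∀ {n} → (Fin n → ℤ) → ℤ
∏ {zero}  a = 1ℤ
∏ {suc n} a = a zero ℤ.* ∏ (a ∘ suc)

∏-cong : ∀ {n} {a b : Fin n → ℤ} → (∀ l → a l ≡ b l) → ∏ a ≡ ∏ b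
∏-cong {zero}  _   = refl
∏-cong {suc n} a≗b = cong₂ ℤ._*_ (a≗b zero) (∏-cong (a≗b ∘ suc))

∏-zero : ∀ {n} (a : Fin n → ℤ) l → a l ≡ 0ℤ → ∏ a ≡ 0ℤ
∏-zero a zero    aₗ≡0 = cong (ℤ._* ∏ (a ∘ suc)) aₗ≡0
∏-zero a (suc l) aₗ≡0 = trans (cong (a zero ℤ.*_) (∏-zero (a ∘ suc) l aₗ≡0)) (ℤ.*-zeroʳ (a zero))

∏-indicator : ∀ {n} (b : Fin n → Bool) → ∏ (indicator ∘ b) ≡ indicator (all b)
∏-indicator {zero}  b = refl
∏-indicator {suc n} b = trans (cong (indicator (b zero) ℤ.*_) (∏-indicator (b ∘ suc))) (sym (indicator-∧ (b zero) (all (b ∘ suc))))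

∏-difference : ∀ {n} (a b : Fin n → ℤ) (m : Fin n) → (∀ l → l ≢ m → a l ≡ b l) →
               ∏ a ℤ.- ∏ b ≡ ∏ (λ l → if does (l Fin.≟ m) then a l ℤ.- b l else a l)
∏-difference {suc n} a b zero agree =
  trans (cong (λ z → a zero ℤ.* ∏ (a ∘ suc) ℤ.- b zero ℤ.* z) (sym (∏-cong (λ l → agree (suc l) λ ()))))
        (ℤ-lemma (a zero) (b zero) (∏ (a ∘ suc)))
  where
  ℤ-lemma : ∀ (x y z : ℤ) → x ℤ.* z ℤ.- y ℤ.* z ≡ (x ℤ.- y) ℤ.* z
  ℤ-lemma = solve-∀
∏-difference {suc n} a b (suc m) agree =
  trans (cong (λ z → a zero ℤ.* ∏ (a ∘ suc) ℤ.- z ℤ.* ∏ (b ∘ suc)) (sym (agree zero λ ())))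
        (trans (ℤ-lemma (a zero) (∏ (a ∘ suc)) (∏ (b ∘ suc)))
               (cong (a zero ℤ.*_) (∏-difference (a ∘ suc) (b ∘ suc) m (λ l l≢m → agree (suc l) (l≢m ∘ Fin.suc-injective)))))
  where
  ℤ-lemma : ∀ (x y z : ℤ) → x ℤ.* y ℤ.- x ℤ.* z ≡ x ℤ.* (y ℤ.- z)
  ℤ-lemma = solve-∀

when : ∀ {ℓ} {P : Set ℓ} → Dec P → ℤ → ℤ
when (yes _) z = z
when (no _)  z = 0ℤ

when-cong : ∀ {ℓ} {P : Set ℓ} (p? : Dec P) {a b : ℤ} → (P → a ≡ b) → when p? a ≡ when p? b
when-cong (yes p) a≡b = a≡b p
when-cong (no _)  a≡b = refl

when-⇔ : ∀ {ℓ ℓ′} {P : Set ℓ} {R : Set ℓ′} (p? : Dec P) (r? : Dec R) → (P → R) → (R → P) → {a b : ℤ} → a ≡ b → when p? a ≡ when r? b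
when-⇔ (yes p) (yes r) _ _ a≡b = a≡b
when-⇔ (yes p) (no ¬r) f _ a≡b = ⊥-elim (¬r (f p))
when-⇔ (no ¬p) (yes r) _ g a≡b = ⊥-elim (¬p (g r))
when-⇔ (no ¬p) (no ¬r) _ _ a≡b = refl

when-- : ∀ {ℓ} {P : Set ℓ} (p? : Dec P) a b → when p? a ℤ.- when p? b ≡ when p? (a ℤ.- b)
when-- (yes _) a b = refl
when-- (no _)  a b = refl

when-indicator : ∀ {ℓ} {P : Set ℓ} (p? : Dec P) b → when p? (indicator b) ≡ indicator (⌊ p? ⌋ ∧ b)
when-indicator (yes _) b = refl
when-indicator (no _)  b = refl

count : ∀ {n} → Fin n → List (Fin n) → ℕ
count l []      = 0
count l (m ∷ L) = if does (l Fin.≟ m) then suc (count l L) else count l L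

count-allFin : ∀ {n} (l : Fin n) → count l (List.allFin n) ≡ 1
count-allFin {suc n} zero    = cong suc (count-zero-suc {k = n} id)
  where
  count-zero-suc : ∀ {n k} (g : Fin k → Fin n) → count zero (List.tabulate (Fin.suc ∘ g)) ≡ 0
  count-zero-suc {k = zero}  g = refl
  count-zero-suc {k = suc k} g = count-zero-suc (g ∘ suc)
count-allFin {suc n} (suc l) = trans (count-suc-suc {k = n} id) (count-allFin l)
  where
  count-suc-suc : ∀ {k} (g : Fin k → Fin n) → count (suc l) (List.tabulate (Fin.suc ∘ g)) ≡ count l (List.tabulate g)
  count-suc-suc {zero}  g = refl
  count-suc-suc {suc k} g with does (l Fin.≟ g zero)
  ... | true  = cong suc (count-suc-suc (g ∘ suc))
  ... | false = count-suc-suc (g ∘ suc)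

Profile : ℕ → Set
Profile n = Fin n → ℚ → ℤ

difference : ∀ {n} → Profile n → Profile n
difference h l q = h l q ℤ.- h l (q - 1ℚ)

shiftAt : ∀ {n} → Fin n → Profile n → Profile n
shiftAt m h l q = if does (l Fin.≟ m) then h l (q - 1ℚ) else h l q

differenceAt : ∀ {n} → Fin n → Profile n → Profile n
differenceAt m h l q = if does (l Fin.≟ m) then difference h l q else h l q

differencesAlong : ∀ {n} → List (Fin n) → Profile n → Profile n
differencesAlong []      h = h
differencesAlong (m ∷ L) h = differenceAt m (differencesAlong L h)

iterateDifference : ℕ → (ℚ → ℤ) → ℚ → ℤ
iterateDifference zero    g q = g q
iterateDifference (suc k) g q = iterateDifference k g q ℤ.- iterateDifference k g (q - 1ℚ)

differencesAlong-count : ∀ {n} L (h : Profile n) l q → differencesAlong L h l q ≡ iterateDifference (count l L) (h l) q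
differencesAlong-count []      h l q = refl
differencesAlong-count (m ∷ L) h l q with does (l Fin.≟ m)
... | true  = cong₂ ℤ._-_ (differencesAlong-count L h l q) (differencesAlong-count L h l (q - 1ℚ))
... | false = differencesAlong-count L h l q

differencesAlong-allFin : ∀ {n} (h : Profile n) l q → differencesAlong (List.allFin n) h l q ≡ difference h l q
differencesAlong-allFin h l q =
  trans (differencesAlong-count (List.allFin _) h l q) (cong (λ k → iterateDifference k (h l) q) (count-allFin l))

module SimplicialCone {n d} (v : Fin n → Vec ℤ d) (φ : Fin n → LinearForm d) (bi : Biorthogonal (toℚv ∘ v) φ) where
  open Span (toℚv ∘ v) φ bi public

  productSeries : Profile n → Series d
  productSeries h e = when (inSpan? (toℚv e)) (∏ λ l → h l (coord (toℚv e) l))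

  productSeries-cong : ∀ {h h′ : Profile n} → (∀ l q → h l q ≡ h′ l q) → ∀ e → productSeries h e ≡ productSeries h′ e
  productSeries-cong h≗h′ e = when-cong (inSpan? (toℚv e)) λ _ → ∏-cong λ l → h≗h′ l _

  coord-⊖ : ∀ e m l → coord (toℚv (e ⊖ v m)) l ≡ coord (toℚv e) l - δ l m
  coord-⊖ e m l = trans (eval-toℚv-⊖ (φ l) e (v m)) (cong (λ z → coord (toℚv e) l - z) (eval-δ bi l m))

  toℚv-⊖ᵥ : ∀ e m → toℚv (e ⊖ v m) ≡ toℚv e +v ((- 1ℚ) ·v toℚv (v m))
  toℚv-⊖ᵥ e m = trans (toℚv-⊖ e (v m)) (cong (toℚv e +v_) (-v≡-1·v (toℚv (v m))))

  v∈span : ∀ m → InSpan (toℚv (v m))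
  v∈span m = subst InSpan (lincomb-δ (toℚv ∘ v) m) (inSpan-lincomb (λ l → δ l m))

  productSeries-shift : ∀ h e m → productSeries h (e ⊖ v m) ≡ productSeries (shiftAt m h) e
  productSeries-shift h e m = when-⇔ (inSpan? (toℚv (e ⊖ v m))) (inSpan? (toℚv e))
    (λ e-v∈ → inSpan-shift (- 1ℚ) (v∈span m) (subst InSpan (toℚv-⊖ᵥ e m) e-v∈))
    (λ e∈ → subst InSpan (sym (toℚv-⊖ᵥ e m)) (inSpan-+ e∈ (inSpan-· (- 1ℚ) (v∈span m))))
    (∏-cong shifted)
    where
    shifted : ∀ l → h l (coord (toℚv (e ⊖ v m)) l) ≡ shiftAt m h l (coord (toℚv e) l)
    shifted l = trans (cong (h l) (coord-⊖ e m l)) (unshift (l Fin.≟ m))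
      where
      c : ℚ
      c = coord (toℚv e) l
      unshift : (l≟m : Dec (l ≡ m)) → h l (c - (if does l≟m then 1ℚ else 0ℚ)) ≡ (if does l≟m then h l (c - 1ℚ) else h l c)
      unshift (yes _) = refl
      unshift (no _)  = cong (h l) (solve 1 (λ a → a :- con 0ℚ := a) refl c)

  binomial-productSeries : ∀ h m e → mulSeries (binomial (v m)) (productSeries h) e ≡ productSeries (differenceAt m h) e
  binomial-productSeries h m e = begin
    mulSeries (binomial (v m)) (productSeries h) e              ≡⟨ mulSeries-binomial (v m) (productSeries h) e ⟩
    productSeries h e ℤ.- productSeries h (e ⊖ v m)           ≡⟨ cong (λ z → productSeries h e ℤ.- z) (productSeries-shift h e m) ⟩
    productSeries h e ℤ.- productSeries (shiftAt m h) e        ≡⟨ when-- (inSpan? x) (∏ a) (∏ b) ⟩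
    when (inSpan? x) (∏ a ℤ.- ∏ b)                            ≡⟨ when-cong (inSpan? x) (λ _ → trans (∏-difference a b m agree) (∏-cong factor)) ⟩
    productSeries (differenceAt m h) e                         ∎
    where
    open ≡-Reasoning
    x : Vec ℚ d
    x = toℚv e
    a b : Fin n → ℤ
    a l = h l (coord x l)
    b l = shiftAt m h l (coord x l)
    agree : ∀ l → l ≢ m → a l ≡ b l
    agree l l≢m rewrite dec-false (l Fin.≟ m) l≢m = refl
    factor : ∀ l → (if does (l Fin.≟ m) then a l ℤ.- b l else a l) ≡ differenceAt m h l (coord x l)
    factor l with does (l Fin.≟ m)
    ... | true  = refl
    ... | false = refl

  binomials : List (Fin n) → LPoly d
  binomials []      = oneP
  binomials (m ∷ L) = binomial (v m) *P binomials L

  binomials-productSeries : ∀ L h e → mulSeries (binomials L) (productSeries h) e ≡ productSeries (differencesAlong L h) e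
  binomials-productSeries []      h e = mulSeries-oneP (productSeries h) e
  binomials-productSeries (m ∷ L) h e = begin
    mulSeries (binomial (v m) *P binomials L) (productSeries h) e              ≡⟨ mulSeries-*P (binomial (v m)) (binomials L) _ e ⟩
    mulSeries (binomial (v m)) (mulSeries (binomials L) (productSeries h)) e   ≡⟨ mulSeries-cong (binomial (v m)) (binomials-productSeries L h) e ⟩
    mulSeries (binomial (v m)) (productSeries (differencesAlong L h)) e        ≡⟨ binomial-productSeries (differencesAlong L h) m e ⟩
    productSeries (differencesAlong (m ∷ L) h) e                               ∎
    where open ≡-Reasoning

  binomials-monic : ∀ ψ → (∀ m → 0ℚ ℚ.< eval ψ (toℚv (v m))) → ∀ L → Monic.IsMonic ψ (binomials L)
  binomials-monic ψ ψv>0 []      = Monic.oneP-monic ψ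
  binomials-monic ψ ψv>0 (m ∷ L) =
    Monic.*P-monic ψ (binomial (v m)) (binomials L) (Monic.binomial-monic ψ (v m) (ψv>0 m)) (binomials-monic ψ ψv>0 L)

  denominator : LPoly d
  denominator = binomials (List.allFin n)

  denominator-productSeries : ∀ h e → mulSeries denominator (productSeries h) e ≡ productSeries (difference h) e
  denominator-productSeries h e =
    trans (binomials-productSeries (List.allFin n) h e) (productSeries-cong (differencesAlong-allFin h) e)

term≤sumℕ : ∀ {n} (a : Fin n → ℕ) l → a l ≤ ℕΣ.sum a
term≤sumℕ a zero    = ℕ.m≤m+n (a zero) _
term≤sumℕ a (suc l) = ℕ.≤-trans (term≤sumℕ (a ∘ suc) l) (ℕ.m≤n+m _ (a zero))

toℚ-sumℕ : ∀ {n} (a : Fin n → ℕ) → sum (λ l → toℚ (ℤ.+ a l)) ≡ toℚ (ℤ.+ ℕΣ.sum a)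
toℚ-sumℕ {zero}  a = refl
toℚ-sumℕ {suc n} a = begin
  toℚ (ℤ.+ a zero) + sum (λ l → toℚ (ℤ.+ a (suc l)))      ≡⟨ cong (toℚ (ℤ.+ a zero) +_) (toℚ-sumℕ (a ∘ suc)) ⟩
  toℚ (ℤ.+ a zero) + toℚ (ℤ.+ ℕΣ.sum (a ∘ suc))           ≡⟨ toℚ-+ (ℤ.+ a zero) (ℤ.+ ℕΣ.sum (a ∘ suc)) ⟨
  toℚ (ℤ.+ a zero ℤ.+ ℤ.+ ℕΣ.sum (a ∘ suc))               ≡⟨ cong toℚ (ℤ.pos-+ (a zero) _) ⟨
  toℚ (ℤ.+ ℕΣ.sum a)                                      ∎
  where open ≡-Reasoning

sum-mono-≤ : ∀ {n} {a b : Fin n → ℚ} → (∀ l → a l ℚ.≤ b l) → sum a ℚ.≤ sum b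
sum-mono-≤ {zero}  _   = ℚ.≤-refl
sum-mono-≤ {suc n} a≤b = ℚ.+-mono-≤ (a≤b zero) (sum-mono-≤ (a≤b ∘ suc))

∣sum∣≤sum∣∣ : ∀ {n} (a : Fin n → ℚ) → ∣ sum a ∣ ℚ.≤ sum (λ l → ∣ a l ∣)
∣sum∣≤sum∣∣ {zero}  a = ℚ.≤-refl
∣sum∣≤sum∣∣ {suc n} a = ℚ.≤-trans (ℚ.∣p+q∣≤∣p∣+∣q∣ (a zero) (sum (a ∘ suc))) (ℚ.+-monoʳ-≤ ∣ a zero ∣ (∣sum∣≤sum∣∣ (a ∘ suc)))

module SimplicialConeGF {n d} (v : Fin n → Vec ℤ d) (φ : Fin n → LinearForm d) (bi : Biorthogonal (toℚv ∘ v) φ) where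
  open SimplicialCone v φ bi public

  χ : (Fin n → Bool) → Profile n
  χ strict l q = indicator (admissible (strict l) q)

  conePoints : (Fin n → Bool) → Series d
  conePoints strict = productSeries (χ strict)

  conePoints-indicator : ∀ strict e → conePoints strict e ≡ indicator (inCone? strict (toℚv e))
  conePoints-indicator strict e =
    trans (when-cong (inSpan? x) (λ _ → ∏-indicator (λ l → admissible (strict l) (coord x l)))) (when-indicator (inSpan? x) _)
    where
    x : Vec ℚ d
    x = toℚv e

  χ-neg : ∀ strict l {q} → q ℚ.< 0ℚ → χ strict l q ≡ 0ℤ
  χ-neg strict l {q} q<0 with strict l
  ... | true  = cong indicator (dec-false (0ℚ ℚ.<? q) (ℚ.<-asym q<0))
  ... | false = cong indicator (dec-false (0ℚ ℚ.≤? q) (λ q≥0 → ℚ.<-irrefl refl (ℚ.≤-<-trans q≥0 q<0)))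

  χ-pos : ∀ strict l {q} → 0ℚ ℚ.< q → χ strict l q ≡ 1ℤ
  χ-pos strict l {q} q>0 with strict l
  ... | true  = cong indicator (dec-true (0ℚ ℚ.<? q) q>0)
  ... | false = cong indicator (dec-true (0ℚ ℚ.≤? q) (ℚ.<⇒≤ q>0))

  difference-χ-outside : ∀ strict l q → ¬ (0ℚ ℚ.≤ q × q ℚ.≤ 1ℚ) → difference (χ strict) l q ≡ 0ℤ
  difference-χ-outside strict l q outside with 0ℚ ℚ.≤? q
  ... | no q≱0 = cong₂ ℤ._-_ (χ-neg strict l q<0) (χ-neg strict l (ℚ.<-trans (p-q<p q (ℚ.positive⁻¹ 1ℚ)) q<0))
    where
    q<0 : q ℚ.< 0ℚ
    q<0 = ℚ.≰⇒> q≱0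
  ... | yes q≥0 = cong₂ ℤ._-_ (χ-pos strict l (ℚ.<-trans (ℚ.positive⁻¹ 1ℚ) q>1)) (χ-pos strict l q-1>0)
    where
    q>1 : 1ℚ ℚ.< q
    q>1 = ℚ.≰⇒> (λ q≤1 → outside (q≥0 , q≤1))
    q-1>0 : 0ℚ ℚ.< q - 1ℚ
    q-1>0 = subst (ℚ._< q - 1ℚ) (ℚ.+-inverseʳ 1ℚ) (ℚ.+-monoˡ-< (- 1ℚ) q>1)

  boxRadius : ℕ
  boxRadius = ℕΣ.sum λ j → ℕΣ.sum λ l → ℤ.∣ lookup (v l) j ∣

  parallelepiped⊆box : ∀ e → InSpan (toℚv e) → (∀ l → 0ℚ ℚ.≤ coord (toℚv e) l × coord (toℚv e) l ℚ.≤ 1ℚ) →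
                       ∀ j → ℤ.∣ lookup e j ∣ ≤ boxRadius
  parallelepiped⊆box e e∈ unit j = ℕ.≤-trans (ℤ.drop‿+≤+ (toℚ-cancel-≤ ∣eⱼ∣≤)) (term≤sumℕ _ j)
    where
    x : Vec ℚ d
    x = toℚv e
    c : Fin n → ℚ
    c = coord x
    vⱼ : Fin n → ℚ
    vⱼ l = toℚ (lookup (v l) j)
    term≤ : ∀ l → ∣ c l * vⱼ l ∣ ℚ.≤ toℚ (ℤ.+ ℤ.∣ lookup (v l) j ∣)
    term≤ l = begin
      ∣ c l * vⱼ l ∣                        ≡⟨ ℚ.∣p*q∣≡∣p∣*∣q∣ (c l) (vⱼ l) ⟩
      ∣ c l ∣ * ∣ vⱼ l ∣                    ≡⟨ cong₂ _*_ (ℚ.0≤p⇒∣p∣≡p (proj₁ (unit l))) (toℚ-∣∣ (lookup (v l) j)) ⟩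
      c l * toℚ (ℤ.+ ℤ.∣ lookup (v l) j ∣)  ≤⟨ ℚ.*-monoʳ-≤-nonNeg (toℚ (ℤ.+ ℤ.∣ lookup (v l) j ∣)) {{ℚ.nonNegative (toℚ-mono-≤ {0ℤ} {ℤ.+ ℤ.∣ lookup (v l) j ∣} (ℤ.+≤+ ℕ.z≤n))}} (proj₂ (unit l)) ⟩
      1ℚ * toℚ (ℤ.+ ℤ.∣ lookup (v l) j ∣)   ≡⟨ ℚ.*-identityˡ _ ⟩
      toℚ (ℤ.+ ℤ.∣ lookup (v l) j ∣)        ∎
      where open ℚ.≤-Reasoning
    ∣eⱼ∣≤ : toℚ (ℤ.+ ℤ.∣ lookup e j ∣) ℚ.≤ toℚ (ℤ.+ ℕΣ.sum (λ l → ℤ.∣ lookup (v l) j ∣))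
    ∣eⱼ∣≤ = begin
      toℚ (ℤ.+ ℤ.∣ lookup e j ∣)                           ≡⟨ toℚ-∣∣ (lookup e j) ⟨
      ∣ toℚ (lookup e j) ∣                                 ≡⟨ cong ∣_∣ (lookup-toℚv e j) ⟨
      ∣ lookup x j ∣                                       ≡⟨ cong (λ y → ∣ lookup y j ∣) e∈ ⟨
      ∣ lookup (lincomb c (toℚv ∘ v)) j ∣                  ≡⟨ cong ∣_∣ (trans (lookup-lincomb c _ j) (sum-cong-≗ λ l → cong (c l *_) (lookup-toℚv (v l) j))) ⟩
      ∣ sum (λ l → c l * vⱼ l) ∣                           ≤⟨ ∣sum∣≤sum∣∣ (λ l → c l * vⱼ l) ⟩
      sum (λ l → ∣ c l * vⱼ l ∣)                           ≤⟨ sum-mono-≤ term≤ ⟩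
      sum (λ l → toℚ (ℤ.+ ℤ.∣ lookup (v l) j ∣))           ≡⟨ toℚ-sumℕ (λ l → ℤ.∣ lookup (v l) j ∣) ⟩
      toℚ (ℤ.+ ℕΣ.sum (λ l → ℤ.∣ lookup (v l) j ∣))        ∎
      where open ℚ.≤-Reasoning

  difference-χ-outside-box : ∀ strict e → inBox boxRadius e ≡ false → productSeries (difference (χ strict)) e ≡ 0ℤ
  difference-χ-outside-box strict e outside with inSpan? (toℚv e)
  ... | no _   = refl
  ... | yes e∈ with Fin.all? (λ l → (0ℚ ℚ.≤? coord (toℚv e) l) ×-dec (coord (toℚv e) l ℚ.≤? 1ℚ))
  ...   | yes unit with () ← trans (sym (inBox-true boxRadius e (parallelepiped⊆box e e∈ unit))) outside
  ...   | no ¬unit with Fin.¬∀⟶∃¬ n _ (λ l → (0ℚ ℚ.≤? coord (toℚv e) l) ×-dec (coord (toℚv e) l ℚ.≤? 1ℚ)) ¬unit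
  ...     | l , l∉unit = ∏-zero _ l (difference-χ-outside strict l _ l∉unit)

  numerator : (Fin n → Bool) → LPoly d
  numerator strict = listing (productSeries (difference (χ strict))) (box d boxRadius)

  represents : ∀ strict → Represents (numerator strict , denominator) (conePoints strict)
  represents strict e = begin
    mulSeries denominator (conePoints strict) e                               ≡⟨ denominator-productSeries (χ strict) e ⟩
    productSeries (difference (χ strict)) e                                   ≡⟨ restrict (inBox boxRadius e) refl ⟨
    (if inBox boxRadius e then productSeries (difference (χ strict)) e else 0ℤ) ≡⟨ coeff-listing-box d boxRadius _ e ⟨
    coeff (numerator strict) e                                                ∎
    where
    open ≡-Reasoning
    restrict : ∀ b → inBox boxRadius e ≡ b → (if b then productSeries (difference (χ strict)) e else 0ℤ) ≡ productSeries (difference (χ strict)) e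
    restrict true  _       = refl
    restrict false outside = sym (difference-χ-outside-box strict e outside)

  ψ₁ : LinearForm d
  ψ₁ = combineForms (λ _ → 1ℚ) φ

  ψ₁-pos : ∀ m → 0ℚ ℚ.< eval ψ₁ (toℚv (v m))
  ψ₁-pos m = subst (0ℚ ℚ.<_) (sym (trans (eval-combineForms _ φ _) (trans (sum-cong-≗ λ l → cong (1ℚ *_) (eval-δ bi l m)) (sum-δ (λ _ → 1ℚ) m))))
                   (ℚ.positive⁻¹ 1ℚ)

  isGF : ∀ strict → IsGF (LatticePts (HCone (toℚv ∘ v) strict)) (numerator strict , denominator)
  isGF strict = Monic.monic⇒nonZero ψ₁ denominator (binomials-monic ψ₁ ψ₁-pos (List.allFin n))
              , conePoints strict , (λ e → ∈⇒1 e , ∉⇒0 e) , represents strict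
    where
    ∈⇒1 : ∀ e → HCone (toℚv ∘ v) strict (toℚv e) → conePoints strict e ≡ 1ℤ
    ∈⇒1 e e∈ = trans (conePoints-indicator strict e) (cong indicator (inCone?-complete strict (toℚv e) e∈))
    ∉⇒0 : ∀ e → ¬ HCone (toℚv ∘ v) strict (toℚv e) → conePoints strict e ≡ 0ℤ
    ∉⇒0 e e∉ = trans (conePoints-indicator strict e) (cong indicator (Bool.¬-not (λ ok → e∉ (inCone?-sound strict (toℚv e) ok))))

IsGF-resp-⇔ : ∀ {d} {S S′ : Exp d → Set} {F : RatFun d} → (∀ m → S m → S′ m) → (∀ m → S′ m → S m) → IsGF S F → IsGF S′ F
IsGF-resp-⇔ S⇒S′ S′⇒S (Q≢0 , s , s-indicator , s-represented) =
  Q≢0 , s , (λ m → (λ m∈S′ → proj₁ (s-indicator m) (S′⇒S m m∈S′)) , (λ m∉S′ → proj₂ (s-indicator m) (m∉S′ ∘ S⇒S′ m))) , s-represented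

-- A half-open cone with rational generators is the cone of their integer multiples.
module RationalCone {n d} (w : Fin n → Vec ℚ d) (φ : Fin n → LinearForm d) (bi : Biorthogonal w φ) where

  K : Fin n → ℕ
  K l = proj₁ (clearDenominators (w l))

  κ : Fin n → ℚ
  κ l = toℚ (ℤ.+ suc (K l))

  κ>0 : ∀ l → 0ℚ ℚ.< κ l
  κ>0 l = toℚ-suc-pos (K l)

  κ≢0 : ∀ l → κ l ≢ 0ℚ
  κ≢0 l κ≡0 = ℚ.<-irrefl (sym κ≡0) (κ>0 l)

  v : Fin n → Vec ℤ d
  v l = proj₁ (proj₂ (clearDenominators (w l)))

  v≡κw : ∀ l → toℚv (v l) ≡ κ l ·v w l
  v≡κw l = proj₂ (proj₂ (clearDenominators (w l)))

  φᵥ : Fin n → LinearForm d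
  φᵥ l = scaleForm (recip (κ l)) (φ l)

  biᵥ : Biorthogonal (toℚv ∘ v) φᵥ
  biᵥ = biorthogonal φᵥv≡δ
    where
    φᵥv≡δ : ∀ l m → eval (φᵥ l) (toℚv (v m)) ≡ δ l m
    φᵥv≡δ l m = begin
      recip (κ l) * eval (φ l) (toℚv (v m))     ≡⟨ cong (λ y → recip (κ l) * eval (φ l) y) (v≡κw m) ⟩
      recip (κ l) * eval (φ l) (κ m ·v w m)     ≡⟨ cong (recip (κ l) *_) (eval-· (φ l) (κ m) (w m)) ⟩
      recip (κ l) * (κ m * eval (φ l) (w m))    ≡⟨ cong (λ z → recip (κ l) * (κ m * z)) (eval-δ bi l m) ⟩
      recip (κ l) * (κ m * δ l m)               ≡⟨ rescaled-δ (l Fin.≟ m) ⟩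
      δ l m                                     ∎
      where
      open ≡-Reasoning
      rescaled-δ : (l≟m : Dec (l ≡ m)) → recip (κ l) * (κ m * (if does l≟m then 1ℚ else 0ℚ)) ≡ (if does l≟m then 1ℚ else 0ℚ)
      rescaled-δ (yes refl) = trans (cong (recip (κ l) *_) (ℚ.*-identityʳ (κ l))) (recip-inverseˡ (κ≢0 l))
      rescaled-δ (no _)     = trans (cong (recip (κ l) *_) (ℚ.*-zeroʳ (κ m))) (ℚ.*-zeroʳ (recip (κ l)))

  open SimplicialConeGF v φᵥ biᵥ using (numerator; denominator; binomials-monic) renaming (isGF to isGFᵥ) public

  HCone-w⇒v : ∀ strict x → HCone w strict x → HCone (toℚv ∘ v) strict x
  HCone-w⇒v strict x (t , t≥0 , t>0 , x≡) = (λ l → recip (κ l) * t l)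
    , (λ l → 0≤* (ℚ.<⇒≤ (recip-pos (κ>0 l))) (t≥0 l))
    , (λ l s → 0<* (recip-pos (κ>0 l)) (t>0 l s))
    , trans x≡ (sym (trans (lincomb-cong (λ _ → refl) v≡κw) (trans (lincomb-rescale _ κ w) (lincomb-cong cancel (λ _ → refl)))))
    where
    cancel : ∀ l → recip (κ l) * t l * κ l ≡ t l
    cancel l = begin
      recip (κ l) * t l * κ l     ≡⟨ solve 3 (λ a b c → a :* b :* c := (a :* c) :* b) refl (recip (κ l)) (t l) (κ l) ⟩
      recip (κ l) * κ l * t l     ≡⟨ cong (_* t l) (recip-inverseˡ (κ≢0 l)) ⟩
      1ℚ * t l                    ≡⟨ ℚ.*-identityˡ (t l) ⟩
      t l                         ∎
      where open ≡-Reasoning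

  HCone-v⇒w : ∀ strict x → HCone (toℚv ∘ v) strict x → HCone w strict x
  HCone-v⇒w strict x (t , t≥0 , t>0 , x≡) = (λ l → t l * κ l)
    , (λ l → subst (0ℚ ℚ.≤_) (ℚ.*-comm (κ l) (t l)) (0≤* (ℚ.<⇒≤ (κ>0 l)) (t≥0 l)))
    , (λ l s → subst (0ℚ ℚ.<_) (ℚ.*-comm (κ l) (t l)) (0<* (κ>0 l) (t>0 l s)))
    , trans x≡ (trans (lincomb-cong (λ _ → refl) v≡κw) (lincomb-rescale t κ w))

  isGF : ∀ strict → IsGF (LatticePts (HCone w strict)) (numerator strict , denominator)
  isGF strict = IsGF-resp-⇔ {F = numerator strict , denominator} (λ m → HCone-v⇒w strict (toℚv m)) (λ m → HCone-w⇒v strict (toℚv m)) (isGFᵥ strict)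

-- Replacing one generator of a basis

module SameSpan {n d} {w α : Fin n → Vec ℚ d} {φ B : Fin n → LinearForm d}
                (biw : Biorthogonal w φ) (biα : Biorthogonal α B) where
  module W = Span w φ biw
  module A = Span α B biα

  module _ (w∈A : ∀ m → A.InSpan (w m))
           (separates : ∀ x → A.InSpan x → (∀ l → eval (φ l) x ≡ 0ℚ) → ∀ l → eval (B l) x ≡ 0ℚ) where

    W⇒A : ∀ x → W.InSpan x → A.InSpan x
    W⇒A x x∈W = subst A.InSpan x∈W (A.inSpan-lincombOf (W.coord x) w w∈A)

    A⇒W : ∀ x → A.InSpan x → W.InSpan x
    A⇒W x x∈A = sym (+v-cancelʳ x (W.proj x) ((- 1ℚ) ·v W.proj x) (trans y≡0 (sym (cancel (W.proj x)))))
      where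
      y : Vec ℚ d
      y = x +v ((- 1ℚ) ·v W.proj x)
      y∈A : A.InSpan y
      y∈A = A.inSpan-+ x∈A (A.inSpan-· (- 1ℚ) (W⇒A (W.proj x) (W.inSpan-lincomb (W.coord x))))
      φy≡0 : ∀ l → eval (φ l) y ≡ 0ℚ
      φy≡0 l = begin
        eval (φ l) y                                       ≡⟨ eval-+ (φ l) x _ ⟩
        eval (φ l) x + eval (φ l) ((- 1ℚ) ·v W.proj x)     ≡⟨ cong (eval (φ l) x +_) (eval-· (φ l) (- 1ℚ) (W.proj x)) ⟩
        eval (φ l) x + (- 1ℚ) * eval (φ l) (W.proj x)      ≡⟨ cong (λ z → eval (φ l) x + (- 1ℚ) * z) (W.coord-lincomb (W.coord x) l) ⟩
        eval (φ l) x + (- 1ℚ) * eval (φ l) x               ≡⟨ solve 1 (λ a → a :+ (:- con 1ℚ) :* a := con 0ℚ) refl (eval (φ l) x) ⟩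
        0ℚ                                                 ∎
        where open ≡-Reasoning
      y≡0 : y ≡ replicate d 0ℚ
      y≡0 = A.coords-zero⇒zero y y∈A (separates y y∈A φy≡0)
      cancel : ∀ z → z +v ((- 1ℚ) ·v z) ≡ replicate d 0ℚ
      cancel z = lookup-ext λ j → begin
        lookup (z +v ((- 1ℚ) ·v z)) j             ≡⟨ lookup-+v z _ j ⟩
        lookup z j + lookup ((- 1ℚ) ·v z) j       ≡⟨ cong (lookup z j +_) (lookup-·v (- 1ℚ) z j) ⟩
        lookup z j + (- 1ℚ) * lookup z j          ≡⟨ solve 1 (λ a → a :+ (:- con 1ℚ) :* a := con 0ℚ) refl (lookup z j) ⟩
        0ℚ                                        ≡⟨ Vec.lookup-replicate j 0ℚ ⟨
        lookup (replicate d 0ℚ) j                 ∎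
        where open ≡-Reasoning

replaceCol-same : ∀ {n d} (α : Fin n → Vec ℚ d) (i : Fin n) (u : Vec ℚ d) → replaceCol α i u i ≡ u
replaceCol-same α i u = cong (λ b → if b then u else α i) (⌊⌋-true (toℕ i ℕ.≟ toℕ i) refl)

replaceCol-other : ∀ {n d} (α : Fin n → Vec ℚ d) (i : Fin n) (u : Vec ℚ d) {m} → m ≢ i → replaceCol α i u m ≡ α m
replaceCol-other α i u {m} m≢i = cong (λ b → if b then u else α m) (⌊⌋-false (toℕ m ℕ.≟ toℕ i) (m≢i ∘ Fin.toℕ-injective))

-- coordinates after replacing the i-th vector of a basis by Σ g_l α_l, in terms of the old coordinates t
replacedCoord : ∀ {n} → Fin n → (Fin n → ℚ) → (Fin n → ℚ) → Fin n → ℚ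
replacedCoord i g t l = if does (l Fin.≟ i) then recip (g i) * t i else t l + - (g l * recip (g i)) * t i

replacedCoord-cong : ∀ {n} i {g g′ : Fin n → ℚ} → (∀ l → g l ≡ g′ l) → ∀ t l → replacedCoord i g t l ≡ replacedCoord i g′ t l
replacedCoord-cong i g≗g′ t l = cong₂ (λ a b → if does (l Fin.≟ i) then recip a * t i else t l + - (b * recip a) * t i) (g≗g′ i) (g≗g′ l)

replacedCoord-same : ∀ {n} i g (t : Fin n → ℚ) → replacedCoord i g t i ≡ recip (g i) * t i
replacedCoord-same i g t = cong (λ b → if b then recip (g i) * t i else t i + - (g i * recip (g i)) * t i) (dec-true (i Fin.≟ i) refl)

replacedCoord-other : ∀ {n} {i l} g (t : Fin n → ℚ) → l ≢ i → replacedCoord i g t l ≡ t l + - (g l * recip (g i)) * t i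
replacedCoord-other {i = i} {l} g t l≢i =
  cong (λ b → if b then recip (g i) * t i else t l + - (g l * recip (g i)) * t i) (dec-false (l Fin.≟ i) l≢i)

module ColumnReplacement {n d} (α : Fin n → Vec ℚ d) (B : Fin n → LinearForm d) (biα : Biorthogonal α B)
                         (i : Fin n) (g : Fin n → ℚ) (gᵢ≢0 : g i ≢ 0ℚ) where
  module A = Span α B biα

  w : Fin n → Vec ℚ d
  w = replaceCol α i (lincomb g α)

  r : ℚ
  r = recip (g i)

  φ : Fin n → LinearForm d
  φ l = φ-at (l Fin.≟ i)
    where
    φ-at : Dec (l ≡ i) → LinearForm d
    φ-at (yes _) = scaleForm r (B i)
    φ-at (no _)  = addForm (B l) (scaleForm (- (g l * r)) (B i))

  eval-φ : ∀ x l → eval (φ l) x ≡ replacedCoord i g (A.coord x) l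
  eval-φ x l with l Fin.≟ i
  ... | yes _ = refl
  ... | no _  = refl

  Bα≡ : ∀ l m → eval (B l) (w m) ≡ (if does (m Fin.≟ i) then g l else δ l m)
  Bα≡ l m with m Fin.≟ i
  ... | yes refl = trans (cong (eval (B l)) (replaceCol-same α i (lincomb g α))) (A.coord-lincomb g l)
  ... | no m≢i   = trans (cong (eval (B l)) (replaceCol-other α i (lincomb g α) m≢i)) (eval-δ biα l m)

  φw≡δ : ∀ l m → eval (φ l) (w m) ≡ δ l m
  φw≡δ l m rewrite eval-φ (w m) l with l Fin.≟ i | m Fin.≟ i | Bα≡ l m | Bα≡ i m
  ... | yes refl | yes refl | _ | Bᵢwᵢ = trans (cong (r *_) Bᵢwᵢ) (trans (recip-inverseˡ gᵢ≢0) (sym (δ-refl l)))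
  ... | yes refl | no m≢i  | _ | Bᵢwₘ = trans (cong (r *_) (trans Bᵢwₘ (δ-≢ (m≢i ∘ sym)))) (trans (ℚ.*-zeroʳ r) (sym (δ-≢ (m≢i ∘ sym))))
  ... | no l≢i   | yes refl | Bₗwᵢ | Bᵢwᵢ = begin
    eval (B l) (w m) + - (g l * r) * eval (B m) (w m)  ≡⟨ cong₂ (λ a b → a + - (g l * r) * b) Bₗwᵢ Bᵢwᵢ ⟩
    g l + - (g l * r) * g m                            ≡⟨ solve 3 (λ a q b → a :+ (:- (a :* q)) :* b := a :- a :* (q :* b)) refl (g l) r (g m) ⟩
    g l - g l * (r * g m)                              ≡⟨ cong (λ z → g l - g l * z) (recip-inverseˡ gᵢ≢0) ⟩
    g l - g l * 1ℚ                                     ≡⟨ solve 1 (λ a → a :- a :* con 1ℚ := con 0ℚ) refl (g l) ⟩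
    0ℚ                                                 ≡⟨ δ-≢ l≢i ⟨
    δ l m                                              ∎
    where open ≡-Reasoning
  ... | no l≢i   | no m≢i  | Bₗwₘ | Bᵢwₘ = begin
    eval (B l) (w m) + - (g l * r) * eval (B i) (w m)  ≡⟨ cong₂ (λ a b → a + - (g l * r) * b) Bₗwₘ (trans Bᵢwₘ (δ-≢ (m≢i ∘ sym))) ⟩
    δ l m + - (g l * r) * 0ℚ                           ≡⟨ solve 2 (λ a b → a :+ b :* con 0ℚ := a) refl (δ l m) (- (g l * r)) ⟩
    δ l m                                              ∎
    where open ≡-Reasoning

  biw : Biorthogonal w φ
  biw = biorthogonal φw≡δ

  w∈A : ∀ m → A.InSpan (w m)
  w∈A m with m Fin.≟ i
  ... | yes refl = subst A.InSpan (sym (replaceCol-same α i (lincomb g α))) (A.inSpan-lincomb g)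
  ... | no m≢i   = subst A.InSpan (sym (replaceCol-other α i (lincomb g α) m≢i))
                         (subst A.InSpan (lincomb-δ α m) (A.inSpan-lincomb (λ l → δ l m)))

  separates : ∀ x → A.InSpan x → (∀ l → eval (φ l) x ≡ 0ℚ) → ∀ l → eval (B l) x ≡ 0ℚ
  separates x _ φx≡0 l = separate-at (l Fin.≟ i)
    where
    tᵢ≡0 : A.coord x i ≡ 0ℚ
    tᵢ≡0 = begin
      A.coord x i                     ≡⟨ ℚ.*-identityˡ (A.coord x i) ⟨
      1ℚ * A.coord x i                ≡⟨ cong (_* A.coord x i) (recip-inverseʳ gᵢ≢0) ⟨
      g i * r * A.coord x i           ≡⟨ trans (ℚ.*-assoc (g i) r (A.coord x i)) (cong (g i *_) (sym (replacedCoord-same i g (A.coord x)))) ⟩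
      g i * replacedCoord i g (A.coord x) i ≡⟨ cong (g i *_) (trans (sym (eval-φ x i)) (φx≡0 i)) ⟩
      g i * 0ℚ                        ≡⟨ ℚ.*-zeroʳ (g i) ⟩
      0ℚ                              ∎
      where
      open ≡-Reasoning
    separate-at : Dec (l ≡ i) → A.coord x l ≡ 0ℚ
    separate-at (yes refl) = tᵢ≡0
    separate-at (no l≢i) = begin
      A.coord x l                                        ≡⟨ solve 2 (λ a b → a := a :+ b :* con 0ℚ) refl (A.coord x l) (- (g l * r)) ⟩
      A.coord x l + - (g l * r) * 0ℚ                     ≡⟨ cong (λ z → A.coord x l + - (g l * r) * z) tᵢ≡0 ⟨
      A.coord x l + - (g l * r) * A.coord x i            ≡⟨ replacedCoord-other g (A.coord x) l≢i ⟨
      replacedCoord i g (A.coord x) l                    ≡⟨ trans (sym (eval-φ x l)) (φx≡0 l) ⟩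
      0ℚ                                                 ∎
      where open ≡-Reasoning

  module W = Span w φ biw

  inCone?-replaced : ∀ strict x → W.inCone? strict x ≡ ⌊ A.inSpan? x ⌋ ∧ all (λ l → admissible (strict l) (replacedCoord i g (A.coord x) l))
  inCone?-replaced strict x = cong₂ _∧_
    (⌊⌋-⇔ (SameSpan.W⇒A biw biα w∈A separates x) (SameSpan.A⇒W biw biα w∈A separates x) (W.inSpan? x) (A.inSpan? x))
    (all-cong λ l → cong (admissible (strict l)) (eval-φ x l))

  open RationalCone w φ biw using (numerator; denominator; isGF) public

_⊓ₘ_ : ℚ → Maybe ℚ → ℚ

q ⊓ₘ nothing = q
q ⊓ₘ just m  = q ℚ.⊓ m

minOver : ∀ {n} → (Fin n → Bool) → (Fin n → ℚ) → Maybe ℚ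
minOver {zero}  sel a = nothing
minOver {suc n} sel a =
  if sel zero then just (a zero ⊓ₘ minOver (sel ∘ suc) (a ∘ suc)) else minOver (sel ∘ suc) (a ∘ suc)

_≤ₘ_ : ℚ → Maybe ℚ → Bool

q ≤ₘ nothing = true
q ≤ₘ just m  = does (q ℚ.≤? m)

≤-⊓ₘ : ∀ q x m → does (q ℚ.≤? x) ∧ (q ≤ₘ m) ≡ does (q ℚ.≤? (x ⊓ₘ m))
≤-⊓ₘ q x nothing  = Bool.∧-identityʳ _
≤-⊓ₘ q x (just m) = does-⇔ (mk⇔ (λ (q≤x , q≤m) → ℚ.⊓-glb q≤x q≤m) (λ q≤x⊓m → ℚ.p≤q⊓r⇒p≤q x m q≤x⊓m , ℚ.p≤q⊓r⇒p≤r x m q≤x⊓m))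
                           ((q ℚ.≤? x) ×-dec (q ℚ.≤? m)) (q ℚ.≤? (x ℚ.⊓ m))

all-≤⇔≤-minOver : ∀ {n} (sel : Fin n → Bool) (a : Fin n → ℚ) q →
                  all (λ l → if sel l then does (q ℚ.≤? a l) else true) ≡ q ≤ₘ minOver sel a
all-≤⇔≤-minOver {zero}  sel a q = refl
all-≤⇔≤-minOver {suc n} sel a q =
  trans (cong ((if sel zero then does (q ℚ.≤? a zero) else true) ∧_) (all-≤⇔≤-minOver (sel ∘ suc) (a ∘ suc) q)) (head (sel zero))
  where
  m′ : Maybe ℚ
  m′ = minOver (sel ∘ suc) (a ∘ suc)
  head : ∀ s → (if s then does (q ℚ.≤? a zero) else true) ∧ q ≤ₘ m′ ≡ q ≤ₘ (if s then just (a zero ⊓ₘ m′) else m′)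
  head true  = ≤-⊓ₘ q (a zero) m′
  head false = refl

isFirstMin : ∀ {n} → (Fin n → Bool) → (Fin n → ℚ) → Fin n → Bool
isFirstMin sel a i =
  sel i ∧ all (λ l → if sel l then (if does (toℕ l ℕ.<? toℕ i) then does (a i ℚ.<? a l) else does (a i ℚ.≤? a l)) else true)

indicator-∧-rearrange : ∀ s c t (z : ℤ) → indicator (s ∧ (c ∧ t)) ℤ.* z ≡ indicator (s ∧ t) ℤ.* (indicator c ℤ.* z)
indicator-∧-rearrange false c     t z = refl
indicator-∧-rearrange true  false t z = trans (ℤ.*-zeroˡ z) (sym (trans (cong (indicator t ℤ.*_) (ℤ.*-zeroˡ z)) (ℤ.*-zeroʳ (indicator t))))
indicator-∧-rearrange true  true  t z = cong (indicator t ℤ.*_) (sym (ℤ.*-identityˡ z))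

min-split : ∀ (G : ℚ → ℤ) a₀ m →
            indicator (a₀ ≤ₘ m) ℤ.* G a₀ ℤ.+ Maybe.maybe (λ q → indicator (does (q ℚ.<? a₀)) ℤ.* G q) 0ℤ m ≡ G (a₀ ⊓ₘ m)
min-split G a₀ nothing  = trans (ℤ.+-identityʳ _) (ℤ.*-identityˡ (G a₀))
min-split G a₀ (just m) = by-cases (a₀ ℚ.≤? m) (m ℚ.<? a₀)
  where
  by-cases : (a₀≤?m : Dec (a₀ ℚ.≤ m)) (m<?a₀ : Dec (m ℚ.< a₀)) →
             indicator (does a₀≤?m) ℤ.* G a₀ ℤ.+ indicator (does m<?a₀) ℤ.* G m ≡ G (a₀ ℚ.⊓ m)
  by-cases (yes a₀≤m) (yes m<a₀) = ⊥-elim (ℚ.<-irrefl refl (ℚ.<-≤-trans m<a₀ a₀≤m))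
  by-cases (yes a₀≤m) (no _)     = trans (cong₂ ℤ._+_ (ℤ.*-identityˡ (G a₀)) (ℤ.*-zeroˡ (G m)))
                                         (trans (ℤ.+-identityʳ (G a₀)) (cong G (sym (ℚ.p≤q⇒p⊓q≡p a₀≤m))))
  by-cases (no a₀≰m)  (yes m<a₀) = trans (cong₂ ℤ._+_ (ℤ.*-zeroˡ (G a₀)) (ℤ.*-identityˡ (G m)))
                                         (trans (ℤ.+-identityˡ (G m)) (cong G (sym (ℚ.p≥q⇒p⊓q≡q (ℚ.<⇒≤ m<a₀)))))
  by-cases (no a₀≰m)  (no m≮a₀)  = ⊥-elim (m≮a₀ (ℚ.≰⇒> a₀≰m))

sum-firstMin : ∀ {n} (sel : Fin n → Bool) (a : Fin n → ℚ) (G : ℚ → ℤ) →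
               ℤΣ.sum (λ i → indicator (isFirstMin sel a i) ℤ.* G (a i)) ≡ Maybe.maybe G 0ℤ (minOver sel a)
sum-firstMin {zero}  sel a G = refl
sum-firstMin {suc n} sel a G = begin
  indicator (isFirstMin sel a zero) ℤ.* G a₀ ℤ.+ ℤΣ.sum (λ i → indicator (isFirstMin sel a (suc i)) ℤ.* G (a′ i))
    ≡⟨ cong₂ ℤ._+_ first (ℤΣ.sum-cong-≗ later) ⟩
  indicator (sel zero ∧ a₀ ≤ₘ m′) ℤ.* G a₀ ℤ.+ ℤΣ.sum (λ i → indicator (isFirstMin sel′ a′ i) ℤ.* G′ (a′ i))
    ≡⟨ cong (λ z → indicator (sel zero ∧ a₀ ≤ₘ m′) ℤ.* G a₀ ℤ.+ z) (sum-firstMin sel′ a′ G′) ⟩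
  indicator (sel zero ∧ a₀ ≤ₘ m′) ℤ.* G a₀ ℤ.+ Maybe.maybe G′ 0ℤ m′
    ≡⟨ combine (sel zero) ⟩
  Maybe.maybe G 0ℤ (minOver sel a) ∎
  where
  open ≡-Reasoning
  sel′ : Fin n → Bool
  sel′ = sel ∘ suc
  a′ : Fin n → ℚ
  a′ = a ∘ suc
  a₀ : ℚ
  a₀ = a zero
  m′ : Maybe ℚ
  m′ = minOver sel′ a′
  G′ : ℚ → ℤ
  G′ q = indicator (if sel zero then does (q ℚ.<? a₀) else true) ℤ.* G q
  later : ∀ i → indicator (isFirstMin sel a (suc i)) ℤ.* G (a′ i) ≡ indicator (isFirstMin sel′ a′ i) ℤ.* G′ (a′ i)
  later i = indicator-∧-rearrange (sel′ i) (if sel zero then does (a′ i ℚ.<? a₀) else true) _ (G (a′ i))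
  a₀≤a₀ : ∀ s → (if s then does (a₀ ℚ.≤? a₀) else true) ≡ true
  a₀≤a₀ true  = dec-true (a₀ ℚ.≤? a₀) ℚ.≤-refl
  a₀≤a₀ false = refl
  first : indicator (isFirstMin sel a zero) ℤ.* G a₀ ≡ indicator (sel zero ∧ a₀ ≤ₘ m′) ℤ.* G a₀
  first = cong (λ b → indicator (sel zero ∧ b) ℤ.* G a₀)
    (trans (cong (_∧ all (λ l → if sel′ l then does (a₀ ℚ.≤? a′ l) else true)) (a₀≤a₀ (sel zero))) (all-≤⇔≤-minOver sel′ a′ a₀))
  combine : ∀ s → indicator (s ∧ a₀ ≤ₘ m′) ℤ.* G a₀ ℤ.+ Maybe.maybe (λ q → indicator (if s then does (q ℚ.<? a₀) else true) ℤ.* G q) 0ℤ m′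
                  ≡ Maybe.maybe G 0ℤ (if s then just (a₀ ⊓ₘ m′) else m′)
  combine false with m′
  ... | nothing = refl
  ... | just m  = trans (ℤ.+-identityˡ _) (ℤ.*-identityˡ (G m))
  combine true = min-split G a₀ m′

minOver-shift : ∀ {n} (sel : Fin n → Bool) (a b : Fin n → ℚ) c → (∀ l → sel l ≡ true → b l ≡ a l + c) →
                minOver sel b ≡ Maybe.map (_+ c) (minOver sel a)
minOver-shift {zero}  sel a b c b≡a+c = refl
minOver-shift {suc n} sel a b c b≡a+c with sel zero in sel₀ | minOver-shift (sel ∘ suc) (a ∘ suc) (b ∘ suc) c (b≡a+c ∘ suc)
... | false | IH = IH
... | true  | IH rewrite IH | b≡a+c zero sel₀ = cong just (⊓ₘ-shift (a zero) (minOver (sel ∘ suc) (a ∘ suc)))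
  where
  ⊓ₘ-shift : ∀ x m → (x + c) ⊓ₘ Maybe.map (_+ c) m ≡ (x ⊓ₘ m) + c
  ⊓ₘ-shift x nothing  = refl
  ⊓ₘ-shift x (just m) = sym (ℚ.mono-≤-distrib-⊓ (ℚ.+-monoˡ-≤ c) x m)

-- Counting the cones K_l at a point

data Part : Set where
  pos neg rest : Part

isPos isNeg isRest : Part → Bool
isPos pos = true
isPos _   = false

isNeg neg = true
isNeg _   = false

isRest rest = true
isRest _    = false

signed : Part → ℚ → ℚ
signed pos  q = q
signed neg  q = - q
signed rest q = 0ℚ

-- The cone K_i (i ∈ pos) of the paper, with γ = Σ_l signed (part l) (p l) α_l, tested on α-coordinates t;
-- it is described through the ratios t_l / p_l.
module ReplacedCone {n} (part : Fin n → Part) (p : Fin n → ℚ) (p>0 : ∀ l → part l ≢ rest → 0ℚ ℚ.< p l) where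

  g : Fin n → ℚ
  g l = signed (part l) (p l)

  ratio : (Fin n → ℚ) → Fin n → ℚ
  ratio t l = recip (p l) * t l

  restOK : (Fin n → ℚ) → Bool
  restOK t = all (λ m → if isRest (part m) then does (0ℚ ℚ.≤? t m) else true)

  strictBefore : Fin n → Fin n → Bool
  strictBefore i m = isPos (part m) ∧ does (toℕ m ℕ.<? toℕ i)

  replacedCone? : Fin n → (Fin n → ℚ) → Bool
  replacedCone? i t = all (λ m → admissible (strictBefore i m) (replacedCoord i g t m))

  p>0-at : ∀ {m x} → part m ≡ x → x ≢ rest → 0ℚ ℚ.< p m
  p>0-at {m} m∈x x≢rest = p>0 m (x≢rest ∘ trans (sym m∈x))

  p-ratio : ∀ {m} t → 0ℚ ℚ.< p m → p m * ratio t m ≡ t m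
  p-ratio {m} t pₘ>0 = begin
    p m * (recip (p m) * t m)     ≡⟨ ℚ.*-assoc (p m) (recip (p m)) (t m) ⟨
    p m * recip (p m) * t m       ≡⟨ cong (_* t m) (recip-inverseʳ (λ pₘ≡0 → ℚ.<-irrefl (sym pₘ≡0) pₘ>0)) ⟩
    1ℚ * t m                      ≡⟨ ℚ.*-identityˡ (t m) ⟩
    t m                           ∎
    where open ≡-Reasoning

  module _ (i : Fin n) (i∈pos : part i ≡ pos) (t : Fin n → ℚ) where

    aᵢ : ℚ
    aᵢ = ratio t i

    replaced-≢ : ∀ {m} → m ≢ i → replacedCoord i g t m ≡ t m + - (g m * recip (p i)) * t i
    replaced-≢ {m} m≢i = trans (replacedCoord-other g t m≢i) (cong (λ x → t m + - (g m * recip (signed x (p i))) * t i) i∈pos)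

    replaced-pos : ∀ {m} → m ≢ i → part m ≡ pos → replacedCoord i g t m ≡ p m * (ratio t m - aᵢ)
    replaced-pos {m} m≢i m∈pos = begin
      replacedCoord i g t m                       ≡⟨ replaced-≢ m≢i ⟩
      t m + - (g m * recip (p i)) * t i           ≡⟨ cong₂ (λ u z → u + - (z * recip (p i)) * t i) (sym (p-ratio t (p>0-at m∈pos λ ()))) (cong (λ x → signed x (p m)) m∈pos) ⟩
      p m * ratio t m + - (p m * recip (p i)) * t i ≡⟨ solve 4 (λ q b r c → q :* b :+ (:- (q :* r)) :* c := q :* (b :- r :* c)) refl (p m) (ratio t m) (recip (p i)) (t i) ⟩
      p m * (ratio t m - aᵢ)                      ∎
      where open ≡-Reasoning

    replaced-neg : ∀ {m} → m ≢ i → part m ≡ neg → replacedCoord i g t m ≡ p m * (ratio t m - (- aᵢ))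
    replaced-neg {m} m≢i m∈neg = begin
      replacedCoord i g t m                       ≡⟨ replaced-≢ m≢i ⟩
      t m + - (g m * recip (p i)) * t i           ≡⟨ cong₂ (λ u z → u + - (z * recip (p i)) * t i) (sym (p-ratio t (p>0-at m∈neg λ ()))) (cong (λ x → signed x (p m)) m∈neg) ⟩
      p m * ratio t m + - (- p m * recip (p i)) * t i ≡⟨ solve 4 (λ q b r c → q :* b :+ (:- ((:- q) :* r)) :* c := q :* (b :- (:- (r :* c)))) refl (p m) (ratio t m) (recip (p i)) (t i) ⟩
      p m * (ratio t m - (- aᵢ))                  ∎
      where open ≡-Reasoning

    replaced-rest : ∀ {m} → m ≢ i → part m ≡ rest → replacedCoord i g t m ≡ t m
    replaced-rest {m} m≢i m∈rest = trans (replaced-≢ m≢i)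
      (trans (cong (λ x → t m + - (signed x (p m) * recip (p i)) * t i) m∈rest)
             (solve 3 (λ x r c → x :+ (:- (con 0ℚ :* r)) :* c := x) refl (t m) (recip (p i)) (t i)))

    coordTest : Fin n → Bool
    coordTest m = admissible (strictBefore i m) (replacedCoord i g t m)

    firstMinTest minTest restTest atI : Fin n → Bool
    firstMinTest m = if isPos (part m) then (if does (toℕ m ℕ.<? toℕ i) then does (aᵢ ℚ.<? ratio t m) else does (aᵢ ℚ.≤? ratio t m)) else true
    atI          m = if does (m Fin.≟ i) then does (0ℚ ℚ.≤? aᵢ) else true
    minTest      m = if isNeg (part m) then does (- aᵢ ℚ.≤? ratio t m) else true
    restTest     m = if isRest (part m) then does (0ℚ ℚ.≤? t m) else true

    admissible-scaled : ∀ b {q} x y → 0ℚ ℚ.< q →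
                        admissible b (q * (y - x)) ≡ (if b then does (x ℚ.<? y) else does (x ℚ.≤? y))
    admissible-scaled true  x y q>0 = scaled-difference-< x y q>0
    admissible-scaled false x y q>0 = scaled-difference-≤ x y q>0

    Split : Fin n → Set
    Split m = coordTest m ≡ firstMinTest m ∧ (atI m ∧ (minTest m ∧ restTest m))

    split-self : Split i
    split-self = begin
      coordTest i
        ≡⟨ cong₂ admissible (trans (cong (isPos (part i) ∧_) (dec-false (toℕ i ℕ.<? toℕ i) (ℕ.<-irrefl refl))) (Bool.∧-zeroʳ _))
                            (trans (replacedCoord-same i g t) (cong (λ x → recip (signed x (p i)) * t i) i∈pos)) ⟩
      does (0ℚ ℚ.≤? aᵢ)
        ≡⟨ Bool.∧-identityʳ _ ⟨
      does (0ℚ ℚ.≤? aᵢ) ∧ true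
        ≡⟨ cong₂ _∧_ (if-true (dec-true (i Fin.≟ i) refl)) (cong₂ _∧_ (if-false (cong isNeg i∈pos)) (if-false (cong isRest i∈pos))) ⟨
      atI i ∧ (minTest i ∧ restTest i)
        ≡⟨ cong (_∧ (atI i ∧ (minTest i ∧ restTest i)))
             (trans (if-true (cong isPos i∈pos)) (trans (if-false (dec-false (toℕ i ℕ.<? toℕ i) (ℕ.<-irrefl refl))) (dec-true (aᵢ ℚ.≤? aᵢ) ℚ.≤-refl))) ⟨
      firstMinTest i ∧ (atI i ∧ (minTest i ∧ restTest i)) ∎
      where open ≡-Reasoning

    split-pos : ∀ {m} → m ≢ i → part m ≡ pos → Split m
    split-pos {m} m≢i m∈pos = begin
      coordTest m
        ≡⟨ cong₂ admissible (cong (λ x → isPos x ∧ does (toℕ m ℕ.<? toℕ i)) m∈pos) (replaced-pos m≢i m∈pos) ⟩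
      admissible (does (toℕ m ℕ.<? toℕ i)) (p m * (ratio t m - aᵢ))
        ≡⟨ admissible-scaled (does (toℕ m ℕ.<? toℕ i)) aᵢ (ratio t m) (p>0-at m∈pos λ ()) ⟩
      (if does (toℕ m ℕ.<? toℕ i) then does (aᵢ ℚ.<? ratio t m) else does (aᵢ ℚ.≤? ratio t m))
        ≡⟨ Bool.∧-identityʳ _ ⟨
      (if does (toℕ m ℕ.<? toℕ i) then does (aᵢ ℚ.<? ratio t m) else does (aᵢ ℚ.≤? ratio t m)) ∧ true
        ≡⟨ cong₂ _∧_ (if-true (cong isPos m∈pos))
                     (cong₂ _∧_ (if-false (dec-false (m Fin.≟ i) m≢i)) (cong₂ _∧_ (if-false (cong isNeg m∈pos)) (if-false (cong isRest m∈pos)))) ⟨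
      firstMinTest m ∧ (atI m ∧ (minTest m ∧ restTest m)) ∎
      where open ≡-Reasoning

    split-neg : ∀ {m} → m ≢ i → part m ≡ neg → Split m
    split-neg {m} m≢i m∈neg = begin
      coordTest m
        ≡⟨ cong₂ admissible (cong (λ x → isPos x ∧ does (toℕ m ℕ.<? toℕ i)) m∈neg) (replaced-neg m≢i m∈neg) ⟩
      does (0ℚ ℚ.≤? p m * (ratio t m - (- aᵢ)))
        ≡⟨ scaled-difference-≤ (- aᵢ) (ratio t m) (p>0-at m∈neg λ ()) ⟩
      does (- aᵢ ℚ.≤? ratio t m)
        ≡⟨ Bool.∧-identityʳ _ ⟨
      does (- aᵢ ℚ.≤? ratio t m) ∧ true
        ≡⟨ cong₂ _∧_ (if-false (cong isPos m∈neg))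
                     (cong₂ _∧_ (if-false (dec-false (m Fin.≟ i) m≢i)) (cong₂ _∧_ (if-true (cong isNeg m∈neg)) (if-false (cong isRest m∈neg)))) ⟨
      firstMinTest m ∧ (atI m ∧ (minTest m ∧ restTest m)) ∎
      where open ≡-Reasoning

    split-rest : ∀ {m} → m ≢ i → part m ≡ rest → Split m
    split-rest {m} m≢i m∈rest = begin
      coordTest m
        ≡⟨ cong₂ admissible (cong (λ x → isPos x ∧ does (toℕ m ℕ.<? toℕ i)) m∈rest) (replaced-rest m≢i m∈rest) ⟩
      does (0ℚ ℚ.≤? t m)
        ≡⟨ cong₂ _∧_ (if-false (cong isPos m∈rest))
                     (cong₂ _∧_ (if-false (dec-false (m Fin.≟ i) m≢i)) (cong₂ _∧_ (if-false (cong isNeg m∈rest)) (if-true (cong isRest m∈rest)))) ⟨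
      firstMinTest m ∧ (atI m ∧ (minTest m ∧ restTest m)) ∎
      where open ≡-Reasoning

    coordTest-split : ∀ m → Split m
    coordTest-split m = by-cases (m Fin.≟ i) (part m) refl
      where
      by-cases : Dec (m ≡ i) → ∀ x → part m ≡ x → Split m
      by-cases (yes refl) _    _  = split-self
      by-cases (no m≢i)   pos  m∈ = split-pos m≢i m∈
      by-cases (no m≢i)   neg  m∈ = split-neg m≢i m∈
      by-cases (no m≢i)   rest m∈ = split-rest m≢i m∈

    replacedCone?-firstMin : replacedCone? i t ≡
      isFirstMin (isPos ∘ part) (ratio t) i ∧ (does (0ℚ ℚ.≤? aᵢ) ∧ ((- aᵢ) ≤ₘ minOver (isNeg ∘ part) (ratio t) ∧ restOK t))
    replacedCone?-firstMin = begin
      all coordTest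
        ≡⟨ all-cong coordTest-split ⟩
      all (λ m → firstMinTest m ∧ (atI m ∧ (minTest m ∧ restTest m)))
        ≡⟨ trans (all-∧ firstMinTest _) (cong (all firstMinTest ∧_) (trans (all-∧ atI _) (cong (all atI ∧_) (all-∧ minTest restTest)))) ⟩
      all firstMinTest ∧ (all atI ∧ (all minTest ∧ all restTest))
        ≡⟨ cong₂ (λ u v → u ∧ (v ∧ (all minTest ∧ all restTest)))
             (sym (cong (_∧ all firstMinTest) (cong isPos i∈pos)))
             (trans (all-single atI i (λ m m≢i → if-false (dec-false (m Fin.≟ i) m≢i))) (if-true (dec-true (i Fin.≟ i) refl))) ⟩
      isFirstMin (isPos ∘ part) (ratio t) i ∧ (does (0ℚ ℚ.≤? aᵢ) ∧ (all minTest ∧ restOK t))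
        ≡⟨ cong (λ z → isFirstMin (isPos ∘ part) (ratio t) i ∧ (does (0ℚ ℚ.≤? aᵢ) ∧ (z ∧ restOK t)))
                (all-≤⇔≤-minOver (isNeg ∘ part) (ratio t) (- aᵢ)) ⟩
      isFirstMin (isPos ∘ part) (ratio t) i ∧ (does (0ℚ ℚ.≤? aᵢ) ∧ ((- aᵢ) ≤ₘ minOver (isNeg ∘ part) (ratio t) ∧ restOK t)) ∎
      where open ≡-Reasoning

  nonneg-min : ∀ t → all (λ m → does (0ℚ ℚ.≤? t m)) ≡
               0ℚ ≤ₘ minOver (isPos ∘ part) (ratio t) ∧ (0ℚ ≤ₘ minOver (isNeg ∘ part) (ratio t) ∧ restOK t)
  nonneg-min t = begin
    all (λ m → does (0ℚ ℚ.≤? t m))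
      ≡⟨ all-cong (λ m → split m (part m) refl) ⟩
    all (λ m → posNonneg m ∧ (negNonneg m ∧ restNonneg m))
      ≡⟨ trans (all-∧ posNonneg _) (cong (all posNonneg ∧_) (all-∧ negNonneg restNonneg)) ⟩
    all posNonneg ∧ (all negNonneg ∧ restOK t)
      ≡⟨ cong₂ (λ u v → u ∧ (v ∧ restOK t)) (all-≤⇔≤-minOver (isPos ∘ part) (ratio t) 0ℚ) (all-≤⇔≤-minOver (isNeg ∘ part) (ratio t) 0ℚ) ⟩
    0ℚ ≤ₘ minOver (isPos ∘ part) (ratio t) ∧ (0ℚ ≤ₘ minOver (isNeg ∘ part) (ratio t) ∧ restOK t) ∎
    where
    open ≡-Reasoning
    posNonneg negNonneg restNonneg : Fin n → Bool
    posNonneg  m = if isPos (part m) then does (0ℚ ℚ.≤? ratio t m) else true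
    negNonneg  m = if isNeg (part m) then does (0ℚ ℚ.≤? ratio t m) else true
    restNonneg m = if isRest (part m) then does (0ℚ ℚ.≤? t m) else true
    ratio-≤ : ∀ m → 0ℚ ℚ.< p m → does (0ℚ ℚ.≤? t m) ≡ does (0ℚ ℚ.≤? ratio t m)
    ratio-≤ m pₘ>0 = sym (scaled-≤ (t m) (recip-pos pₘ>0))
    split : ∀ m x → part m ≡ x → does (0ℚ ℚ.≤? t m) ≡ posNonneg m ∧ (negNonneg m ∧ restNonneg m)
    split m pos m∈pos = trans (ratio-≤ m (p>0-at m∈pos λ ()))
      (sym (trans (cong₂ _∧_ (if-true (cong isPos m∈pos)) (cong₂ _∧_ (if-false (cong isNeg m∈pos)) (if-false (cong isRest m∈pos)))) (Bool.∧-identityʳ _)))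
    split m neg m∈neg = trans (ratio-≤ m (p>0-at m∈neg λ ()))
      (sym (trans (cong₂ _∧_ (if-false (cong isPos m∈neg)) (cong₂ _∧_ (if-true (cong isNeg m∈neg)) (if-false (cong isRest m∈neg)))) (Bool.∧-identityʳ _)))
    split m rest m∈rest =
      sym (cong₂ _∧_ (if-false (cong isPos m∈rest)) (cong₂ _∧_ (if-false (cong isNeg m∈rest)) (if-true (cong isRest m∈rest))))

cornerAt : Maybe ℚ → Maybe ℚ → ℤ
cornerAt nothing  m = 0ℤ
cornerAt (just A) m = indicator (does (0ℚ ℚ.≤? A)) ℤ.* indicator ((- A) ≤ₘ m)

-- [t ≥ 0] − Σ_l [x ∈ K_l], as a function of the minima of the ratios over pos and over neg
excess : Maybe ℚ → Maybe ℚ → ℤ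
excess mP mN = indicator (0ℚ ≤ₘ mP ∧ 0ℚ ≤ₘ mN) ℤ.- (cornerAt mP mN ℤ.+ cornerAt mN mP)

-A≤B⇔0≤A+B : ∀ A B → does (- A ℚ.≤? B) ≡ does (0ℚ ℚ.≤? A + B)
-A≤B⇔0≤A+B A B = does-⇔ (mk⇔ to from) (- A ℚ.≤? B) (0ℚ ℚ.≤? A + B)
  where
  to : - A ℚ.≤ B → 0ℚ ℚ.≤ A + B
  to h = subst₂ ℚ._≤_ (ℚ.+-inverseˡ A) (ℚ.+-comm B A) (ℚ.+-monoˡ-≤ A h)
  from : 0ℚ ℚ.≤ A + B → - A ℚ.≤ B
  from h = subst₂ ℚ._≤_ (ℚ.+-identityˡ (- A)) (solve 2 (λ A B → A :+ B :+ (:- A) := B) refl A B) (ℚ.+-monoˡ-≤ (- A) h)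

excess-just : ∀ A B → excess (just A) (just B) ≡ ℤ.- indicator (does (0ℚ ℚ.≤? A + B))
excess-just A B = trans
  (cong₂ (λ u v → indicator (does (0ℚ ℚ.≤? A) ∧ does (0ℚ ℚ.≤? B)) ℤ.- (indicator (does (0ℚ ℚ.≤? A)) ℤ.* indicator u ℤ.+ indicator (does (0ℚ ℚ.≤? B)) ℤ.* indicator v))
    (-A≤B⇔0≤A+B A B) (trans (-A≤B⇔0≤A+B B A) (cong (λ q → does (0ℚ ℚ.≤? q)) (ℚ.+-comm B A))))
  (by-cases (0ℚ ℚ.≤? A) (0ℚ ℚ.≤? B) (0ℚ ℚ.≤? A + B))
  where
  by-cases : (A≥0 : Dec (0ℚ ℚ.≤ A)) (B≥0 : Dec (0ℚ ℚ.≤ B)) (A+B≥0 : Dec (0ℚ ℚ.≤ A + B)) →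
    indicator (does A≥0 ∧ does B≥0) ℤ.- (indicator (does A≥0) ℤ.* indicator (does A+B≥0) ℤ.+ indicator (does B≥0) ℤ.* indicator (does A+B≥0))
      ≡ ℤ.- indicator (does A+B≥0)
  by-cases (yes A≥0) (yes B≥0) (no A+B≱0)  = ⊥-elim (A+B≱0 (ℚ.+-mono-≤ A≥0 B≥0))
  by-cases (no A≱0)  (no B≱0)  (yes A+B≥0) = ⊥-elim (ℚ.<-irrefl refl (ℚ.≤-<-trans A+B≥0 (ℚ.+-mono-< (ℚ.≰⇒> A≱0) (ℚ.≰⇒> B≱0))))
  by-cases (yes _) (yes _) (yes _) = refl
  by-cases (yes _) (no _)  (yes _) = refl
  by-cases (yes _) (no _)  (no _)  = refl
  by-cases (no _)  (yes _) (yes _) = refl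
  by-cases (no _)  (yes _) (no _)  = refl
  by-cases (no _)  (no _)  (no _)  = refl

excess-shift : ∀ mP mN ν → excess (Maybe.map (_+ (- ν)) mP) (Maybe.map (_+ ν) mN) ≡ excess mP mN
excess-shift nothing  nothing  ν = refl
excess-shift (just A) nothing  ν = trans (vanishes (does (0ℚ ℚ.≤? A + - ν))) (sym (vanishes (does (0ℚ ℚ.≤? A))))
  where
  vanishes : ∀ b → indicator (b ∧ true) ℤ.- (indicator b ℤ.* 1ℤ ℤ.+ 0ℤ) ≡ 0ℤ
  vanishes true  = refl
  vanishes false = refl
excess-shift nothing  (just B) ν = trans (vanishes (does (0ℚ ℚ.≤? B + ν))) (sym (vanishes (does (0ℚ ℚ.≤? B))))
  where
  vanishes : ∀ b → indicator (true ∧ b) ℤ.- (0ℤ ℤ.+ indicator b ℤ.* 1ℤ) ≡ 0ℤ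
  vanishes true  = refl
  vanishes false = refl
excess-shift (just A) (just B) ν = begin
  excess (just (A + - ν)) (just (B + ν))                 ≡⟨ excess-just (A + - ν) (B + ν) ⟩
  ℤ.- indicator (does (0ℚ ℚ.≤? (A + - ν) + (B + ν)))     ≡⟨ cong (λ q → ℤ.- indicator (does (0ℚ ℚ.≤? q))) (solve 3 (λ A B ν → A :+ (:- ν) :+ (B :+ ν) := A :+ B) refl A B ν) ⟩
  ℤ.- indicator (does (0ℚ ℚ.≤? A + B))                   ≡⟨ excess-just A B ⟨
  excess (just A) (just B)                               ∎
  where open ≡-Reasoning

swap : Part → Part
swap pos  = neg
swap neg  = pos
swap rest = rest

swap-rest : ∀ x → x ≡ rest → swap x ≡ rest
swap-rest rest _ = refl

isCone : Part → Bool
isCone rest = false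
isCone _    = true

isFirstMin-cong : ∀ {n} {sel sel′ : Fin n → Bool} → (∀ l → sel l ≡ sel′ l) → ∀ a i → isFirstMin sel a i ≡ isFirstMin sel′ a i
isFirstMin-cong sel≗sel′ a i = cong₂ _∧_ (sel≗sel′ i) (all-cong λ l → cong (λ b → if b then _ else true) (sel≗sel′ l))

minOver-cong : ∀ {n} {sel sel′ : Fin n → Bool} → (∀ l → sel l ≡ sel′ l) → ∀ a → minOver sel a ≡ minOver sel′ a
minOver-cong {zero}  sel≗sel′ a = refl
minOver-cong {suc n} sel≗sel′ a rewrite sel≗sel′ zero | minOver-cong (sel≗sel′ ∘ suc) (a ∘ suc) = refl

isPos-swap : ∀ x → isPos (swap x) ≡ isNeg x
isPos-swap pos  = refl
isPos-swap neg  = refl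
isPos-swap rest = refl

isNeg-swap : ∀ x → isNeg (swap x) ≡ isPos x
isNeg-swap pos  = refl
isNeg-swap neg  = refl
isNeg-swap rest = refl

isRest-swap : ∀ x → isRest (swap x) ≡ isRest x
isRest-swap pos  = refl
isRest-swap neg  = refl
isRest-swap rest = refl

excess-restricted : ∀ b mP mN →
  indicator (0ℚ ≤ₘ mP ∧ (0ℚ ≤ₘ mN ∧ b))
    ℤ.- (Maybe.maybe (λ q → indicator (does (0ℚ ℚ.≤? q) ∧ ((- q) ≤ₘ mN ∧ b))) 0ℤ mP
         ℤ.+ Maybe.maybe (λ q → indicator (does (0ℚ ℚ.≤? q) ∧ ((- q) ≤ₘ mP ∧ b))) 0ℤ mN)
  ≡ indicator b ℤ.* excess mP mN
excess-restricted false mP mN = begin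
  indicator (0ℚ ≤ₘ mP ∧ (0ℚ ≤ₘ mN ∧ false)) ℤ.- (corner mP mN ℤ.+ corner mN mP)
    ≡⟨ cong₂ (λ u v → indicator u ℤ.- v) (trans (cong (0ℚ ≤ₘ mP ∧_) (Bool.∧-zeroʳ _)) (Bool.∧-zeroʳ _)) (cong₂ ℤ._+_ (corner≡0 mP mN) (corner≡0 mN mP)) ⟩
  0ℤ ℤ.- 0ℤ ∎
  where
  open ≡-Reasoning
  corner : Maybe ℚ → Maybe ℚ → ℤ
  corner m m′ = Maybe.maybe (λ q → indicator (does (0ℚ ℚ.≤? q) ∧ ((- q) ≤ₘ m′ ∧ false))) 0ℤ m
  corner≡0 : ∀ m m′ → corner m m′ ≡ 0ℤ
  corner≡0 nothing  m′ = refl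
  corner≡0 (just q) m′ = cong indicator (trans (cong (does (0ℚ ℚ.≤? q) ∧_) (Bool.∧-zeroʳ _)) (Bool.∧-zeroʳ _))
excess-restricted true mP mN =
  trans (cong₂ (λ u v → indicator u ℤ.- v) (cong (0ℚ ≤ₘ mP ∧_) (Bool.∧-identityʳ _)) (cong₂ ℤ._+_ (corner≡ mP mN) (corner≡ mN mP)))
        (sym (ℤ.*-identityˡ _))
  where
  corner≡ : ∀ m m′ → Maybe.maybe (λ q → indicator (does (0ℚ ℚ.≤? q) ∧ ((- q) ≤ₘ m′ ∧ true))) 0ℤ m ≡ cornerAt m m′
  corner≡ nothing  m′ = refl
  corner≡ (just q) m′ = trans (cong (λ z → indicator (does (0ℚ ℚ.≤? q) ∧ z)) (Bool.∧-identityʳ _)) (indicator-∧ (does (0ℚ ℚ.≤? q)) ((- q) ≤ₘ m′))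

module LineInvariance {n} (part : Fin n → Part) (p : Fin n → ℚ) (p>0 : ∀ l → part l ≢ rest → 0ℚ ℚ.< p l) where
  module Pos = ReplacedCone part p p>0
  module Neg = ReplacedCone (swap ∘ part) p (λ l l∉rest → p>0 l (l∉rest ∘ swap-rest (part l)))
  open Pos using (g; ratio; restOK)

  coneTest : Fin n → (Fin n → ℚ) → Bool
  coneTest l t = if isPos (part l) then Pos.replacedCone? l t else Neg.replacedCone? l t

  pointExcess : (Fin n → ℚ) → ℤ
  pointExcess t = indicator (all (λ m → does (0ℚ ℚ.≤? t m))) ℤ.- ℤΣ.sum (λ l → if isCone (part l) then indicator (coneTest l t) else 0ℤ)

  minPos minNeg : (Fin n → ℚ) → Maybe ℚ
  minPos t = minOver (isPos ∘ part) (ratio t)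
  minNeg t = minOver (isNeg ∘ part) (ratio t)

  corner⁺ corner⁻ : (Fin n → ℚ) → ℚ → Bool
  corner⁺ t q = does (0ℚ ℚ.≤? q) ∧ ((- q) ≤ₘ minNeg t ∧ restOK t)
  corner⁻ t q = does (0ℚ ℚ.≤? q) ∧ ((- q) ≤ₘ minPos t ∧ restOK t)

  Neg-restOK : ∀ t → Neg.restOK t ≡ restOK t
  Neg-restOK t = all-cong λ m → cong (λ b → if b then does (0ℚ ℚ.≤? t m) else true) (isRest-swap (part m))

  ConeSplit : (Fin n → ℚ) → Fin n → Set
  ConeSplit t l = (if isCone (part l) then indicator (coneTest l t) else 0ℤ) ≡
    indicator (isFirstMin (isPos ∘ part) (ratio t) l) ℤ.* indicator (corner⁺ t (ratio t l))
      ℤ.+ indicator (isFirstMin (isNeg ∘ part) (ratio t) l) ℤ.* indicator (corner⁻ t (ratio t l))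

  not-firstMin : ∀ sel t l z → sel l ≡ false → indicator (isFirstMin sel (ratio t) l) ℤ.* z ≡ 0ℤ
  not-firstMin sel t l z sel≡false = cong (λ b → indicator (b ∧ rest-of-test) ℤ.* z) sel≡false
    where
    rest-of-test : Bool
    rest-of-test = all (λ m → if sel m then (if does (toℕ m ℕ.<? toℕ l) then does (ratio t l ℚ.<? ratio t m) else does (ratio t l ℚ.≤? ratio t m)) else true)

  split-pos : ∀ t {l} → part l ≡ pos → ConeSplit t l
  split-pos t {l} l∈pos = begin
    (if isCone (part l) then indicator (coneTest l t) else 0ℤ)
      ≡⟨ trans (if-true (cong isCone l∈pos)) (cong indicator (if-true (cong isPos l∈pos))) ⟩
    indicator (Pos.replacedCone? l t)
      ≡⟨ cong indicator (Pos.replacedCone?-firstMin l l∈pos t) ⟩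
    indicator (isFirstMin (isPos ∘ part) (ratio t) l ∧ corner⁺ t (ratio t l))
      ≡⟨ indicator-∧ (isFirstMin (isPos ∘ part) (ratio t) l) (corner⁺ t (ratio t l)) ⟩
    indicator (isFirstMin (isPos ∘ part) (ratio t) l) ℤ.* indicator (corner⁺ t (ratio t l))
      ≡⟨ trans (cong (λ z → indicator (isFirstMin (isPos ∘ part) (ratio t) l) ℤ.* indicator (corner⁺ t (ratio t l)) ℤ.+ z)
                     (not-firstMin (isNeg ∘ part) t l (indicator (corner⁻ t (ratio t l))) (cong isNeg l∈pos)))
               (ℤ.+-identityʳ _) ⟨
    indicator (isFirstMin (isPos ∘ part) (ratio t) l) ℤ.* indicator (corner⁺ t (ratio t l))
      ℤ.+ indicator (isFirstMin (isNeg ∘ part) (ratio t) l) ℤ.* indicator (corner⁻ t (ratio t l)) ∎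
    where open ≡-Reasoning

  split-neg : ∀ t {l} → part l ≡ neg → ConeSplit t l
  split-neg t {l} l∈neg = begin
    (if isCone (part l) then indicator (coneTest l t) else 0ℤ)
      ≡⟨ trans (if-true (cong isCone l∈neg)) (cong indicator (if-false (cong isPos l∈neg))) ⟩
    indicator (Neg.replacedCone? l t)
      ≡⟨ cong indicator (Neg.replacedCone?-firstMin l (cong swap l∈neg) t) ⟩
    indicator (isFirstMin (isPos ∘ swap ∘ part) (ratio t) l ∧ (does (0ℚ ℚ.≤? ratio t l)
               ∧ ((- ratio t l) ≤ₘ minOver (isNeg ∘ swap ∘ part) (ratio t) ∧ Neg.restOK t)))
      ≡⟨ cong₂ (λ u v → indicator (u ∧ v))
           (isFirstMin-cong (isPos-swap ∘ part) (ratio t) l)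
           (cong₂ (λ u v → does (0ℚ ℚ.≤? ratio t l) ∧ ((- ratio t l) ≤ₘ u ∧ v)) (minOver-cong (isNeg-swap ∘ part) (ratio t)) (Neg-restOK t)) ⟩
    indicator (isFirstMin (isNeg ∘ part) (ratio t) l ∧ corner⁻ t (ratio t l))
      ≡⟨ indicator-∧ (isFirstMin (isNeg ∘ part) (ratio t) l) (corner⁻ t (ratio t l)) ⟩
    indicator (isFirstMin (isNeg ∘ part) (ratio t) l) ℤ.* indicator (corner⁻ t (ratio t l))
      ≡⟨ trans (cong (λ z → z ℤ.+ indicator (isFirstMin (isNeg ∘ part) (ratio t) l) ℤ.* indicator (corner⁻ t (ratio t l)))
                     (not-firstMin (isPos ∘ part) t l (indicator (corner⁺ t (ratio t l))) (cong isPos l∈neg)))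
               (ℤ.+-identityˡ _) ⟨
    indicator (isFirstMin (isPos ∘ part) (ratio t) l) ℤ.* indicator (corner⁺ t (ratio t l))
      ℤ.+ indicator (isFirstMin (isNeg ∘ part) (ratio t) l) ℤ.* indicator (corner⁻ t (ratio t l)) ∎
    where open ≡-Reasoning

  split-rest : ∀ t {l} → part l ≡ rest → ConeSplit t l
  split-rest t {l} l∈rest = trans (if-false (cong isCone l∈rest))
    (sym (cong₂ ℤ._+_ (not-firstMin (isPos ∘ part) t l (indicator (corner⁺ t (ratio t l))) (cong isPos l∈rest)) (not-firstMin (isNeg ∘ part) t l (indicator (corner⁻ t (ratio t l))) (cong isNeg l∈rest))))

  coneTest-split : ∀ t l → ConeSplit t l
  coneTest-split t l = by-cases (part l) refl
    where
    by-cases : ∀ x → part l ≡ x → ConeSplit t l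
    by-cases pos  l∈ = split-pos t l∈
    by-cases neg  l∈ = split-neg t l∈
    by-cases rest l∈ = split-rest t l∈

  pointExcess-formula : ∀ t → pointExcess t ≡ indicator (restOK t) ℤ.* excess (minPos t) (minNeg t)
  pointExcess-formula t = begin
    indicator (all (λ m → does (0ℚ ℚ.≤? t m))) ℤ.- ℤΣ.sum (λ l → if isCone (part l) then indicator (coneTest l t) else 0ℤ)
      ≡⟨ cong₂ (λ u v → indicator u ℤ.- v) (Pos.nonneg-min t) (trans (ℤΣ.sum-cong-≗ (coneTest-split t)) (ℤΣ.∑-distrib-+ (λ l → indicator (isFirstMin (isPos ∘ part) (ratio t) l) ℤ.* indicator (corner⁺ t (ratio t l))) (λ l → indicator (isFirstMin (isNeg ∘ part) (ratio t) l) ℤ.* indicator (corner⁻ t (ratio t l))))) ⟩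
    indicator (0ℚ ≤ₘ minPos t ∧ (0ℚ ≤ₘ minNeg t ∧ restOK t))
      ℤ.- (ℤΣ.sum (λ l → indicator (isFirstMin (isPos ∘ part) (ratio t) l) ℤ.* indicator (corner⁺ t (ratio t l)))
           ℤ.+ ℤΣ.sum (λ l → indicator (isFirstMin (isNeg ∘ part) (ratio t) l) ℤ.* indicator (corner⁻ t (ratio t l))))
      ≡⟨ cong (λ v → indicator (0ℚ ≤ₘ minPos t ∧ (0ℚ ≤ₘ minNeg t ∧ restOK t)) ℤ.- v)
              (cong₂ ℤ._+_ (sum-firstMin (isPos ∘ part) (ratio t) (indicator ∘ corner⁺ t))
                           (sum-firstMin (isNeg ∘ part) (ratio t) (indicator ∘ corner⁻ t))) ⟩
    indicator (0ℚ ≤ₘ minPos t ∧ (0ℚ ≤ₘ minNeg t ∧ restOK t))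
      ℤ.- (Maybe.maybe (indicator ∘ corner⁺ t) 0ℤ (minPos t) ℤ.+ Maybe.maybe (indicator ∘ corner⁻ t) 0ℤ (minNeg t))
      ≡⟨ excess-restricted (restOK t) (minPos t) (minNeg t) ⟩
    indicator (restOK t) ℤ.* excess (minPos t) (minNeg t) ∎
    where open ≡-Reasoning

  module _ (μ : ℚ) {t t′ : Fin n → ℚ} (t′≡ : ∀ m → t′ m ≡ t m + (- μ) * g m) where

    shifted-ratio : ∀ m c → 0ℚ ℚ.< p m → (- μ) * g m ≡ c * p m → ratio t′ m ≡ ratio t m + c
    shifted-ratio m c pₘ>0 shift≡ = begin
      recip (p m) * t′ m                          ≡⟨ cong (recip (p m) *_) (trans (t′≡ m) (cong (t m +_) shift≡)) ⟩
      recip (p m) * (t m + c * p m)               ≡⟨ solve 4 (λ r x c q → r :* (x :+ c :* q) := r :* x :+ c :* (r :* q)) refl (recip (p m)) (t m) c (p m) ⟩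
      ratio t m + c * (recip (p m) * p m)         ≡⟨ cong (λ z → ratio t m + c * z) (recip-inverseˡ (λ pₘ≡0 → ℚ.<-irrefl (sym pₘ≡0) pₘ>0)) ⟩
      ratio t m + c * 1ℚ                          ≡⟨ cong (ratio t m +_) (ℚ.*-identityʳ c) ⟩
      ratio t m + c                               ∎
      where open ≡-Reasoning

    minPos-shift : minPos t′ ≡ Maybe.map (_+ (- μ)) (minPos t)
    minPos-shift = minOver-shift (isPos ∘ part) (ratio t) (ratio t′) (- μ) (λ m m∈pos → pos-case m (part m) refl m∈pos)
      where
      pos-case : ∀ m x → part m ≡ x → isPos x ≡ true → ratio t′ m ≡ ratio t m + (- μ)
      pos-case m pos m∈pos _ = shifted-ratio m (- μ) (Pos.p>0-at m∈pos λ ()) (cong (λ x → (- μ) * signed x (p m)) m∈pos)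
      pos-case m neg _ ()
      pos-case m rest _ ()

    minNeg-shift : minNeg t′ ≡ Maybe.map (_+ μ) (minNeg t)
    minNeg-shift = minOver-shift (isNeg ∘ part) (ratio t) (ratio t′) μ (λ m m∈neg → neg-case m (part m) refl m∈neg)
      where
      neg-case : ∀ m x → part m ≡ x → isNeg x ≡ true → ratio t′ m ≡ ratio t m + μ
      neg-case m neg m∈neg _ = shifted-ratio m μ (Pos.p>0-at m∈neg λ ())
        (trans (cong (λ x → (- μ) * signed x (p m)) m∈neg) (solve 2 (λ a q → (:- a) :* (:- q) := a :* q) refl μ (p m)))
      neg-case m pos _ ()
      neg-case m rest _ ()

    restOK-shift : restOK t′ ≡ restOK t
    restOK-shift = all-cong λ m → rest-case m (part m) refl
      where
      rest-case : ∀ m x → part m ≡ x → (if isRest (part m) then does (0ℚ ℚ.≤? t′ m) else true) ≡ (if isRest (part m) then does (0ℚ ℚ.≤? t m) else true)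
      rest-case m rest m∈rest = cong (λ q → if isRest (part m) then does (0ℚ ℚ.≤? q) else true)
        (trans (t′≡ m) (trans (cong (λ x → t m + (- μ) * signed x (p m)) m∈rest) (solve 2 (λ x a → x :+ (:- a) :* con 0ℚ := x) refl (t m) μ)))
      rest-case m pos m∈pos = trans (if-false (cong isRest m∈pos)) (sym (if-false (cong isRest m∈pos)))
      rest-case m neg m∈neg = trans (if-false (cong isRest m∈neg)) (sym (if-false (cong isRest m∈neg)))

    pointExcess-shift : pointExcess t′ ≡ pointExcess t
    pointExcess-shift = begin
      pointExcess t′                                               ≡⟨ pointExcess-formula t′ ⟩
      indicator (restOK t′) ℤ.* excess (minPos t′) (minNeg t′)      ≡⟨ cong₂ (λ u v → indicator u ℤ.* v) restOK-shift (cong₂ excess minPos-shift minNeg-shift) ⟩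
      indicator (restOK t) ℤ.* excess (Maybe.map (_+ (- μ)) (minPos t)) (Maybe.map (_+ μ) (minNeg t))
                                                                   ≡⟨ cong (indicator (restOK t) ℤ.*_) (excess-shift (minPos t) (minNeg t) μ) ⟩
      indicator (restOK t) ℤ.* excess (minPos t) (minNeg t)         ≡⟨ pointExcess-formula t ⟨
      pointExcess t                                                ∎
      where open ≡-Reasoning

classify : ℕ → ℕ → ℕ → Part
classify k r m = if ⌊ m ℕ.<? k ⌋ then pos else if ⌊ m ℕ.<? r ⌋ then neg else rest

gammaCoeff≡signed : ∀ {n} k r (p : Fin n → ℚ) l → gammaCoeff k r p l ≡ signed (classify k r (toℕ l)) (p l)
gammaCoeff≡signed k r p l with ⌊ toℕ l ℕ.<? k ⌋ | ⌊ toℕ l ℕ.<? r ⌋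
... | true  | _     = refl
... | false | true  = refl
... | false | false = refl

module _ {k r : ℕ} (k≤r : k ≤ r) where

  classify-before : ∀ {m} → m < k → classify k r m ≡ pos
  classify-before {m} m<k = if-true (⌊⌋-true (m ℕ.<? k) m<k)

  classify-between : ∀ {m} → k ≤ m → m < r → classify k r m ≡ neg
  classify-between {m} k≤m m<r = trans (if-false (⌊⌋-false (m ℕ.<? k) (ℕ.≤⇒≯ k≤m))) (if-true (⌊⌋-true (m ℕ.<? r) m<r))

  classify-after : ∀ {m} → r ≤ m → classify k r m ≡ rest
  classify-after {m} r≤m = trans (if-false (⌊⌋-false (m ℕ.<? k) (ℕ.≤⇒≯ (ℕ.≤-trans k≤r r≤m)))) (if-false (⌊⌋-false (m ℕ.<? r) (ℕ.≤⇒≯ r≤m)))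

  classify≢rest⇒< : ∀ {m} → classify k r m ≢ rest → m < r
  classify≢rest⇒< m∉rest = ℕ.≰⇒> (m∉rest ∘ classify-after)

  <⇒classify≢rest : ∀ {m} → m < r → classify k r m ≢ rest
  <⇒classify≢rest {m} m<r with m ℕ.<? k
  ... | yes _ = λ ()
  ... | no _ rewrite ⌊⌋-true (m ℕ.<? r) m<r = λ ()

  isCone-classify : ∀ m → isCone (classify k r m) ≡ ⌊ m ℕ.<? r ⌋
  isCone-classify m with m ℕ.<? k | m ℕ.<? r
  ... | yes m<k | yes _   = refl
  ... | yes m<k | no m≮r  = ⊥-elim (m≮r (ℕ.<-≤-trans m<k k≤r))
  ... | no _    | yes m<r = refl
  ... | no _    | no _    = refl

  strict-before : ∀ {n} (i m : Fin n) → toℕ i < k →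
                  ⌊ toℕ m ℕ.<? toℕ i ⌋ ≡ isPos (classify k r (toℕ m)) ∧ does (toℕ m ℕ.<? toℕ i)
  strict-before i m i<k with toℕ m ℕ.<? toℕ i
  ... | yes m<i = sym (cong₂ _∧_ (cong isPos (classify-before (ℕ.<-trans m<i i<k))) (dec-true (toℕ m ℕ.<? toℕ i) m<i))
  ... | no m≮i  = sym (trans (cong (isPos (classify k r (toℕ m)) ∧_) (dec-false (toℕ m ℕ.<? toℕ i) m≮i)) (Bool.∧-zeroʳ _))

  strict-between : ∀ {n} (i m : Fin n) → toℕ i < r →
                   ⌊ k ℕ.≤? toℕ m ⌋ ∧ ⌊ toℕ m ℕ.<? toℕ i ⌋ ≡ isPos (swap (classify k r (toℕ m))) ∧ does (toℕ m ℕ.<? toℕ i)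
  strict-between i m i<r with toℕ m ℕ.<? toℕ i
  ... | no m≮i  = trans (Bool.∧-zeroʳ _) (sym (trans (cong (isPos (swap (classify k r (toℕ m))) ∧_) (dec-false (toℕ m ℕ.<? toℕ i) m≮i)) (Bool.∧-zeroʳ _)))
  ... | yes m<i with k ℕ.≤? toℕ m
  ...   | yes k≤m = sym (cong₂ _∧_ (cong (isPos ∘ swap) (classify-between k≤m (ℕ.<-trans m<i i<r))) (dec-true (toℕ m ℕ.<? toℕ i) m<i))
  ...   | no k≰m  = sym (cong₂ _∧_ (cong (isPos ∘ swap) (classify-before (ℕ.≰⇒> k≰m))) (dec-true (toℕ m ℕ.<? toℕ i) m<i))

signed-≢0 : ∀ x {q} → x ≢ rest → 0ℚ ℚ.< q → signed x q ≢ 0ℚ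
signed-≢0 pos  _       q>0 q≡0  = ℚ.<-irrefl (sym q≡0) q>0
signed-≢0 neg  _       q>0 -q≡0 = ℚ.<-irrefl (sym (trans (solve 1 (λ q → q := :- (:- q)) refl _) (cong -_ -q≡0))) q>0
signed-≢0 rest x≢rest  _   _    = x≢rest refl

neg-signed : ∀ x q → - signed x q ≡ signed (swap x) q
neg-signed pos  q = refl
neg-signed neg  q = solve 1 (λ q → :- (:- q) := q) refl q
neg-signed rest q = refl

module Decomposition {n d} (α : Fin (suc n) → Vec ℚ d) (indep : LinIndep α)
                     (r : ℕ) (1≤r : 1 ≤ r) (k : ℕ) (k≤r : k ≤ r)
                     (p : Fin (suc n) → ℚ) (p>0 : ∀ l → toℕ l < r → 0ℚ ℚ.< p l) where

  B : Fin (suc n) → LinearForm d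
  B = proj₁ (biorthogonal-exists α indep)

  biα : Biorthogonal α B
  biα = proj₂ (biorthogonal-exists α indep)

  module A = Span α B biα

  part : Fin (suc n) → Part
  part l = classify k r (toℕ l)

  open LineInvariance part p (λ l l∉rest → p>0 l (classify≢rest⇒< k≤r l∉rest)) public

  γ-coeff : Fin (suc n) → ℚ
  γ-coeff = gammaCoeff k r p

  γ-coeff≢0 : ∀ l → toℕ l < r → γ-coeff l ≢ 0ℚ
  γ-coeff≢0 l l<r = subst (_≢ 0ℚ) (sym (gammaCoeff≡signed k r p l)) (signed-≢0 (part l) (<⇒classify≢rest k≤r l<r) (p>0 l l<r))

  module K = RationalCone α B biα

  unstrict : Fin (suc n) → Bool
  unstrict _ = false

  P₀ Q₀ : LPoly d
  P₀ = K.numerator unstrict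
  Q₀ = K.denominator

  s₀ : Series d
  s₀ = proj₁ (proj₂ (K.isGF unstrict))

  s₀≡ : ∀ e → s₀ e ≡ indicator (⌊ A.inSpan? (toℚv e) ⌋ ∧ all (λ m → does (0ℚ ℚ.≤? A.coord (toℚv e) m)))
  s₀≡ e = indicatorSeries (proj₁ (proj₂ (proj₂ (K.isGF unstrict)))) e _
            (A.inCone?-sound unstrict (toℚv e)) (A.inCone?-complete unstrict (toℚv e))

  -- ±γ, whichever has positive first α-coordinate, so that positiveForm applies
  sign : ℚ
  sign = if ⌊ 0 ℕ.<? k ⌋ then 1ℚ else - 1ℚ

  h : Fin (suc n) → ℚ
  h l = sign * Pos.g l

  h₀>0 : 0ℚ ℚ.< h zero
  h₀>0 = by-sign (0 ℕ.<? k)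
    where
    by-sign : (0<?k : Dec (0 < k)) → 0ℚ ℚ.< (if ⌊ 0<?k ⌋ then 1ℚ else - 1ℚ) * Pos.g zero
    by-sign (yes 0<k) = subst (0ℚ ℚ.<_) (sym (trans (ℚ.*-identityˡ (Pos.g zero)) (cong (λ x → signed x (p zero)) (classify-before k≤r 0<k))))
                              (p>0 zero 1≤r)
    by-sign (no 0≮k)  = subst (0ℚ ℚ.<_) (sym (trans (cong (λ x → - 1ℚ * signed x (p zero)) (classify-between k≤r (ℕ.≮⇒≥ 0≮k) 1≤r))
                                                    (solve 1 (λ q → (:- con 1ℚ) :* (:- q) := q) refl (p zero))))
                              (p>0 zero 1≤r)

  ψ : LinearForm d
  ψ = proj₁ (positiveForm α B biα h h₀>0)

  N : ℕ
  N = proj₁ (clearDenominators (lincomb h α))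

  u : Exp d
  u = proj₁ (proj₂ (clearDenominators (lincomb h α)))

  u≡ : toℚv u ≡ toℚ (ℤ.+ suc N) ·v lincomb h α
  u≡ = proj₂ (proj₂ (clearDenominators (lincomb h α)))

  ψu>0 : 0ℚ ℚ.< eval ψ (toℚv u)
  ψu>0 = subst (0ℚ ℚ.<_) (sym (trans (cong (eval ψ) u≡) (eval-· ψ (toℚ (ℤ.+ suc N)) (lincomb h α))))
                (0<* (toℚ-suc-pos N) (proj₂ (proj₂ (positiveForm α B biα h h₀>0))))

  ψv>0 : ∀ m → 0ℚ ℚ.< eval ψ (toℚv (K.v m))
  ψv>0 m = subst (0ℚ ℚ.<_) (sym (trans (cong (eval ψ) (K.v≡κw m)) (eval-· ψ (K.κ m) (α m))))
                 (0<* (K.κ>0 m) (proj₁ (proj₂ (positiveForm α B biα h h₀>0)) m))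

  F : RatFun d
  F = binomial u *P P₀ , binomial u *P Q₀

  F-represents : Represents F s₀
  F-represents e = begin
    mulSeries (binomial u *P Q₀) s₀ e               ≡⟨ mulSeries-*P (binomial u) Q₀ s₀ e ⟩
    mulSeries (binomial u) (mulSeries Q₀ s₀) e      ≡⟨ mulSeries-cong (binomial u) (proj₂ (proj₂ (proj₂ (K.isGF unstrict)))) e ⟩
    mulSeries (binomial u) (coeff P₀) e             ≡⟨ coeff-*P (binomial u) P₀ e ⟨
    coeff (binomial u *P P₀) e                      ∎
    where open ≡-Reasoning

  -- multiplying by 1 − y^u keeps the fraction but makes room for the periodicity argument below
  F-isGF : IsGF (LatticePts (Kmain α)) F
  F-isGF = Monic.monic⇒nonZero ψ (binomial u *P Q₀)
             (Monic.*P-monic ψ (binomial u) Q₀ (Monic.binomial-monic ψ u ψu>0) (K.binomials-monic ψ ψv>0 (List.allFin _)))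
         , s₀ , proj₁ (proj₂ (proj₂ (K.isGF unstrict))) , F-represents

  θ⁺ θ⁻ : Fin (suc n) → Fin (suc n) → Bool
  θ⁺ l m = ⌊ toℕ m ℕ.<? toℕ l ⌋
  θ⁻ l m = ⌊ k ℕ.≤? toℕ m ⌋ ∧ ⌊ toℕ m ℕ.<? toℕ l ⌋

  -- Kcone α k r p l unfolds to K-at l (toℕ l <? k)
  K-at : (l : Fin (suc n)) → Dec (toℕ l < k) → Vec ℚ d → Set
  K-at l l<?k = if ⌊ l<?k ⌋ then HCone (replaceCol α l (gamma α k r p)) (θ⁺ l)
                            else HCone (replaceCol α l (-v gamma α k r p)) (θ⁻ l)

  -γ≡ : -v gamma α k r p ≡ lincomb (λ m → - γ-coeff m) α
  -γ≡ = trans (-v≡-1·v (gamma α k r p))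
             (trans (sym (lincomb-· (- 1ℚ) γ-coeff α)) (lincomb-cong {v = α} (λ m → solve 1 (λ x → (:- con 1ℚ) :* x := :- x) refl (γ-coeff m)) (λ _ → refl)))

  module R⁺ (l : Fin (suc n)) (l<r : toℕ l < r) = ColumnReplacement α B biα l γ-coeff (γ-coeff≢0 l l<r)
  module R⁻ (l : Fin (suc n)) (l<r : toℕ l < r) =
    ColumnReplacement α B biα l (λ m → - γ-coeff m) (λ -γₗ≡0 → γ-coeff≢0 l l<r (trans (solve 1 (λ x → x := :- (:- x)) refl (γ-coeff l)) (cong -_ -γₗ≡0)))

  inKₗ? : Fin (suc n) → Vec ℚ d → Bool
  inKₗ? l x = ⌊ A.inSpan? x ⌋ ∧ coneTest l (A.coord x)

  inKₗ?-correct : ∀ l → toℕ l < r → (l<?k : Dec (toℕ l < k)) → ∀ x →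
                  (K-at l l<?k x → inKₗ? l x ≡ true) × (inKₗ? l x ≡ true → K-at l l<?k x)
  inKₗ?-correct l l<r (yes l<k) x = (λ x∈ → trans (sym inCone?≡) (R.W.inCone?-complete (θ⁺ l) x x∈))
                                  , (λ ok → R.W.inCone?-sound (θ⁺ l) x (trans inCone?≡ ok))
    where
    module R = R⁺ l l<r
    inCone?≡ : R.W.inCone? (θ⁺ l) x ≡ inKₗ? l x
    inCone?≡ = trans (R.inCone?-replaced (θ⁺ l) x) (cong (⌊ A.inSpan? x ⌋ ∧_) (trans
      (all-cong λ m → cong₂ admissible (strict-before k≤r l m l<k) (replacedCoord-cong l (gammaCoeff≡signed k r p) (A.coord x) m))
      (sym (if-true (cong isPos (classify-before k≤r l<k))))))
  inKₗ?-correct l l<r (no l≮k) x = (λ x∈ → trans (sym inCone?≡) (R.W.inCone?-complete (θ⁻ l) x (subst (λ v → HCone (replaceCol α l v) (θ⁻ l) x) -γ≡ x∈)))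
                                 , (λ ok → subst (λ v → HCone (replaceCol α l v) (θ⁻ l) x) (sym -γ≡) (R.W.inCone?-sound (θ⁻ l) x (trans inCone?≡ ok)))
    where
    module R = R⁻ l l<r
    inCone?≡ : R.W.inCone? (θ⁻ l) x ≡ inKₗ? l x
    inCone?≡ = trans (R.inCone?-replaced (θ⁻ l) x) (cong (⌊ A.inSpan? x ⌋ ∧_) (trans
      (all-cong λ m → cong₂ admissible (strict-between k≤r l m l<r)
        (replacedCoord-cong l (λ m′ → trans (cong -_ (gammaCoeff≡signed k r p m′)) (neg-signed (part m′) (p m′))) (A.coord x) m))
      (sym (if-false (cong isPos (classify-between k≤r (ℕ.≮⇒≥ l≮k) l<r))))))

  Kₗ-GF : ∀ l → toℕ l < r → (l<?k : Dec (toℕ l < k)) → Σ (RatFun d) (IsGF (LatticePts (K-at l l<?k)))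
  Kₗ-GF l l<r (yes _) = (R.numerator (θ⁺ l) , R.denominator) , R.isGF (θ⁺ l)
    where module R = R⁺ l l<r
  Kₗ-GF l l<r (no _)  = (R.numerator (θ⁻ l) , R.denominator)
                      , subst (λ v → IsGF (LatticePts (HCone (replaceCol α l v) (θ⁻ l))) (R.numerator (θ⁻ l) , R.denominator)) (sym -γ≡) (R.isGF (θ⁻ l))
    where module R = R⁻ l l<r

  G-at : (l : Fin (suc n)) → Dec (toℕ l < r) → RatFun d
  G-at l (yes l<r) = proj₁ (Kₗ-GF l l<r (toℕ l ℕ.<? k))
  G-at l (no _)    = zeroR

  s-at : (l : Fin (suc n)) → Dec (toℕ l < r) → Series d
  s-at l (yes l<r) = proj₁ (proj₂ (proj₂ (Kₗ-GF l l<r (toℕ l ℕ.<? k))))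
  s-at l (no _)    = λ _ → 0ℤ

  G : Fin (suc n) → RatFun d
  G l = G-at l (toℕ l ℕ.<? r)

  sₗ : Fin (suc n) → Series d
  sₗ l = s-at l (toℕ l ℕ.<? r)

  G-isGF : ∀ l → toℕ l < r → IsGF (LatticePts (Kcone α k r p l)) (G l)
  G-isGF l l<r = at (toℕ l ℕ.<? r)
    where
    at : (l<?r : Dec (toℕ l < r)) → IsGF (LatticePts (Kcone α k r p l)) (G-at l l<?r)
    at (yes l<r′) = proj₂ (Kₗ-GF l l<r′ (toℕ l ℕ.<? k))
    at (no l≮r)   = ⊥-elim (l≮r l<r)

  G-represents : ∀ l → ⌊ toℕ l ℕ.<? r ⌋ ≡ true → Represents (G l) (sₗ l)
  G-represents l = at (toℕ l ℕ.<? r)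
    where
    at : (l<?r : Dec (toℕ l < r)) → ⌊ l<?r ⌋ ≡ true → Represents (G-at l l<?r) (s-at l l<?r)
    at (yes l<r) _ = proj₂ (proj₂ (proj₂ (proj₂ (Kₗ-GF l l<r (toℕ l ℕ.<? k)))))

  sₗ≡ : ∀ l → ⌊ toℕ l ℕ.<? r ⌋ ≡ true → ∀ e → sₗ l e ≡ indicator (inKₗ? l (toℚv e))
  sₗ≡ l = at (toℕ l ℕ.<? r)
    where
    at : (l<?r : Dec (toℕ l < r)) → ⌊ l<?r ⌋ ≡ true → ∀ e → s-at l l<?r e ≡ indicator (inKₗ? l (toℚv e))
    at (yes l<r) _ e = indicatorSeries (proj₁ (proj₂ (proj₂ (proj₂ (Kₗ-GF l l<r (toℕ l ℕ.<? k)))))) e _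
      (proj₂ (inKₗ?-correct l l<r (toℕ l ℕ.<? k) (toℚv e))) (proj₁ (inKₗ?-correct l l<r (toℕ l ℕ.<? k) (toℚv e)))

  Σsₗ : Series d
  Σsₗ e = ℤΣ.sum (λ l → if ⌊ toℕ l ℕ.<? r ⌋ then sₗ l e else 0ℤ)

  indicator-factor : ∀ {m} (sel : Fin m → Bool) b X (Y : Fin m → Bool) →
    indicator (b ∧ X) ℤ.- ℤΣ.sum (λ l → if sel l then indicator (b ∧ Y l) else 0ℤ)
      ≡ indicator b ℤ.* (indicator X ℤ.- ℤΣ.sum (λ l → if sel l then indicator (Y l) else 0ℤ))
  indicator-factor sel true  X Y = sym (ℤ.*-identityˡ _)
  indicator-factor {m} sel false X Y = cong (λ z → 0ℤ ℤ.- z) (trans (ℤΣ.sum-cong-≗ (λ l → if-0 (sel l))) (ℤΣ.sum-replicate-zero m))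
    where
    if-0 : ∀ b → (if b then 0ℤ else 0ℤ) ≡ 0ℤ
    if-0 true  = refl
    if-0 false = refl

  difference≡ : ∀ e → s₀ e ℤ.- Σsₗ e ≡ indicator ⌊ A.inSpan? (toℚv e) ⌋ ℤ.* pointExcess (A.coord (toℚv e))
  difference≡ e = begin
    s₀ e ℤ.- Σsₗ e
      ≡⟨ cong₂ ℤ._-_ (s₀≡ e) (ℤΣ.sum-cong-≗ selected) ⟩
    indicator (⌊ A.inSpan? x ⌋ ∧ all (λ m → does (0ℚ ℚ.≤? A.coord x m)))
      ℤ.- ℤΣ.sum (λ l → if isCone (part l) then indicator (⌊ A.inSpan? x ⌋ ∧ coneTest l (A.coord x)) else 0ℤ)
      ≡⟨ indicator-factor (isCone ∘ part) ⌊ A.inSpan? x ⌋ _ (λ l → coneTest l (A.coord x)) ⟩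
    indicator ⌊ A.inSpan? x ⌋ ℤ.* pointExcess (A.coord x) ∎
    where
    open ≡-Reasoning
    x : Vec ℚ d
    x = toℚv e
    selected : ∀ l → (if ⌊ toℕ l ℕ.<? r ⌋ then sₗ l e else 0ℤ) ≡ (if isCone (part l) then indicator (inKₗ? l x) else 0ℤ)
    selected l = by (⌊ toℕ l ℕ.<? r ⌋) refl
      where
      by : ∀ b → ⌊ toℕ l ℕ.<? r ⌋ ≡ b → (if ⌊ toℕ l ℕ.<? r ⌋ then sₗ l e else 0ℤ) ≡ (if isCone (part l) then indicator (inKₗ? l x) else 0ℤ)
      by true  l<r = trans (if-true l<r) (trans (sₗ≡ l l<r e) (sym (if-true (trans (isCone-classify k≤r (toℕ l)) l<r))))
      by false l≮r = trans (if-false l≮r) (sym (if-false (trans (isCone-classify k≤r (toℕ l)) l≮r)))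

  κ : ℚ
  κ = toℚ (ℤ.+ suc N)

  u∈span : A.InSpan (toℚv u)
  u∈span = subst A.InSpan (sym u≡) (A.inSpan-· κ (A.inSpan-lincomb h))

  coord-⊖u : ∀ e m → A.coord (toℚv (e ⊖ u)) m ≡ A.coord (toℚv e) m + (- (κ * sign)) * Pos.g m
  coord-⊖u e m = begin
    A.coord (toℚv (e ⊖ u)) m                          ≡⟨ eval-toℚv-⊖ (B m) e u ⟩
    A.coord (toℚv e) m - eval (B m) (toℚv u)          ≡⟨ cong (λ z → A.coord (toℚv e) m - z) (trans (cong (eval (B m)) u≡) (eval-· (B m) κ _)) ⟩
    A.coord (toℚv e) m - κ * A.coord (lincomb h α) m  ≡⟨ cong (λ z → A.coord (toℚv e) m - κ * z) (A.coord-lincomb h m) ⟩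
    A.coord (toℚv e) m - κ * (sign * Pos.g m)         ≡⟨ solve 4 (λ t κ s g → t :- κ :* (s :* g) := t :+ (:- (κ :* s)) :* g) refl (A.coord (toℚv e) m) κ sign (Pos.g m) ⟩
    A.coord (toℚv e) m + (- (κ * sign)) * Pos.g m     ∎
    where open ≡-Reasoning

  difference-periodic : Periodic u (λ e → s₀ e ℤ.- Σsₗ e)
  difference-periodic e = begin
    s₀ (e ⊖ u) ℤ.- Σsₗ (e ⊖ u)
      ≡⟨ difference≡ (e ⊖ u) ⟩
    indicator ⌊ A.inSpan? (toℚv (e ⊖ u)) ⌋ ℤ.* pointExcess (A.coord (toℚv (e ⊖ u)))
      ≡⟨ cong₂ (λ b z → indicator b ℤ.* z) span≡ (pointExcess-shift (κ * sign) {A.coord (toℚv e)} (coord-⊖u e)) ⟩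
    indicator ⌊ A.inSpan? (toℚv e) ⌋ ℤ.* pointExcess (A.coord (toℚv e))
      ≡⟨ difference≡ e ⟨
    s₀ e ℤ.- Σsₗ e ∎
    where
    open ≡-Reasoning
    e-u≡ : toℚv (e ⊖ u) ≡ toℚv e +v ((- 1ℚ) ·v toℚv u)
    e-u≡ = trans (toℚv-⊖ e u) (cong (toℚv e +v_) (-v≡-1·v (toℚv u)))
    span≡ : ⌊ A.inSpan? (toℚv (e ⊖ u)) ⌋ ≡ ⌊ A.inSpan? (toℚv e) ⌋
    span≡ = ⌊⌋-⇔ (λ e-u∈ → A.inSpan-shift (- 1ℚ) u∈span (subst A.InSpan e-u≡ e-u∈))
                 (λ e∈ → subst A.InSpan (sym e-u≡) (A.inSpan-+ e∈ (A.inSpan-· (- 1ℚ) u∈span)))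
                 (A.inSpan? (toℚv (e ⊖ u))) (A.inSpan? (toℚv e))

  F≈ΣG : F ≈R sumR (λ l → ⌊ toℕ l ℕ.<? r ⌋) G
  F≈ΣG = represents-≈R {F = F} {G = sumR (λ l → ⌊ toℕ l ℕ.<? r ⌋) G} F-represents
           (represents-sumR (λ l → ⌊ toℕ l ℕ.<? r ⌋) G sₗ G-represents) annihilated
    where
    Q : LPoly d
    Q = proj₂ (sumR (λ l → ⌊ toℕ l ℕ.<? r ⌋) G)
    annihilated : ∀ e → mulSeries (binomial u *P Q₀) (mulSeries Q (λ x → s₀ x ℤ.- Σsₗ x)) e ≡ 0ℤ
    annihilated e = trans (mulSeries-*P (binomial u) Q₀ _ e)
      (binomial-annihilates (mulSeries-periodic Q₀ (mulSeries-periodic Q difference-periodic)) e)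

proposition3p4 : ∀ {d n : ℕ} (α : Fin n → Vec ℚ d) → LinIndep α →
    (r : ℕ) → 1 ≤ r → r ≤ n → (k : ℕ) → k ≤ r →
    (p : Fin n → ℚ) → (∀ l → toℕ l < r → 0ℚ ℚ.< p l) →
    Σ (RatFun d) λ F → Σ (Fin n → RatFun d) λ G →
      IsGF (LatticePts (Kmain α)) F
      × (∀ l → toℕ l < r → IsGF (LatticePts (Kcone α k r p l)) (G l))
      × (F ≈R sumR (λ l → ⌊ toℕ l <? r ⌋) G)
-- r ≤ n only matters for n = 0, where it contradicts 1 ≤ r
proposition3p4 {n = zero}  α _     r 1≤r r≤0 _ _   _ _   = ⊥-elim (ℕ.<⇒≱ 1≤r r≤0)
proposition3p4 {n = suc n} α indep r 1≤r _   k k≤r p p>0 = F , G , F-isGF , G-isGF , F≈ΣG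
  where open Decomposition α indep r 1≤r k k≤r p p>0
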